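{- Let $R$ be an HRS and $l\to r\in R$. Then for every substitution $\theta$ and every $t\in\mathit{safe}(l)$: if $l\theta{\downarrow}\in\mathcal T^{args}_{SC}(R)$, then $SC(R,t\theta{\downarrow})$.
   Context: Setting: HRSs à la Nipkow. Simple types are generated from a set $\mathcal B$ of basic types by $\to$. Terms are simply-typed $\lambda$-terms over typed variables $\mathcal V$ and typed function symbols $\Sigma$, always in $\beta$-normal $\eta$-long form; $t{\downarrow}$ is the $\eta$-long $\beta$-normal form of a preterm $t$; $\mathcal T_\alpha$ is the set of terms of type $\alpha$. Terms are up to $\alpha$-equivalence $\equiv$, bound variables pairwise distinct and distinct from free variables. Every term has the form $\lambda x_1\ldots x_m.a(t_1,\ldots,t_n)$ with $a\in\Sigma\cup\mathcal V$; then $top$ of it is $a$ and $args$ of it is $\{t_1,\ldots,t_n\}$. $FV(t)$ is the set of free variables. Subterms: $Sub(\lambda x.s)=\{\lambda x.s\}\cup Sub(s)$, $Sub(a(t_1,\ldots,t_n))=\{a(t_1,\ldots,t_n)\}\cup\bigcup_i Sub(t_i)$. A substitution maps variables to terms of the same type, with finite domain; $t\theta{\downarrow}$ is the normal form of the result of substitution. A rewrite rule is $l\to r$ with $top(l)\in\Sigma$, $type(l)=type(r)\in\mathcal B$, $FV(r)\subseteq FV(l)$; an HRS $R$ is a set of rules; $s\to_R t$ iff $s\equiv C[l\theta{\downarrow}]$, $t\equiv C[r\theta{\downarrow}]$ for some rule, context $C$ and substitution $\theta$. $SN(R,t)$: no infinite $\to_R$-sequence from $t$. Strong computability $SC(R,t)$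 is defined by induction on types: if $type(t)\in\mathcal B$, $SC(R,t)$ iff $SN(R,t)$; if $type(t)=\alpha\to\beta$, $SC(R,t)$ iff $SC(R,(t\,u){\downarrow})$ for every $u\in\mathcal T_\alpha$ with $SC(R,u)$. $\mathcal T^{args}_{SC}(R)=\{t\mid SC(R,u)\text{ for all }u\in args(t)\}$. Stable subterms: $SSub(t)=SSub_{FV(t)}(t)$ with $SSub_X(t)=\{t\}\cup SSub'_X(t)$, $SSub'_X(\lambda x.s)=SSub_X(s)$, $SSub'_X(a(t_1,\ldots,t_n))=\bigcup_i SSub_X(t_i)$ if $a\notin X$, and $SSub'_X(t)=\emptyset$ otherwise. Accessibility: for a term $l'$, the set $Acc(l')$ (of $\beta$-normal preterms, not necessarily $\eta$-long) is inductively defined by: (0) $l'\in Acc(l')$; (1) if $t\in SSub(l')$, $type(t)\in\mathcal B$ and $FV(t)\subseteq FV(l')$ then $t\in Acc(l')$; (2) if $\lambda x.t\in Acc(l')$ and $x\notin FV(l')$ then $t\in Acc(l')$; (3) if $t(x{\downarrow})\in Acc(l')$ and $x\notin FV(t)\cup FV(l')$ then $t\in Acc(l')$; (4) if $f(t_1,\ldots,t_n)\in Acc(l')$ with $f\in\Sigma$, $t_i=\lambda x_1\ldots x_k.t$, $type(t)\in\mathcal B$ and $\{x_1,\ldots,x_k\}\cap FV(t)=\emptyset$, then $t\in Acc(l')$; (5) if $x(t_1,\ldots,t_n)\in Acc(l')$ with $x$ a variable, $t_i=t$ and $x\notin FV(t_1,\ldots,t_n)\cup FV(l')$, then $t\in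 Acc(l')$. Safe subterms: $\mathit{safe}(l)=\bigcup_{l'\in args(l)}\{t{\downarrow}\mid t\in Acc(l'),\ FV(t)\subseteq FV(l')\}$. -}

module Defs where

open import Data.Nat using (ℕ)
open import Data.List using (List; []; _∷_)
open import Data.List.Membership.Propositional using (_∈_)
open import Data.Product using (Σ; _×_; _,_; proj₁; proj₂)
open import Data.Maybe using (Maybe; just; nothing)
open import Data.Unit using (⊤)
open import Relation.Binary.PropositionalEquality using (_≡_)
open import Relation.Nullary using (¬_)
open import Induction.WellFounded using (Acc)

infixr 7 _⇒_
data Ty (B : Set) : Set where
  base : B → Ty B
  _⇒_  : Ty B → Ty B → Ty B

-- Everything below is relative to the basic types B and a typed
-- signature F (F α = the function symbols of type α).

module HRSTheory (B : Set) (F : Ty B → Set) where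

  Type : Set
  Type = Ty B

  -- Contexts of λ-bound variables (de Bruijn; terms are thus identified
  -- up to α-equivalence).
  Ctx : Set
  Ctx = List Type

  data _∋_ : Ctx → Type → Set where
    here  : ∀ {Γ α} → (α ∷ Γ) ∋ α
    there : ∀ {Γ α β} → Γ ∋ α → (β ∷ Γ) ∋ α

  -- The typed variables 𝒱: for every type α, countably many variables
  -- (α , n), n : ℕ.  These are the (named) free variables of terms.
  Var : Set
  Var = Σ Type (λ _ → ℕ)

  -- Possible heads a ∈ Σ ∪ 𝒱 (plus locally bound variables).
  data Head (Γ : Ctx) : Type → Set where
    bv  : ∀ {α} → Γ ∋ α → Head Γ α
    fv  : ∀ {α} → ℕ → Head Γ α
    con : ∀ {α} → F α → Head Γ α

  -- β-normal preterms (not necessarily η-long):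
  --   λx₁…xₘ. a(t₁,…,tₙ)
  mutual
    data Nf (Γ : Ctx) : Type → Set where
      lam : ∀ {α β} → Nf (α ∷ Γ) β → Nf Γ (α ⇒ β)
      ne  : ∀ {α} → Ne Γ α → Nf Γ α

    data Ne (Γ : Ctx) : Type → Set where
      hd  : ∀ {α} → Head Γ α → Ne Γ α
      app : ∀ {α β} → Ne Γ (α ⇒ β) → Nf Γ α → Ne Γ β

  -- η-longness; the *terms* of the paper are the η-long elements of Nf.
  mutual
    data EtaLong {Γ : Ctx} : ∀ {α} → Nf Γ α → Set where
      lam : ∀ {α β} {t : Nf (α ∷ Γ) β} → EtaLong t → EtaLong (lam t)
      ne  : ∀ {b} {n : Ne Γ (base b)} → EtaLongNe n → EtaLong (ne n)

    data EtaLongNe {Γ : Ctx} : ∀ {α} → Ne Γ α → Set where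
      hd  : ∀ {α} {h : Head Γ α} → EtaLongNe (hd h)
      app : ∀ {α β} {n : Ne Γ (α ⇒ β)} {u : Nf Γ α} →
            EtaLongNe n → EtaLong u → EtaLongNe (app n u)

  infixl 9 _·_
  data Tm (Γ : Ctx) : Type → Set where
    `_  : ∀ {α} → Head Γ α → Tm Γ α
    ƛ_  : ∀ {α β} → Tm (α ∷ Γ) β → Tm Γ (α ⇒ β)
    _·_ : ∀ {α β} → Tm Γ (α ⇒ β) → Tm Γ α → Tm Γ β

  mutual
    ⌜_⌝ : ∀ {Γ α} → Nf Γ α → Tm Γ α
    ⌜ lam t ⌝ = ƛ ⌜ t ⌝
    ⌜ ne n ⌝  = ⌜ n ⌝ne

    ⌜_⌝ne : ∀ {Γ α} → Ne Γ α → Tm Γ α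
    ⌜ hd h ⌝ne    = ` h
    ⌜ app n u ⌝ne = ⌜ n ⌝ne · ⌜ u ⌝

  data _⊆_ : Ctx → Ctx → Set where
    done : [] ⊆ []
    keep : ∀ {Γ Δ α} → Γ ⊆ Δ → (α ∷ Γ) ⊆ (α ∷ Δ)
    drop : ∀ {Γ Δ α} → Γ ⊆ Δ → Γ ⊆ (α ∷ Δ)

  ⊆-refl : ∀ {Γ} → Γ ⊆ Γ
  ⊆-refl {[]}    = done
  ⊆-refl {_ ∷ Γ} = keep ⊆-refl

  ⊆-trans : ∀ {Γ Δ Θ} → Γ ⊆ Δ → Δ ⊆ Θ → Γ ⊆ Θ
  ⊆-trans ρ        (drop σ) = drop (⊆-trans ρ σ)
  ⊆-trans done     done     = done
  ⊆-trans (keep ρ) (keep σ) = keep (⊆-trans ρ σ)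
  ⊆-trans (drop ρ) (keep σ) = drop (⊆-trans ρ σ)

  ε⊆ : ∀ {Γ} → [] ⊆ Γ
  ε⊆ {[]}    = done
  ε⊆ {_ ∷ Γ} = drop ε⊆

  renVar : ∀ {Γ Δ α} → Γ ⊆ Δ → Γ ∋ α → Δ ∋ α
  renVar (keep ρ) here      = here
  renVar (keep ρ) (there x) = there (renVar ρ x)
  renVar (drop ρ) x         = there (renVar ρ x)

  renHead : ∀ {Γ Δ α} → Γ ⊆ Δ → Head Γ α → Head Δ α
  renHead ρ (bv x)  = bv (renVar ρ x)
  renHead ρ (fv n)  = fv n
  renHead ρ (con f) = con f

  mutual
    renNf : ∀ {Γ Δ α} → Γ ⊆ Δ → Nf Γ α → Nf Δ α
    renNf ρ (lam t) = lam (renNf (keep ρ) t)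
    renNf ρ (ne n)  = ne (renNe ρ n)

    renNe : ∀ {Γ Δ α} → Γ ⊆ Δ → Ne Γ α → Ne Δ α
    renNe ρ (hd h)    = hd (renHead ρ h)
    renNe ρ (app n u) = app (renNe ρ n) (renNf ρ u)

  renTm : ∀ {Γ Δ α} → Γ ⊆ Δ → Tm Γ α → Tm Δ α
  renTm ρ (` h)   = ` renHead ρ h
  renTm ρ (ƛ t)   = ƛ renTm (keep ρ) t
  renTm ρ (t · u) = renTm ρ t · renTm ρ u

  HSub : Ctx → Ctx → Set
  HSub Γ Δ = ∀ {α} → Γ ∋ α → Head Δ α

  liftHS : ∀ {Γ Δ β} → HSub Γ Δ → HSub (β ∷ Γ) (β ∷ Δ)
  liftHS σ here      = bv here
  liftHS σ (there x) = renHead (drop ⊆-refl) (σ x)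

  hsHead : ∀ {Γ Δ α} → HSub Γ Δ → Head Γ α → Head Δ α
  hsHead σ (bv x)  = σ x
  hsHead σ (fv n)  = fv n
  hsHead σ (con f) = con f

  mutual
    hsNf : ∀ {Γ Δ α} → HSub Γ Δ → Nf Γ α → Nf Δ α
    hsNf σ (lam t) = lam (hsNf (liftHS σ) t)
    hsNf σ (ne n)  = ne (hsNe σ n)

    hsNe : ∀ {Γ Δ α} → HSub Γ Δ → Ne Γ α → Ne Δ α
    hsNe σ (hd h)    = hd (hsHead σ h)
    hsNe σ (app n u) = app (hsNe σ n) (hsNf σ u)

  open0 : ∀ {α β} → Nf (α ∷ []) β → ℕ → Nf [] β
  open0 t n = hsNf (λ { here → fv n ; (there ()) }) t

  -- Normalisation: t↓ = η-long β-normal form of a preterm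
  -- (normalisation by evaluation).

  Sem : Type → Ctx → Set
  Sem (base b) Γ = Ne Γ (base b)
  Sem (α ⇒ β)  Γ = ∀ {Δ} → Γ ⊆ Δ → Sem α Δ → Sem β Δ

  renSem : ∀ α {Γ Δ} → Γ ⊆ Δ → Sem α Γ → Sem α Δ
  renSem (base b) ρ n = renNe ρ n
  renSem (α ⇒ β)  ρ f = λ σ → f (⊆-trans ρ σ)

  mutual
    reflect : ∀ α {Γ} → Ne Γ α → Sem α Γ
    reflect (base b) n = n
    reflect (α ⇒ β)  n = λ ρ a → reflect β (app (renNe ρ n) (reify α a))

    reify : ∀ α {Γ} → Sem α Γ → Nf Γ α
    reify (base b) n = ne n
    reify (α ⇒ β)  f = lam (reify β (f (drop ⊆-refl) (reflect α (hd (bv here)))))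

  Env : Ctx → Ctx → Set
  Env Γ Δ = ∀ {α} → Γ ∋ α → Sem α Δ

  GEnv : Ctx → Set
  GEnv Δ = ∀ α → ℕ → Sem α Δ

  eval : ∀ {Γ Δ α} → Env Γ Δ → GEnv Δ → Tm Γ α → Sem α Δ
  eval ρ g (` bv x)        = ρ x
  eval ρ g (` fv {α} n)    = g α n
  eval ρ g (` con {α} f)   = reflect α (hd (con f))
  eval {α = α ⇒ β} ρ g (ƛ t) = λ σ a →
    eval (λ { here → a ; (there x) → renSem _ σ (ρ x) })
         (λ γ n → renSem γ σ (g γ n)) t
  eval ρ g (t · u)         = eval ρ g t ⊆-refl (eval ρ g u)

  nf : ∀ {Γ α} → Tm Γ α → Nf Γ α
  nf {α = α} t = reify α (eval (λ {γ} x → reflect γ (hd (bv x)))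
                              (λ γ n → reflect γ (hd (fv n))) t)

  var↓ : ∀ α → ℕ → Nf [] α
  var↓ α n = nf (` fv {α = α} n)

  record Subst (Γ : Ctx) : Set where
    field
      map    : ∀ α → ℕ → Maybe (Nf Γ α)
      dom    : List Var
      finite : ∀ α n (u : Nf Γ α) → map α n ≡ just u → (α , n) ∈ dom
      etaLong : ∀ α n (u : Nf Γ α) → map α n ≡ just u → EtaLong u

  sbTm : ∀ {Γ Δ α} → (∀ β → ℕ → Maybe (Nf Γ β)) → Γ ⊆ Δ → Tm Δ α → Tm Δ α
  sbTm σ ρ (` bv x)  = ` bv x
  sbTm σ ρ (` fv {α} n) with σ α n
  ... | just u  = renTm ρ ⌜ u ⌝
  ... | nothing = ` fv n
  sbTm σ ρ (` con f) = ` con f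
  sbTm σ ρ (ƛ t)     = ƛ sbTm σ (drop ρ) t
  sbTm σ ρ (t · u)   = sbTm σ ρ t · sbTm σ ρ u

  _[_]↓ : ∀ {Γ α} → Nf [] α → Subst Γ → Nf Γ α
  t [ θ ]↓ = nf (sbTm (Subst.map θ) ⊆-refl (renTm ε⊆ ⌜ t ⌝))

  mutual
    data _∈FV_ {Γ : Ctx} : ∀ {α} → Var → Nf Γ α → Set where
      lam : ∀ {x α β} {t : Nf (α ∷ Γ) β} → x ∈FV t → x ∈FV lam t
      ne  : ∀ {x α} {n : Ne Γ α} → x ∈FVne n → x ∈FV ne n

    data _∈FVne_ {Γ : Ctx} : ∀ {α} → Var → Ne Γ α → Set where
      hd   : ∀ {α} {n : ℕ} → (α , n) ∈FVne hd (fv {α = α} n)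
      appL : ∀ {x α β} {n : Ne Γ (α ⇒ β)} {u : Nf Γ α} → x ∈FVne n → x ∈FVne app n u
      appR : ∀ {x α β} {n : Ne Γ (α ⇒ β)} {u : Nf Γ α} → x ∈FV u → x ∈FVne app n u

  _⊆FV_ : ∀ {Γ Δ α β} → Nf Γ α → Nf Δ β → Set
  t ⊆FV s = ∀ x → x ∈FV t → x ∈FV s

  neHead : ∀ {Γ α} → Ne Γ α → Σ Type (Head Γ)
  neHead (hd h)    = _ , h
  neHead (app n u) = neHead n

  data ArgOf {Γ : Ctx} : ∀ {α β} → Nf Γ α → Ne Γ β → Set where
    last    : ∀ {α β} {n : Ne Γ (α ⇒ β)} {u : Nf Γ α} → ArgOf u (app n u)
    earlier : ∀ {α β γ} {n : Ne Γ (α ⇒ β)} {u : Nf Γ α} {v : Nf Γ γ} →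
              ArgOf v n → ArgOf v (app n u)

  -- args(t) for t = a(t₁,…,tₙ) (no leading λ's; used only for terms of
  -- basic type, which never start with λ)
  data IsArg {Γ : Ctx} {α} (u : Nf Γ α) : ∀ {β} → Nf Γ β → Set where
    isArg : ∀ {β} {n : Ne Γ β} → ArgOf u n → IsArg u (ne n)

  data TopCon {Γ : Ctx} : ∀ {α} → Ne Γ α → Set where
    hd  : ∀ {α} {f : F α} → TopCon (hd (con f))
    app : ∀ {α β} {n : Ne Γ (α ⇒ β)} {u : Nf Γ α} → TopCon n → TopCon (app n u)

  data TopVar {Γ : Ctx} : ∀ {α} → Var → Ne Γ α → Set where
    hd  : ∀ {α} {n : ℕ} → TopVar (α , n) (hd (fv {α = α} n))
    app : ∀ {x α β} {n : Ne Γ (α ⇒ β)} {u : Nf Γ α} → TopVar x n → TopVar x (app n u)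

  data TopInΣ {Γ : Ctx} : ∀ {α} → Nf Γ α → Set where
    ne : ∀ {α} {n : Ne Γ α} → TopCon n → TopInΣ (ne n)

  data Lams : ∀ {Γ α Δ β} → Nf Γ α → Nf Δ β → Set where
    none : ∀ {Γ α} {t : Nf Γ α} → Lams t t
    more : ∀ {Γ α β Δ δ} {t : Nf (α ∷ Γ) β} {s : Nf Δ δ} →
           Lams t s → Lams (lam t) s

  record Rule : Set where
    field
      sort   : B
      lhs    : Nf [] (base sort)
      rhs    : Nf [] (base sort)
      lhs-η  : EtaLong lhs
      rhs-η  : EtaLong rhs
      lhs-top : TopInΣ lhs
      fv-rhs : rhs ⊆FV lhs

  HRS : Set₁
  HRS = Rule → Set

  -- s →_R t  (s ≡ C[lθ↓], t ≡ C[rθ↓]); the substitution may use the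
  -- variables bound by the context C.
  mutual
    data Step (R : HRS) {Γ : Ctx} : ∀ {α} → Nf Γ α → Nf Γ α → Set where
      root : (ρ : Rule) → R ρ → (θ : Subst Γ) →
             Step R (Rule.lhs ρ [ θ ]↓) (Rule.rhs ρ [ θ ]↓)
      lam  : ∀ {α β} {s t : Nf (α ∷ Γ) β} → Step R s t → Step R (lam s) (lam t)
      ne   : ∀ {α} {n n' : Ne Γ α} → StepNe R n n' → Step R (ne n) (ne n')

    data StepNe (R : HRS) {Γ : Ctx} : ∀ {α} → Ne Γ α → Ne Γ α → Set where
      appL : ∀ {α β} {n n' : Ne Γ (α ⇒ β)} {u : Nf Γ α} →
             StepNe R n n' → StepNe R (app n u) (app n' u)
      appR : ∀ {α β} {n : Ne Γ (α ⇒ β)} {u u' : Nf Γ α} →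
             Step R u u' → StepNe R (app n u) (app n u')

  SN : HRS → ∀ {α} → Nf [] α → Set
  SN R {α} t = Acc (λ u v → Step R v u) t

  SC : HRS → ∀ α → Nf [] α → Set
  SC R (base b) t = SN R t
  SC R (α ⇒ β)  t = ∀ (u : Nf [] α) → EtaLong u → SC R α u →
                    SC R β (nf (⌜ t ⌝ · ⌜ u ⌝))

  ArgsSC : HRS → ∀ {α} → Nf [] α → Set
  ArgsSC R t = ∀ {β} (u : Nf [] β) → IsArg u t → SC R β u

  HeadNotIn : (Var → Set) → ∀ {Γ} → Σ Type (Head Γ) → Set
  HeadNotIn X (α , bv x)  = ⊤
  HeadNotIn X (α , fv n)  = ¬ X (α , n)
  HeadNotIn X (α , con f) = ⊤

  -- SSubX X t s : s ∈ SSub_X(t)  (s lives under the λ's it passes)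
  data SSubX (X : Var → Set) : ∀ {Γ α Δ β} → Nf Γ α → Nf Δ β → Set where
    self  : ∀ {Γ α} {t : Nf Γ α} → SSubX X t t
    under : ∀ {Γ α β Δ δ} {t : Nf (α ∷ Γ) β} {s : Nf Δ δ} →
            SSubX X t s → SSubX X (lam t) s
    arg   : ∀ {Γ α γ Δ δ} {n : Ne Γ α} {u : Nf Γ γ} {s : Nf Δ δ} →
            HeadNotIn X (neHead n) → ArgOf u n → SSubX X u s → SSubX X (ne n) s

  SSub : ∀ {Γ α Δ β} → Nf Γ α → Nf Δ β → Set
  SSub t s = SSubX (λ x → x ∈FV t) t s

  data Accs {γ} (l' : Nf [] γ) : ∀ {α} → Nf [] α → Set where
    acc0 : Accs l' l'
    acc1 : ∀ {Δ b} {s : Nf Δ (base b)} {t : Nf [] (base b)} →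
           SSub l' s → s ≡ renNf ε⊆ t → t ⊆FV l' → Accs l' t
    acc2 : ∀ {α β} {t : Nf (α ∷ []) β} (n : ℕ) → Accs l' (lam t) →
           ¬ (α , n) ∈FV l' → ¬ (α , n) ∈FV lam t → Accs l' (open0 t n)
    acc3 : ∀ {α β} {n : Ne [] (α ⇒ β)} (m : ℕ) →
           Accs l' (ne (app n (var↓ α m))) →
           ¬ (α , m) ∈FV ne n → ¬ (α , m) ∈FV l' → Accs l' (ne n)
    acc4 : ∀ {α δ Δ b} {n : Ne [] α} {tᵢ : Nf [] δ} {s : Nf Δ (base b)}
             {t : Nf [] (base b)} →
           Accs l' (ne n) → TopCon n → ArgOf tᵢ n → Lams tᵢ s →
           s ≡ renNf ε⊆ t → Accs l' t
    acc5 : ∀ {α δ} {n : Ne [] α} {t : Nf [] δ} (x : Var) →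
           Accs l' (ne n) → TopVar x n → ArgOf t n →
           (∀ {ε} (u : Nf [] ε) → ArgOf u n → ¬ x ∈FV u) →
           ¬ x ∈FV l' → Accs l' t

  data Safe {β} (l : Nf [] β) {α} (u : Nf [] α) : Set where
    safe : ∀ {γ} {l' : Nf [] γ} {t : Nf [] α} →
           IsArg l' l → Accs l' t → t ⊆FV l' → u ≡ nf ⌜ t ⌝ → Safe l u

-- Every t ∈ Acc(l') is, once its bound variables are named by fresh free variables, the instance of
-- a body whose instances by strongly computable values become strongly computable under θ.  This
-- follows by induction on Acc(l'): the base cases come from the strong computability of the
-- arguments of lθ↓ (stable subterms of l' being subterms of l'θ↓); the λ- and η-cases rebind the
-- named variable to an arbitrary SC value; an argument of a function symbol is SN because the whole
-- application is; and an argument of a free variable x is reached by instantiating x with an SC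
-- projection term.  Since t has its free variables in l', naming is undone at the end.  All
-- identities between normal forms rest on the correctness of normalisation by evaluation.

module Submission where

open import Defs
open import Data.List using ([]; _∷_)
open import Data.Nat using (ℕ)
open import Data.Product using (Σ; _×_; _,_; proj₁; proj₂)
open import Data.Sum using (_⊎_; inj₁; inj₂)
open import Data.Maybe using (Maybe; just; nothing)
open import Data.Unit using (⊤; tt)
open import Data.Empty using (⊥; ⊥-elim)
open import Relation.Binary.PropositionalEquality
open import Relation.Nullary using (¬_)
open import Induction.WellFounded using (Acc; acc)

module Syntax (B : Set) (F : Ty B → Set) where

  open HRSTheory B F
  open ≡-Reasoning

  wk : ∀ {Γ α} → Γ ⊆ (α ∷ Γ)
  wk = drop ⊆-refl

  ⊆-trans-identityˡ : ∀ {Γ Δ} (ρ : Γ ⊆ Δ) → ⊆-trans ⊆-refl ρ ≡ ρ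
  ⊆-trans-identityˡ done = refl
  ⊆-trans-identityˡ (keep ρ) = cong keep (⊆-trans-identityˡ ρ)
  ⊆-trans-identityˡ (drop ρ) = cong drop (⊆-trans-identityˡ ρ)

  ⊆-trans-identityʳ : ∀ {Γ Δ} (ρ : Γ ⊆ Δ) → ⊆-trans ρ ⊆-refl ≡ ρ
  ⊆-trans-identityʳ done = refl
  ⊆-trans-identityʳ (keep ρ) = cong keep (⊆-trans-identityʳ ρ)
  ⊆-trans-identityʳ (drop ρ) = cong drop (⊆-trans-identityʳ ρ)

  ⊆-trans-assoc : ∀ {Γ Δ Θ Ξ} (ρ : Γ ⊆ Δ) (σ : Δ ⊆ Θ) (τ : Θ ⊆ Ξ) →
            ⊆-trans (⊆-trans ρ σ) τ ≡ ⊆-trans ρ (⊆-trans σ τ)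
  ⊆-trans-assoc ρ σ (drop τ) = cong drop (⊆-trans-assoc ρ σ τ)
  ⊆-trans-assoc ρ (drop σ) (keep τ) = cong drop (⊆-trans-assoc ρ σ τ)
  ⊆-trans-assoc (drop ρ) (keep σ) (keep τ) = cong drop (⊆-trans-assoc ρ σ τ)
  ⊆-trans-assoc (keep ρ) (keep σ) (keep τ) = cong keep (⊆-trans-assoc ρ σ τ)
  ⊆-trans-assoc done done done = refl

  ε⊆-wk-trans : ∀ {Δ α} → ⊆-trans (ε⊆ {Δ}) (wk {α = α}) ≡ ε⊆
  ε⊆-wk-trans = cong drop (⊆-trans-identityʳ ε⊆)

  renVar-id : ∀ {Γ α} (x : Γ ∋ α) → renVar ⊆-refl x ≡ x
  renVar-id here = refl
  renVar-id (there x) = cong there (renVar-id x)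

  renVar-trans : ∀ {Γ Δ Θ α} (ρ : Γ ⊆ Δ) (σ : Δ ⊆ Θ) (x : Γ ∋ α) →
                 renVar (⊆-trans ρ σ) x ≡ renVar σ (renVar ρ x)
  renVar-trans ρ (drop σ) x = cong there (renVar-trans ρ σ x)
  renVar-trans done done ()
  renVar-trans (keep ρ) (keep σ) here = refl
  renVar-trans (keep ρ) (keep σ) (there x) = cong there (renVar-trans ρ σ x)
  renVar-trans (drop ρ) (keep σ) x = cong there (renVar-trans ρ σ x)

  renHead-id : ∀ {Γ α} (h : Head Γ α) → renHead ⊆-refl h ≡ h
  renHead-id (bv x) = cong bv (renVar-id x)
  renHead-id (fv n) = refl
  renHead-id (con f) = refl

  renHead-trans : ∀ {Γ Δ Θ α} (ρ : Γ ⊆ Δ) (σ : Δ ⊆ Θ) (h : Head Γ α) →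
                 renHead (⊆-trans ρ σ) h ≡ renHead σ (renHead ρ h)
  renHead-trans ρ σ (bv x) = cong bv (renVar-trans ρ σ x)
  renHead-trans ρ σ (fv n) = refl
  renHead-trans ρ σ (con f) = refl

  mutual
    renNf-id : ∀ {Γ α} (v : Nf Γ α) → renNf ⊆-refl v ≡ v
    renNf-id (lam v) = cong lam (renNf-id v)
    renNf-id (ne n) = cong ne (renNe-id n)

    renNe-id : ∀ {Γ α} (n : Ne Γ α) → renNe ⊆-refl n ≡ n
    renNe-id (hd h) = cong hd (renHead-id h)
    renNe-id (app n u) = cong₂ app (renNe-id n) (renNf-id u)

  mutual
    renNf-trans : ∀ {Γ Δ Θ α} (ρ : Γ ⊆ Δ) (σ : Δ ⊆ Θ) (v : Nf Γ α) →
                  renNf (⊆-trans ρ σ) v ≡ renNf σ (renNf ρ v)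
    renNf-trans ρ σ (lam v) = cong lam (renNf-trans (keep ρ) (keep σ) v)
    renNf-trans ρ σ (ne n) = cong ne (renNe-trans ρ σ n)

    renNe-trans : ∀ {Γ Δ Θ α} (ρ : Γ ⊆ Δ) (σ : Δ ⊆ Θ) (n : Ne Γ α) →
                  renNe (⊆-trans ρ σ) n ≡ renNe σ (renNe ρ n)
    renNe-trans ρ σ (hd h) = cong hd (renHead-trans ρ σ h)
    renNe-trans ρ σ (app n u) = cong₂ app (renNe-trans ρ σ n) (renNf-trans ρ σ u)

  renTm-id : ∀ {Γ α} (t : Tm Γ α) → renTm ⊆-refl t ≡ t
  renTm-id (` h) = cong `_ (renHead-id h)
  renTm-id (ƛ t) = cong ƛ_ (renTm-id t)
  renTm-id (t · u) = cong₂ _·_ (renTm-id t) (renTm-id u)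

  renTm-trans : ∀ {Γ Δ Θ α} (ρ : Γ ⊆ Δ) (σ : Δ ⊆ Θ) (t : Tm Γ α) →
                renTm (⊆-trans ρ σ) t ≡ renTm σ (renTm ρ t)
  renTm-trans ρ σ (` h) = cong `_ (renHead-trans ρ σ h)
  renTm-trans ρ σ (ƛ t) = cong ƛ_ (renTm-trans (keep ρ) (keep σ) t)
  renTm-trans ρ σ (t · u) = cong₂ _·_ (renTm-trans ρ σ t) (renTm-trans ρ σ u)

  mutual
    ⌜⌝-renNf : ∀ {Γ Δ α} (ρ : Γ ⊆ Δ) (v : Nf Γ α) → ⌜ renNf ρ v ⌝ ≡ renTm ρ ⌜ v ⌝
    ⌜⌝-renNf ρ (lam v) = cong ƛ_ (⌜⌝-renNf (keep ρ) v)
    ⌜⌝-renNf ρ (ne n) = ⌜⌝ne-renNe ρ n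

    ⌜⌝ne-renNe : ∀ {Γ Δ α} (ρ : Γ ⊆ Δ) (n : Ne Γ α) → ⌜ renNe ρ n ⌝ne ≡ renTm ρ ⌜ n ⌝ne
    ⌜⌝ne-renNe ρ (hd h) = refl
    ⌜⌝ne-renNe ρ (app n u) = cong₂ _·_ (⌜⌝ne-renNe ρ n) (⌜⌝-renNf ρ u)

  Sub : Ctx → Ctx → Set
  Sub Γ Δ = ∀ {α} → Γ ∋ α → Tm Δ α

  liftS : ∀ {Γ Δ β} → Sub Γ Δ → Sub (β ∷ Γ) (β ∷ Δ)
  liftS σ here = ` bv here
  liftS σ (there x) = renTm wk (σ x)

  subTm : ∀ {Γ Δ α} → Sub Γ Δ → Tm Γ α → Tm Δ α
  subTm σ (` bv x) = σ x
  subTm σ (` fv n) = ` fv n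
  subTm σ (` con f) = ` con f
  subTm σ (ƛ t) = ƛ subTm (liftS σ) t
  subTm σ (t · u) = subTm σ t · subTm σ u

  idS : ∀ {Γ} → Sub Γ Γ
  idS x = ` bv x

  consS : ∀ {Γ Δ α} → Tm Δ α → Sub Γ Δ → Sub (α ∷ Γ) Δ
  consS U σ here = U
  consS U σ (there x) = σ x

  ne-injective : ∀ {Γ α} {a b : Ne Γ α} → _≡_ {A = Nf Γ α} (ne a) (ne b) → a ≡ b
  ne-injective refl = refl

  lam-injective : ∀ {Γ α β} {a b : Nf (α ∷ Γ) β} → _≡_ {A = Nf Γ (α ⇒ β)} (lam a) (lam b) → a ≡ b
  lam-injective refl = refl

  ne-subst : ∀ {b b'} (e : b ≡ b') (n : Ne [] (base b)) →
             ne (subst (λ c → Ne [] (base c)) e n) ≡ subst (λ c → Nf [] (base c)) e (ne n)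
  ne-subst refl n = refl

  hd-injective : ∀ {Γ α} {a b : Head Γ α} → _≡_ {A = Ne Γ α} (hd a) (hd b) → a ≡ b
  hd-injective refl = refl

  bv-injective : ∀ {Γ α} {a b : Γ ∋ α} → _≡_ {A = Head Γ α} (bv a) (bv b) → a ≡ b
  bv-injective refl = refl

  there-injective : ∀ {Γ α β} {a b : Γ ∋ α} → _≡_ {A = (β ∷ Γ) ∋ α} (there a) (there b) → a ≡ b
  there-injective refl = refl

  app-injective : ∀ {Γ α β} {a a' : Ne Γ (α ⇒ β)} {b b' : Nf Γ α} → _≡_ {A = Ne Γ β} (app a b) (app a' b') → (a ≡ a') × (b ≡ b')
  app-injective refl = refl , refl

  argType : ∀ {Γ β} → Ne Γ β → Type
  argType (app {α} a b) = α
  argType (hd {α} h) = α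

  app-argType : ∀ {Γ α α' β} {a : Ne Γ (α ⇒ β)} {b : Nf Γ α} {a' : Ne Γ (α' ⇒ β)} {b' : Nf Γ α'} →
             _≡_ {A = Ne Γ β} (app a b) (app a' b') → α ≡ α'
  app-argType e = cong argType e

  mutual
    hsNf-ext : ∀ {Γ Δ α} (σ σ' : HSub Γ Δ) → (∀ {β} (x : Γ ∋ β) → σ x ≡ σ' x) →
             (v : Nf Γ α) → hsNf σ v ≡ hsNf σ' v
    hsNf-ext σ σ' e (lam v) = cong lam (hsNf-ext (liftHS σ) (liftHS σ') e' v)
      where
      e' : ∀ {β} (x : _ ∋ β) → liftHS σ x ≡ liftHS σ' x
      e' here = refl
      e' (there x) = cong (renHead wk) (e x)
    hsNf-ext σ σ' e (ne n) = cong ne (hsNe-ext σ σ' e n)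

    hsNe-ext : ∀ {Γ Δ α} (σ σ' : HSub Γ Δ) → (∀ {β} (x : Γ ∋ β) → σ x ≡ σ' x) →
             (n : Ne Γ α) → hsNe σ n ≡ hsNe σ' n
    hsNe-ext σ σ' e (hd (bv x)) = cong hd (e x)
    hsNe-ext σ σ' e (hd (fv n)) = refl
    hsNe-ext σ σ' e (hd (con f)) = refl
    hsNe-ext σ σ' e (app n u) = cong₂ app (hsNe-ext σ σ' e n) (hsNf-ext σ σ' e u)

  hsComp : ∀ {Γ Δ Θ} → HSub Δ Θ → HSub Γ Δ → HSub Γ Θ
  hsComp τ σ x = hsHead τ (σ x)

  renHead-wk-lift : ∀ {Δ Θ β γ} (τ : HSub Δ Θ) (h : Head Δ γ) →
    renHead (wk {α = β}) (hsHead τ h) ≡ hsHead (liftHS τ) (renHead wk h)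
  renHead-wk-lift τ (bv x) = cong (λ y → renHead wk (τ y)) (sym (renVar-id x))
  renHead-wk-lift τ (fv n) = refl
  renHead-wk-lift τ (con f) = refl

  lift-comp : ∀ {Γ Δ Θ β} (τ : HSub Δ Θ) (σ : HSub Γ Δ) {γ} (x : (β ∷ Γ) ∋ γ) →
    liftHS (hsComp τ σ) x ≡ hsComp (liftHS τ) (liftHS σ) x
  lift-comp τ σ here = refl
  lift-comp τ σ (there x) = renHead-wk-lift τ (σ x)

  mutual
    hsNf-∘ : ∀ {Γ Δ Θ α} (τ : HSub Δ Θ) (σ : HSub Γ Δ) (v : Nf Γ α) →
            hsNf τ (hsNf σ v) ≡ hsNf (hsComp τ σ) v
    hsNf-∘ τ σ (lam v) = cong lam (trans (hsNf-∘ (liftHS τ) (liftHS σ) v)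
                          (sym (hsNf-ext _ _ (lift-comp τ σ) v)))
    hsNf-∘ τ σ (ne n) = cong ne (hsNe-∘ τ σ n)

    hsNe-∘ : ∀ {Γ Δ Θ α} (τ : HSub Δ Θ) (σ : HSub Γ Δ) (n : Ne Γ α) →
            hsNe τ (hsNe σ n) ≡ hsNe (hsComp τ σ) n
    hsNe-∘ τ σ (hd (bv x)) = refl
    hsNe-∘ τ σ (hd (fv n)) = refl
    hsNe-∘ τ σ (hd (con f)) = refl
    hsNe-∘ τ σ (app n u) = cong₂ app (hsNe-∘ τ σ n) (hsNf-∘ τ σ u)

  renHS : ∀ {Γ Δ} → Γ ⊆ Δ → HSub Γ Δ
  renHS ρ x = bv (renVar ρ x)

  mutual
    renNf-as-hsNf : ∀ {Γ Δ α} (ρ : Γ ⊆ Δ) (v : Nf Γ α) → renNf ρ v ≡ hsNf (renHS ρ) v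
    renNf-as-hsNf ρ (lam v) = cong lam (trans (renNf-as-hsNf (keep ρ) v) (hsNf-ext _ _ e v))
      where
      e : ∀ {β} (x : _ ∋ β) → renHS (keep ρ) x ≡ liftHS (renHS ρ) x
      e here = refl
      e (there x) = cong (λ y → bv (there y)) (sym (renVar-id (renVar ρ x)))
    renNf-as-hsNf ρ (ne n) = cong ne (renNe-as-hsNe ρ n)

    renNe-as-hsNe : ∀ {Γ Δ α} (ρ : Γ ⊆ Δ) (n : Ne Γ α) → renNe ρ n ≡ hsNe (renHS ρ) n
    renNe-as-hsNe ρ (hd (bv x)) = refl
    renNe-as-hsNe ρ (hd (fv n)) = refl
    renNe-as-hsNe ρ (hd (con f)) = refl
    renNe-as-hsNe ρ (app n u) = cong₂ app (renNe-as-hsNe ρ n) (renNf-as-hsNf ρ u)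

  hsNf-closed : ∀ {α} (σ : HSub [] []) (v : Nf [] α) → hsNf σ v ≡ v
  hsNf-closed σ v = trans (hsNf-ext σ (renHS ⊆-refl) (λ ()) v) (trans (sym (renNf-as-hsNf ⊆-refl v)) (renNf-id v))

  hsNf-renNf-closed : ∀ {Δ α} (σ : HSub Δ []) (t : Nf [] α) → hsNf σ (renNf ε⊆ t) ≡ t
  hsNf-renNf-closed σ t = trans (cong (hsNf σ) (renNf-as-hsNf ε⊆ t)) (trans (hsNf-∘ σ (renHS ε⊆) t) (hsNf-closed _ t))

  strengthenHS : ∀ {Γ β} → HSub (β ∷ Γ) Γ
  strengthenHS here = fv 0
  strengthenHS (there x) = bv x

  strengthen-wkNf : ∀ {Γ α β} (v : Nf Γ α) → hsNf strengthenHS (renNf (wk {α = β}) v) ≡ v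
  strengthen-wkNf {β = β} v = begin
    hsNf strengthenHS (renNf (wk {α = β}) v)
      ≡⟨ cong (hsNf strengthenHS) (renNf-as-hsNf wk v) ⟩
    hsNf strengthenHS (hsNf (renHS wk) v)
      ≡⟨ hsNf-∘ strengthenHS (renHS wk) v ⟩
    hsNf (hsComp strengthenHS (renHS (wk {α = β}))) v
      ≡⟨ hsNf-ext _ (renHS ⊆-refl) (λ x → refl) v ⟩
    hsNf (renHS ⊆-refl) v
      ≡⟨ sym (renNf-as-hsNf ⊆-refl v) ⟩
    renNf ⊆-refl v
      ≡⟨ renNf-id v ⟩
    v ∎

  strengthen-wkNe : ∀ {Γ α β} (n : Ne Γ α) → hsNe strengthenHS (renNe (wk {α = β}) n) ≡ n
  strengthen-wkNe {β = β} n = begin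
    hsNe strengthenHS (renNe (wk {α = β}) n)
      ≡⟨ cong (hsNe strengthenHS) (renNe-as-hsNe wk n) ⟩
    hsNe strengthenHS (hsNe (renHS wk) n)
      ≡⟨ hsNe-∘ strengthenHS (renHS wk) n ⟩
    hsNe (hsComp strengthenHS (renHS (wk {α = β}))) n
      ≡⟨ hsNe-ext _ (renHS ⊆-refl) (λ x → refl) n ⟩
    hsNe (renHS ⊆-refl) n
      ≡⟨ sym (renNe-as-hsNe ⊆-refl n) ⟩
    renNe ⊆-refl n
      ≡⟨ renNe-id n ⟩
    n ∎

  wkNf-injective : ∀ {Γ α β} {v v' : Nf Γ α} → renNf (wk {α = β}) v ≡ renNf wk v' → v ≡ v'
  wkNf-injective {v = v} {v'} e = trans (sym (strengthen-wkNf v)) (trans (cong (hsNf strengthenHS) e) (strengthen-wkNf v'))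

  wkNe-injective : ∀ {Γ α β} {n n' : Ne Γ α} → renNe (wk {α = β}) n ≡ renNe wk n' → n ≡ n'
  wkNe-injective {n = n} {n'} e = trans (sym (strengthen-wkNe n)) (trans (cong (hsNe strengthenHS) e) (strengthen-wkNe n'))

  wkHead-injective : ∀ {Γ α β} {h h' : Head Γ α} → renHead (wk {α = β}) h ≡ renHead wk h' → h ≡ h'
  wkHead-injective {h = h} {h'} e = hd-injective (wkNe-injective {n = hd h} {hd h'} (cong hd e))

  wkHead≢here : ∀ {Γ α} (h : Head Γ α) → renHead (wk {α = α}) h ≡ bv here → ⊥
  wkHead≢here (bv x) ()
  wkHead≢here (fv n) ()
  wkHead≢here (con f) ()

  wkHead-bv-inv : ∀ {Γ α β} (h : Head Γ α) (z : Γ ∋ α) → renHead (wk {α = β}) h ≡ bv (there z) → h ≡ bv z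
  wkHead-bv-inv (bv x) z e = cong bv (trans (sym (renVar-id x)) (there-injective (bv-injective e)))
  wkHead-bv-inv (fv n) z ()
  wkHead-bv-inv (con f) z ()

  wkHead-fv-inv : ∀ {Γ α β} (h : Head Γ α) (m : ℕ) → renHead (wk {α = β}) h ≡ fv m → h ≡ fv m
  wkHead-fv-inv (bv x) m ()
  wkHead-fv-inv (fv n) m refl = refl
  wkHead-fv-inv (con f) m ()

  mutual
    renNf-EL : ∀ {Γ Δ α} (ρ : Γ ⊆ Δ) {v : Nf Γ α} → EtaLong v → EtaLong (renNf ρ v)
    renNf-EL ρ (lam e) = lam (renNf-EL (keep ρ) e)
    renNf-EL ρ (ne e) = ne (renNe-EL ρ e)

    renNe-EL : ∀ {Γ Δ α} (ρ : Γ ⊆ Δ) {n : Ne Γ α} → EtaLongNe n → EtaLongNe (renNe ρ n)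
    renNe-EL ρ hd = hd
    renNe-EL ρ (app e e') = app (renNe-EL ρ e) (renNf-EL ρ e')

  mutual
    hsNf-EL : ∀ {Γ Δ α} (σ : HSub Γ Δ) {v : Nf Γ α} → EtaLong v → EtaLong (hsNf σ v)
    hsNf-EL σ (lam e) = lam (hsNf-EL (liftHS σ) e)
    hsNf-EL σ (ne e) = ne (hsNe-EL σ e)

    hsNe-EL : ∀ {Γ Δ α} (σ : HSub Γ Δ) {n : Ne Γ α} → EtaLongNe n → EtaLongNe (hsNe σ n)
    hsNe-EL σ (hd {h = bv x}) = hd
    hsNe-EL σ (hd {h = fv n}) = hd
    hsNe-EL σ (hd {h = con f}) = hd
    hsNe-EL σ (app e e') = app (hsNe-EL σ e) (hsNf-EL σ e')

  mutual
    data UsesNf : ∀ {Γ α β} → Nf Γ α → Γ ∋ β → Set where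
      lam : ∀ {Γ α β γ} {v : Nf (α ∷ Γ) β} {y : Γ ∋ γ} → UsesNf v (there y) → UsesNf (lam v) y
      ne  : ∀ {Γ α γ} {n : Ne Γ α} {y : Γ ∋ γ} → UsesNe n y → UsesNf (ne n) y

    data UsesNe : ∀ {Γ α β} → Ne Γ α → Γ ∋ β → Set where
      hd   : ∀ {Γ γ} {y : Γ ∋ γ} → UsesNe (hd (bv y)) y
      appL : ∀ {Γ α β γ} {n : Ne Γ (α ⇒ β)} {u : Nf Γ α} {y : Γ ∋ γ} → UsesNe n y → UsesNe (app n u) y
      appR : ∀ {Γ α β γ} {n : Ne Γ (α ⇒ β)} {u : Nf Γ α} {y : Γ ∋ γ} → UsesNf u y → UsesNe (app n u) y

  mutual
    uses-renNf : ∀ {Γ Δ α β} (ρ : Γ ⊆ Δ) {v : Nf Γ α} {y : Γ ∋ β} → UsesNf v y → UsesNf (renNf ρ v) (renVar ρ y)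
    uses-renNf ρ (lam u) = lam (uses-renNf (keep ρ) u)
    uses-renNf ρ (ne u) = ne (uses-renNe ρ u)

    uses-renNe : ∀ {Γ Δ α β} (ρ : Γ ⊆ Δ) {n : Ne Γ α} {y : Γ ∋ β} → UsesNe n y → UsesNe (renNe ρ n) (renVar ρ y)
    uses-renNe ρ hd = hd
    uses-renNe ρ (appL u) = appL (uses-renNe ρ u)
    uses-renNe ρ (appR u) = appR (uses-renNf ρ u)

  mutual
    uses-hsNf : ∀ {Γ Δ α β} (σ : HSub Γ Δ) {v : Nf Γ α} {y : Γ ∋ β} {z : Δ ∋ β} → UsesNf v y → σ y ≡ bv z →
              UsesNf (hsNf σ v) z
    uses-hsNf σ {z = z} (lam u) e =
      lam (subst (UsesNf _) (cong there (renVar-id z)) (uses-hsNf (liftHS σ) u (cong (renHead wk) e)))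
    uses-hsNf σ (ne u) e = ne (uses-hsNe σ u e)

    uses-hsNe : ∀ {Γ Δ α β} (σ : HSub Γ Δ) {n : Ne Γ α} {y : Γ ∋ β} {z : Δ ∋ β} → UsesNe n y → σ y ≡ bv z →
              UsesNe (hsNe σ n) z
    uses-hsNe σ {z = z} hd e = subst (λ h → UsesNe (hd h) z) (sym e) hd
    uses-hsNe σ (appL u) e = appL (uses-hsNe σ u e)
    uses-hsNe σ (appR u) e = appR (uses-hsNf σ u e)

  mutual
    uses-hsNf-inv : ∀ {Γ Δ α β} (σ : HSub Γ Δ) (v : Nf Γ α) {z : Δ ∋ β} → UsesNf (hsNf σ v) z →
                   Σ (Γ ∋ β) λ y → UsesNf v y × (σ y ≡ bv z)
    uses-hsNf-inv σ (lam v) (lam u) with uses-hsNf-inv (liftHS σ) v u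
    ... | here , u' , ()
    ... | there y , u' , e = y , lam u' , wkHead-bv-inv (σ y) _ e
    uses-hsNf-inv σ (ne n) (ne u) with uses-hsNe-inv σ n u
    ... | y , u' , e = y , ne u' , e

    uses-hsNe-inv : ∀ {Γ Δ α β} (σ : HSub Γ Δ) (n : Ne Γ α) {z : Δ ∋ β} → UsesNe (hsNe σ n) z →
                   Σ (Γ ∋ β) λ y → UsesNe n y × (σ y ≡ bv z)
    uses-hsNe-inv σ (hd (bv x)) u with σ x in eq
    ... | bv w with u
    ...   | hd = x , hd , eq
    uses-hsNe-inv σ (hd (fv m)) ()
    uses-hsNe-inv σ (hd (con f)) ()
    uses-hsNe-inv σ (app n u) (appL p) with uses-hsNe-inv σ n p
    ... | y , q , e = y , appL q , e
    uses-hsNe-inv σ (app n u) (appR p) with uses-hsNf-inv σ u p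
    ... | y , q , e = y , appR q , e

  renNf-closed-unused : ∀ {Δ α β} (ρ : [] ⊆ Δ) (t : Nf [] α) {z : Δ ∋ β} → ¬ UsesNf (renNf ρ t) z
  renNf-closed-unused ρ t u with uses-hsNf-inv (renHS ρ) t (subst (λ w → UsesNf w _) (renNf-as-hsNf ρ t) u)
  ... | () , _ , _

  mutual
    fv-renNf : ∀ {Γ Δ α} (ρ : Γ ⊆ Δ) {v : Nf Γ α} {x : Var} → x ∈FV v → x ∈FV renNf ρ v
    fv-renNf ρ (lam p) = lam (fv-renNf (keep ρ) p)
    fv-renNf ρ (ne p) = ne (fv-renNe ρ p)

    fv-renNe : ∀ {Γ Δ α} (ρ : Γ ⊆ Δ) {n : Ne Γ α} {x : Var} → x ∈FVne n → x ∈FVne renNe ρ n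
    fv-renNe ρ hd = hd
    fv-renNe ρ (appL p) = appL (fv-renNe ρ p)
    fv-renNe ρ (appR p) = appR (fv-renNf ρ p)

  mutual
    uses-fv-hsNf : ∀ {Γ Δ α β} (σ : HSub Γ Δ) {v : Nf Γ α} {y : Γ ∋ β} {m : ℕ} → UsesNf v y → σ y ≡ fv m →
              (β , m) ∈FV hsNf σ v
    uses-fv-hsNf σ (lam u) e = lam (uses-fv-hsNf (liftHS σ) u (cong (renHead wk) e))
    uses-fv-hsNf σ (ne u) e = ne (uses-fv-hsNe σ u e)

    uses-fv-hsNe : ∀ {Γ Δ α β} (σ : HSub Γ Δ) {n : Ne Γ α} {y : Γ ∋ β} {m : ℕ} → UsesNe n y → σ y ≡ fv m →
              (β , m) ∈FVne hsNe σ n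
    uses-fv-hsNe σ {y = y} {m} hd e = subst (λ h → (_ , m) ∈FVne hd h) (sym e) hd
    uses-fv-hsNe σ (appL u) e = appL (uses-fv-hsNe σ u e)
    uses-fv-hsNe σ (appR u) e = appR (uses-fv-hsNf σ u e)

  mutual
    fv-hsNf-inv : ∀ {Γ Δ α β} (κ : HSub Γ Δ) (v : Nf Γ α) {m : ℕ} → (β , m) ∈FV hsNf κ v →
                 ((β , m) ∈FV v) ⊎ (Σ (Γ ∋ β) λ y → UsesNf v y × (κ y ≡ fv m))
    fv-hsNf-inv κ (lam v) (lam p) with fv-hsNf-inv (liftHS κ) v p
    ... | inj₁ q = inj₁ (lam q)
    ... | inj₂ (here , u , ())
    ... | inj₂ (there y , u , e) = inj₂ (y , lam u , wkHead-fv-inv (κ y) _ e)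
    fv-hsNf-inv κ (ne n) (ne p) with fv-hsNe-inv κ n p
    ... | inj₁ q = inj₁ (ne q)
    ... | inj₂ (y , u , e) = inj₂ (y , ne u , e)

    fv-hsNe-inv : ∀ {Γ Δ α β} (κ : HSub Γ Δ) (n : Ne Γ α) {m : ℕ} → (β , m) ∈FVne hsNe κ n →
                 ((β , m) ∈FVne n) ⊎ (Σ (Γ ∋ β) λ y → UsesNe n y × (κ y ≡ fv m))
    fv-hsNe-inv κ (hd (bv x)) p with κ x in eq
    ... | fv k with p
    ...   | hd = inj₂ (x , hd , eq)
    fv-hsNe-inv κ (hd (fv k)) hd = inj₁ hd
    fv-hsNe-inv κ (hd (con f)) ()
    fv-hsNe-inv κ (app n u) (appL p) with fv-hsNe-inv κ n p
    ... | inj₁ q = inj₁ (appL q)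
    ... | inj₂ (y , w , e) = inj₂ (y , appL w , e)
    fv-hsNe-inv κ (app n u) (appR p) with fv-hsNf-inv κ u p
    ... | inj₁ q = inj₁ (appR q)
    ... | inj₂ (y , w , e) = inj₂ (y , appR w , e)

  data HeadOf {Γ : Ctx} : ∀ {α β} → Ne Γ α → Head Γ β → Set where
    hd  : ∀ {β} {h : Head Γ β} → HeadOf (hd h) h
    app : ∀ {α β γ} {n : Ne Γ (α ⇒ β)} {u : Nf Γ α} {h : Head Γ γ} → HeadOf n h → HeadOf (app n u) h

  neHead-HeadOf : ∀ {Γ α} (n : Ne Γ α) → HeadOf n (proj₂ (neHead n))
  neHead-HeadOf (hd h) = hd
  neHead-HeadOf (app n u) = app (neHead-HeadOf n)

  TopVar⇒HeadOf : ∀ {Γ α β m} {n : Ne Γ α} → TopVar (β , m) n → HeadOf n (fv {α = β} m)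
  TopVar⇒HeadOf hd = hd
  TopVar⇒HeadOf (app p) = app (TopVar⇒HeadOf p)

  TopCon⇒HeadOf : ∀ {Γ α} {n : Ne Γ α} → TopCon n → Σ Type λ β → Σ (F β) λ f → HeadOf n (con f)
  TopCon⇒HeadOf (hd {f = f}) = _ , f , hd
  TopCon⇒HeadOf (app p) with TopCon⇒HeadOf p
  ... | β , f , q = β , f , app q

  HeadOf-fv : ∀ {Γ α β m} {n : Ne Γ α} → HeadOf n (fv {α = β} m) → (β , m) ∈FVne n
  HeadOf-fv hd = hd
  HeadOf-fv (app p) = appL (HeadOf-fv p)

  ArgOf-fv : ∀ {Γ α γ} {n : Ne Γ α} {u : Nf Γ γ} {x : Var} → ArgOf u n → x ∈FV u → x ∈FVne n
  ArgOf-fv last q = appR q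
  ArgOf-fv (earlier p) q = appL (ArgOf-fv p q)

  ArgOf-renNe : ∀ {Γ Δ α γ} (ρ : Γ ⊆ Δ) {n : Ne Γ α} {u : Nf Γ γ} → ArgOf u n → ArgOf (renNf ρ u) (renNe ρ n)
  ArgOf-renNe ρ last = last
  ArgOf-renNe ρ (earlier p) = earlier (ArgOf-renNe ρ p)

  ArgOf-EL : ∀ {Γ α γ} {n : Ne Γ α} {u : Nf Γ γ} → ArgOf u n → EtaLongNe n → EtaLong u
  ArgOf-EL last (app e e') = e'
  ArgOf-EL (earlier p) (app e e') = ArgOf-EL p e

  data Subterm : ∀ {Γ α Δ β} → Nf Γ α → Nf Δ β → Set where
    self  : ∀ {Γ α} {t : Nf Γ α} → Subterm t t
    under : ∀ {Γ α β Δ δ} {t : Nf (α ∷ Γ) β} {s : Nf Δ δ} → Subterm t s → Subterm (lam t) s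
    arg   : ∀ {Γ α γ Δ δ} {n : Ne Γ α} {u : Nf Γ γ} {s : Nf Δ δ} → ArgOf u n → Subterm u s → Subterm (ne n) s

  hsNf-ne-inv : ∀ {Γ Δ α} (σ : HSub Γ Δ) (v : Nf Γ α) {n : Ne Δ α} → hsNf σ v ≡ ne n →
           Σ (Ne Γ α) λ N → (v ≡ ne N) × (hsNe σ N ≡ n)
  hsNf-ne-inv σ (ne N) refl = N , refl , refl
  hsNf-ne-inv σ (lam v) ()

  hsNf-lam-inv : ∀ {Γ Δ α β} (σ : HSub Γ Δ) (v : Nf Γ (α ⇒ β)) {w : Nf (α ∷ Δ) β} → hsNf σ v ≡ lam w →
            Σ (Nf (α ∷ Γ) β) λ w' → (v ≡ lam w') × (hsNf (liftHS σ) w' ≡ w)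
  hsNf-lam-inv σ (lam w') refl = w' , refl , refl
  hsNf-lam-inv σ (ne N) ()

  hsNe-app-inv : ∀ {Γ Δ α β} (σ : HSub Γ Δ) (N : Ne Γ β) {n : Ne Δ (α ⇒ β)} {u : Nf Δ α} → hsNe σ N ≡ app n u →
            Σ (Ne Γ (α ⇒ β)) λ n' → Σ (Nf Γ α) λ u' → (N ≡ app n' u') × (hsNe σ n' ≡ n) × (hsNf σ u' ≡ u)
  hsNe-app-inv σ (app n' u') refl = n' , u' , refl , refl , refl
  hsNe-app-inv σ (hd h) ()

  hsNe-ArgOf-inv : ∀ {Γ Δ α γ} (σ : HSub Γ Δ) (N : Ne Γ α) {n : Ne Δ α} {u : Nf Δ γ} → ArgOf u n → hsNe σ N ≡ n →
              Σ (Nf Γ γ) λ u' → ArgOf u' N × (hsNf σ u' ≡ u)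
  hsNe-ArgOf-inv σ N last e with hsNe-app-inv σ N e
  ... | n' , u' , refl , e1 , e2 = u' , last , e2
  hsNe-ArgOf-inv σ N (earlier p) e with hsNe-app-inv σ N e
  ... | n' , u' , refl , e1 , e2 with hsNe-ArgOf-inv σ n' p e1
  ...   | w , q , e3 = w , earlier q , e3

  hsNe-HeadOf-inv : ∀ {Γ Δ α β} (σ : HSub Γ Δ) (N : Ne Γ α) {h' : Head Δ β} → HeadOf (hsNe σ N) h' →
            Σ (Head Γ β) λ h → HeadOf N h × (hsHead σ h ≡ h')
  hsNe-HeadOf-inv σ (hd h0) hd = h0 , hd , refl
  hsNe-HeadOf-inv σ (app N u) (app p) with hsNe-HeadOf-inv σ N p
  ... | h , q , e = h , app q , e

  collapseHS : ∀ {Δ} → HSub Δ []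
  collapseHS x = fv 0

  collapseHS-wk : ∀ {Δ α β} (h : Head Δ α) → hsHead collapseHS (renHead (wk {α = β}) h) ≡ hsHead collapseHS h
  collapseHS-wk (bv x) = refl
  collapseHS-wk (fv n) = refl
  collapseHS-wk (con f) = refl

  openHS : ∀ {α} → HSub (α ∷ []) []
  openHS here = fv 0
  openHS (there ())

  Closing : Ctx → Set
  Closing Γ = ∀ {β} → Γ ∋ β → Nf [] β

  closingSub : ∀ {Γ} → Closing Γ → Sub Γ []
  closingSub ε x = ⌜ ε x ⌝

  namesHS : ∀ {Γ} → (∀ {β} → Γ ∋ β → ℕ) → HSub Γ []
  namesHS σ x = fv (σ x)

  extendNames : ∀ {Γ α} → ℕ → (∀ {β} → Γ ∋ β → ℕ) → (∀ {β} → (α ∷ Γ) ∋ β → ℕ)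
  extendNames n σ here = n
  extendNames n σ (there x) = σ x

  update : ∀ {Γ α} → Closing Γ → Γ ∋ α → Nf [] α → Closing Γ
  update ε here u here = u
  update ε here u (there y) = ε (there y)
  update ε (there i) u here = ε here
  update ε (there i) u (there y) = update (λ z → ε (there z)) i u y

  update-at : ∀ {Γ α} (ε : Closing Γ) (i : Γ ∋ α) (u : Nf [] α) → update ε i u i ≡ u
  update-at ε here u = refl
  update-at ε (there i) u = update-at (λ z → ε (there z)) i u

  update-All : ∀ {Γ α} (P : ∀ {β} → Nf [] β → Set) (ε : Closing Γ) (i : Γ ∋ α) (u : Nf [] α) →
          (∀ {β} (y : Γ ∋ β) → P (ε y)) → P u → ∀ {β} (y : Γ ∋ β) → P (update ε i u y)
  update-All P ε here u h pu here = pu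
  update-All P ε here u h pu (there y) = h (there y)
  update-All P ε (there i) u h pu here = h here
  update-All P ε (there i) u h pu (there y) = update-All P (λ z → ε (there z)) i u (λ z → h (there z)) pu y

  update-other : ∀ {Γ α β} (ε : Closing Γ) (i : Γ ∋ α) (u : Nf [] α) (y : Γ ∋ β) →
              (update ε i u y ≡ ε y) ⊎ (_≡_ {A = Σ Type (λ γ → Γ ∋ γ)} (β , y) (α , i))
  update-other ε here u here = inj₂ refl
  update-other ε here u (there y) = inj₁ refl
  update-other ε (there i) u here = inj₁ refl
  update-other ε (there i) u (there y) with update-other (λ z → ε (there z)) i u y
  ... | inj₁ e = inj₁ e
  ... | inj₂ refl = inj₂ refl

module Semantics (B : Set) (F : Ty B → Set) where

  open HRSTheory B F
  open Syntax B F

  -- Kripke values are compared extensionally (Eq) and restricted to the uniform ones (Uni): those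
  -- that respect Eq and commute with renaming.  Normalisation by evaluation is proved correct in
  -- this partial-equivalence model.
  mutual
    Eq : ∀ α {Γ} → Sem α Γ → Sem α Γ → Set
    Eq (base b) n n' = n ≡ n'
    Eq (α ⇒ β) {Γ} f f' = ∀ {Δ} (ρ : Γ ⊆ Δ) (a : Sem α Δ) → Uni α a → Eq β (f ρ a) (f' ρ a)

    Uni : ∀ α {Γ} → Sem α Γ → Set
    Uni (base b) n = ⊤
    Uni (α ⇒ β) {Γ} f =
      (∀ {Δ} (ρ : Γ ⊆ Δ) a → Uni α a → Uni β (f ρ a)) ×
      ((∀ {Δ} (ρ : Γ ⊆ Δ) a a' → Uni α a → Uni α a' → Eq α a a' → Eq β (f ρ a) (f ρ a')) ×
       (∀ {Δ Θ} (ρ : Γ ⊆ Δ) (τ : Δ ⊆ Θ) a → Uni α a →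
          Eq β (renSem β τ (f ρ a)) (f (⊆-trans ρ τ) (renSem α τ a))))

  Eq-refl : ∀ α {Γ} (s : Sem α Γ) → Eq α s s
  Eq-refl (base b) s = refl
  Eq-refl (α ⇒ β) f ρ a _ = Eq-refl β (f ρ a)

  Eq-sym : ∀ α {Γ} {s s' : Sem α Γ} → Eq α s s' → Eq α s' s
  Eq-sym (base b) e = sym e
  Eq-sym (α ⇒ β) e ρ a u = Eq-sym β (e ρ a u)

  Eq-trans : ∀ α {Γ} {s s' s'' : Sem α Γ} → Eq α s s' → Eq α s' s'' → Eq α s s''
  Eq-trans (base b) e e' = trans e e'
  Eq-trans (α ⇒ β) e e' ρ a u = Eq-trans β (e ρ a u) (e' ρ a u)

  Eq-≡ : ∀ α {Γ} {s s' : Sem α Γ} → s ≡ s' → Eq α s s'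
  Eq-≡ α {s = s} refl = Eq-refl α s

  renSem-Eq : ∀ γ {Γ Δ} (τ : Γ ⊆ Δ) {s s' : Sem γ Γ} → Eq γ s s' → Eq γ (renSem γ τ s) (renSem γ τ s')
  renSem-Eq (base b) τ e = cong (renNe τ) e
  renSem-Eq (α ⇒ β) τ e ρ a u = e (⊆-trans τ ρ) a u

  renSem-Uni : ∀ γ {Γ Δ} (τ : Γ ⊆ Δ) {s : Sem γ Γ} → Uni γ s → Uni γ (renSem γ τ s)
  renSem-Uni (base b) τ u = tt
  renSem-Uni (α ⇒ β) τ {f} (u1 , u2 , u3) =
    (λ ρ a ua → u1 (⊆-trans τ ρ) a ua) ,
    (λ ρ a a' ua ua' ea → u2 (⊆-trans τ ρ) a a' ua ua' ea) ,
    (λ ρ σ a ua → subst (λ z → Eq β (renSem β σ (f (⊆-trans τ ρ) a)) (f z (renSem α σ a)))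
                    (⊆-trans-assoc τ ρ σ) (u3 (⊆-trans τ ρ) σ a ua))

  renSem-id : ∀ γ {Γ} (s : Sem γ Γ) → Eq γ (renSem γ ⊆-refl s) s
  renSem-id (base b) s = renNe-id s
  renSem-id (α ⇒ β) f ρ a u = subst (λ z → Eq β (f z a) (f ρ a)) (sym (⊆-trans-identityˡ ρ)) (Eq-refl β (f ρ a))

  renSem-trans : ∀ γ {Γ Δ Θ} (ρ : Γ ⊆ Δ) (τ : Δ ⊆ Θ) (s : Sem γ Γ) →
                 Eq γ (renSem γ (⊆-trans ρ τ) s) (renSem γ τ (renSem γ ρ s))
  renSem-trans (base b) ρ τ s = renNe-trans ρ τ s
  renSem-trans (α ⇒ β) ρ τ f σ a u =
    subst (λ z → Eq β (f (⊆-trans (⊆-trans ρ τ) σ) a) (f z a)) (⊆-trans-assoc ρ τ σ) (Eq-refl β _)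

  var0Sem : ∀ α {Γ} → Sem α (α ∷ Γ)
  var0Sem α = reflect α (hd (bv here))

  mutual
    reify-Eq : ∀ α {Γ} {s s' : Sem α Γ} → Eq α s s' → reify α s ≡ reify α s'
    reify-Eq (base b) e = cong ne e
    reify-Eq (α ⇒ β) e = cong lam (reify-Eq β (e wk (var0Sem α) (reflect-Uni α _)))

    reflect-Uni : ∀ α {Γ} (n : Ne Γ α) → Uni α (reflect α n)
    reflect-Uni (base b) n = tt
    reflect-Uni (α ⇒ β) n =
      (λ ρ a ua → reflect-Uni β _) ,
      (λ ρ a a' ua ua' ea → reflect-cong β (cong (app (renNe ρ n)) (reify-Eq α ea))) ,
      (λ ρ τ a ua → Eq-trans β (reflect-nat β τ (app (renNe ρ n) (reify α a)))
         (reflect-cong β (cong₂ app (sym (renNe-trans ρ τ n)) (reify-nat α τ a ua))))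

    reflect-cong : ∀ α {Γ} {n n' : Ne Γ α} → n ≡ n' → Eq α (reflect α n) (reflect α n')
    reflect-cong α {n = n} refl = Eq-refl α (reflect α n)

    reflect-nat : ∀ α {Γ Δ} (τ : Γ ⊆ Δ) (n : Ne Γ α) →
                  Eq α (renSem α τ (reflect α n)) (reflect α (renNe τ n))
    reflect-nat (base b) τ n = refl
    reflect-nat (α ⇒ β) τ n ρ a u =
      reflect-cong β (cong (λ z → app z (reify α a)) (renNe-trans τ ρ n))

    reify-nat : ∀ α {Γ Δ} (τ : Γ ⊆ Δ) (s : Sem α Γ) → Uni α s →
                renNf τ (reify α s) ≡ reify α (renSem α τ s)
    reify-nat (base b) τ s u = refl
    reify-nat (α ⇒ β) τ f (u1 , u2 , u3) = cong lam (trans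
      (reify-nat β (keep τ) (f wk (var0Sem α)) (u1 _ _ (reflect-Uni α _)))
      (reify-Eq β (Eq-trans β (u3 wk (keep τ) (var0Sem α) (reflect-Uni α _))
        (Eq-trans β
          (u2 _ _ _ (renSem-Uni α (keep τ) (reflect-Uni α _)) (reflect-Uni α _) (reflect-nat α (keep τ) (hd (bv here))))
          (Eq-≡ β (cong (λ z → f z (var0Sem α)) (trans (cong drop (⊆-trans-identityˡ τ)) (sym (cong drop (⊆-trans-identityʳ τ))))))))))

  UniEnv : ∀ {Γ Δ} → Env Γ Δ → Set
  UniEnv {Γ} ρ = ∀ {α} (x : Γ ∋ α) → Uni α (ρ x)

  EqEnv : ∀ {Γ Δ} → Env Γ Δ → Env Γ Δ → Set
  EqEnv {Γ} ρ ρ' = ∀ {α} (x : Γ ∋ α) → Eq α (ρ x) (ρ' x)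

  UniG : ∀ {Δ} → GEnv Δ → Set
  UniG g = ∀ α n → Uni α (g α n)

  EqG : ∀ {Δ} → GEnv Δ → GEnv Δ → Set
  EqG g g' = ∀ α n → Eq α (g α n) (g' α n)

  renEnv : ∀ {Γ Δ Θ} → Δ ⊆ Θ → Env Γ Δ → Env Γ Θ
  renEnv τ ρ x = renSem _ τ (ρ x)

  renG : ∀ {Δ Θ} → Δ ⊆ Θ → GEnv Δ → GEnv Θ
  renG τ g α n = renSem α τ (g α n)

  renEnv-Uni : ∀ {Γ Δ Θ} (τ : Δ ⊆ Θ) {ρ : Env Γ Δ} → UniEnv ρ → UniEnv (renEnv τ ρ)
  renEnv-Uni τ u x = renSem-Uni _ τ (u x)

  renG-Uni : ∀ {Δ Θ} (τ : Δ ⊆ Θ) {g : GEnv Δ} → UniG g → UniG (renG τ g)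
  renG-Uni τ u α n = renSem-Uni α τ (u α n)

  mutual
    eval-Uni : ∀ {Γ Δ α} (t : Tm Γ α) {ρ : Env Γ Δ} {g : GEnv Δ} →
               UniEnv ρ → UniG g → Uni α (eval ρ g t)
    eval-Uni (` bv x) uρ ug = uρ x
    eval-Uni (` fv {α} n) uρ ug = ug α n
    eval-Uni (` con {α} f) uρ ug = reflect-Uni α _
    eval-Uni {α = α ⇒ β} (ƛ t) {ρ} {g} uρ ug =
      (λ σ a ua → eval-Uni t (λ { here → ua ; (there x) → renSem-Uni _ σ (uρ x) }) (renG-Uni σ ug)) ,
      (λ σ a a' ua ua' ea → eval-Eq t
          (λ { here → ua ; (there x) → renSem-Uni _ σ (uρ x) })
          (λ { here → ua' ; (there x) → renSem-Uni _ σ (uρ x) })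
          (λ { here → ea ; (there x) → Eq-refl _ _ })
          (renG-Uni σ ug) (renG-Uni σ ug) (λ γ n → Eq-refl γ _)) ,
      (λ σ τ a ua → Eq-trans β
         (eval-nat t τ (λ { here → ua ; (there x) → renSem-Uni _ σ (uρ x) }) (renG-Uni σ ug))
         (eval-Eq t
           (λ { here → renSem-Uni α τ ua ; (there x) → renSem-Uni _ τ (renSem-Uni _ σ (uρ x)) })
           (λ { here → renSem-Uni α τ ua ; (there x) → renSem-Uni _ (⊆-trans σ τ) (uρ x) })
           (λ { here → Eq-refl α _ ; (there x) → Eq-sym _ (renSem-trans _ σ τ (ρ x)) })
           (renG-Uni τ (renG-Uni σ ug)) (renG-Uni (⊆-trans σ τ) ug)
           (λ γ n → Eq-sym γ (renSem-trans γ σ τ (g γ n)))))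
    eval-Uni (t · u) uρ ug = proj₁ (eval-Uni t uρ ug) ⊆-refl _ (eval-Uni u uρ ug)

    eval-Eq : ∀ {Γ Δ α} (t : Tm Γ α) {ρ ρ' : Env Γ Δ} {g g' : GEnv Δ} →
              UniEnv ρ → UniEnv ρ' → EqEnv ρ ρ' → UniG g → UniG g' → EqG g g' →
              Eq α (eval ρ g t) (eval ρ' g' t)
    eval-Eq (` bv x) uρ uρ' e ug ug' eg = e x
    eval-Eq (` fv {α} n) uρ uρ' e ug ug' eg = eg α n
    eval-Eq (` con {α} f) uρ uρ' e ug ug' eg = Eq-refl α _
    eval-Eq (ƛ t) {ρ} {ρ'} uρ uρ' e ug ug' eg σ a ua =
      eval-Eq t (λ { here → ua ; (there x) → renSem-Uni _ σ (uρ x) })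
                (λ { here → ua ; (there x) → renSem-Uni _ σ (uρ' x) })
                (λ { here → Eq-refl _ a ; (there x) → renSem-Eq _ σ (e x) })
                (renG-Uni σ ug) (renG-Uni σ ug') (λ γ n → renSem-Eq γ σ (eg γ n))
    eval-Eq {α = β} (_·_ {α} t u) uρ uρ' e ug ug' eg =
      Eq-trans β (eval-Eq t uρ uρ' e ug ug' eg ⊆-refl _ (eval-Uni u uρ ug))
        (proj₁ (proj₂ (eval-Uni t uρ' ug')) ⊆-refl _ _ (eval-Uni u uρ ug) (eval-Uni u uρ' ug')
           (eval-Eq u uρ uρ' e ug ug' eg))

    eval-nat : ∀ {Γ Δ Θ α} (t : Tm Γ α) (τ : Δ ⊆ Θ) {ρ : Env Γ Δ} {g : GEnv Δ} →
               UniEnv ρ → UniG g →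
               Eq α (renSem α τ (eval ρ g t)) (eval (renEnv τ ρ) (renG τ g) t)
    eval-nat (` bv x) τ uρ ug = Eq-refl _ _
    eval-nat (` fv {α} n) τ uρ ug = Eq-refl α _
    eval-nat (` con {α} f) τ uρ ug = reflect-nat α τ _
    eval-nat (ƛ t) τ {ρ} {g} uρ ug σ a ua =
      eval-Eq t (λ { here → ua ; (there x) → renSem-Uni _ (⊆-trans τ σ) (uρ x) })
                (λ { here → ua ; (there x) → renSem-Uni _ σ (renSem-Uni _ τ (uρ x)) })
                (λ { here → Eq-refl _ a ; (there x) → renSem-trans _ τ σ (ρ x) })
                (renG-Uni (⊆-trans τ σ) ug) (renG-Uni σ (renG-Uni τ ug))
                (λ γ n → renSem-trans γ τ σ (g γ n))
    eval-nat {α = β} (_·_ {α} t u) τ {ρ} {g} uρ ug =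
      let f = eval ρ g t
          a = eval ρ g u
          ut = eval-Uni t uρ ug
          ua = eval-Uni u uρ ug
          ut' = eval-Uni t (renEnv-Uni τ uρ) (renG-Uni τ ug)
          ua' = eval-Uni u (renEnv-Uni τ uρ) (renG-Uni τ ug)
      in Eq-trans β (proj₂ (proj₂ ut) ⊆-refl τ a ua)
         (Eq-trans β (Eq-≡ β (cong (λ z → f z (renSem α τ a)) (trans (⊆-trans-identityˡ τ) (sym (⊆-trans-identityʳ τ)))))
         (Eq-trans β (eval-nat t τ uρ ug ⊆-refl (renSem α τ a) (renSem-Uni α τ ua))
           (proj₁ (proj₂ ut') ⊆-refl _ _ (renSem-Uni α τ ua) ua' (eval-nat u τ uρ ug))))

  eval-ren : ∀ {Γ Γ' Δ α} (t : Tm Γ α) (ρ' : Γ ⊆ Γ') {ρ : Env Γ' Δ} {g : GEnv Δ} →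
             UniEnv ρ → UniG g →
             Eq α (eval ρ g (renTm ρ' t)) (eval (λ x → ρ (renVar ρ' x)) g t)
  eval-ren (` bv x) ρ' uρ ug = Eq-refl _ _
  eval-ren (` fv n) ρ' uρ ug = Eq-refl _ _
  eval-ren (` con f) ρ' uρ ug = Eq-refl _ _
  eval-ren (ƛ t) ρ' {ρ} {g} uρ ug σ a ua =
    Eq-trans _ (eval-ren t (keep ρ') (λ { here → ua ; (there x) → renSem-Uni _ σ (uρ x) }) (renG-Uni σ ug))
      (eval-Eq t (λ { here → ua ; (there x) → renSem-Uni _ σ (uρ (renVar ρ' x)) })
                 (λ { here → ua ; (there x) → renSem-Uni _ σ (uρ (renVar ρ' x)) })
                 (λ { here → Eq-refl _ a ; (there x) → Eq-refl _ _ })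
                 (renG-Uni σ ug) (renG-Uni σ ug) (λ γ n → Eq-refl γ _))
  eval-ren {α = β} (_·_ {α} t u) ρ' {ρ} {g} uρ ug =
    let uρ' = λ {γ} (x : _ ∋ γ) → uρ (renVar ρ' x) in
    Eq-trans β (eval-ren t ρ' uρ ug ⊆-refl _ (eval-Uni (renTm ρ' u) uρ ug))
      (proj₁ (proj₂ (eval-Uni t uρ' ug)) ⊆-refl _ _ (eval-Uni (renTm ρ' u) uρ ug) (eval-Uni u uρ' ug)
         (eval-ren u ρ' uρ ug))

  ext : ∀ {Γ Δ Θ α} → Δ ⊆ Θ → Sem α Θ → Env Γ Δ → Env (α ∷ Γ) Θ
  ext τ a ρ here = a
  ext τ a ρ (there x) = renSem _ τ (ρ x)

  ext-Uni : ∀ {Γ Δ Θ α} (τ : Δ ⊆ Θ) {a : Sem α Θ} {ρ : Env Γ Δ} → Uni α a → UniEnv ρ → UniEnv (ext τ a ρ)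
  ext-Uni τ ua uρ here = ua
  ext-Uni τ ua uρ (there x) = renSem-Uni _ τ (uρ x)

  eval-ƛ : ∀ {Γ Δ Θ α β} (t : Tm (α ∷ Γ) β) (τ : Δ ⊆ Θ) (a : Sem α Θ) {ρ : Env Γ Δ} {g : GEnv Δ} →
           UniEnv ρ → UniG g → Uni α a →
           Eq β (eval ρ g (ƛ t) τ a) (eval (ext τ a ρ) (renG τ g) t)
  eval-ƛ t τ a uρ ug ua =
    eval-Eq t (λ { here → ua ; (there x) → renSem-Uni _ τ (uρ x) }) (ext-Uni τ ua uρ)
      (λ { here → Eq-refl _ a ; (there x) → Eq-refl _ _ }) (renG-Uni τ ug) (renG-Uni τ ug) (λ γ n → Eq-refl γ _)

  eval-sub : ∀ {Γ Γ' Δ α} (t : Tm Γ α) (σ : Sub Γ Γ') {ρ : Env Γ' Δ} {g : GEnv Δ} →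
             UniEnv ρ → UniG g →
             Eq α (eval ρ g (subTm σ t)) (eval (λ x → eval ρ g (σ x)) g t)
  eval-sub (` bv x) σ uρ ug = Eq-refl _ _
  eval-sub (` fv n) σ uρ ug = Eq-refl _ _
  eval-sub (` con f) σ uρ ug = Eq-refl _ _
  eval-sub (ƛ t) σ {ρ} {g} uρ ug τ a ua =
    let uτg = renG-Uni τ ug
        ue = ext-Uni τ ua uρ
        uρ' = λ {γ} (x : _ ∋ γ) → eval-Uni (σ x) uρ ug in
    Eq-trans _ (eval-ƛ (subTm (liftS σ) t) τ a uρ ug ua)
     (Eq-trans _ (eval-sub t (liftS σ) ue uτg)
      (Eq-trans _ (eval-Eq t (λ x → eval-Uni (liftS σ x) ue uτg)
                 (ext-Uni τ ua uρ')
                 (λ { here → Eq-refl _ a ;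
                      (there x) → Eq-trans _ (eval-ren (σ x) wk ue uτg)
                        (Eq-trans _ (eval-Eq (σ x) (λ y → renSem-Uni _ τ (uρ (renVar ⊆-refl y)))
                                          (renEnv-Uni τ uρ)
                                          (λ y → Eq-≡ _ (cong (λ z → renSem _ τ (ρ z)) (renVar-id y)))
                                          uτg uτg (λ γ n → Eq-refl γ _))
                                    (Eq-sym _ (eval-nat (σ x) τ uρ ug))) })
                 uτg uτg (λ γ n → Eq-refl γ _))
       (Eq-sym _ (eval-ƛ t τ a uρ' ug ua))))
  eval-sub {α = β} (_·_ {α} t u) σ {ρ} {g} uρ ug =
    let uρ' = λ {γ} (x : _ ∋ γ) → eval-Uni (σ x) uρ ug in
    Eq-trans β (eval-sub t σ uρ ug ⊆-refl _ (eval-Uni (subTm σ u) uρ ug))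
      (proj₁ (proj₂ (eval-Uni t uρ' ug)) ⊆-refl _ _ (eval-Uni (subTm σ u) uρ ug) (eval-Uni u uρ' ug)
         (eval-sub u σ uρ ug))

  sbGEnvAt : ∀ {Γ0 Δ Θ α} → Env Δ Θ → GEnv Θ → Γ0 ⊆ Δ → ℕ → Maybe (Nf Γ0 α) → Sem α Θ
  sbGEnvAt ρ g ρ' n (just u) = eval ρ g (renTm ρ' ⌜ u ⌝)
  sbGEnvAt {α = α} ρ g ρ' n nothing = g α n

  sbGEnv : ∀ {Γ0 Δ Θ} → Env Δ Θ → GEnv Θ → (∀ β → ℕ → Maybe (Nf Γ0 β)) → Γ0 ⊆ Δ → GEnv Θ
  sbGEnv ρ g m ρ' α n = sbGEnvAt ρ g ρ' n (m α n)

  sbGEnvAt-Uni : ∀ {Γ0 Δ Θ α} {ρ : Env Δ Θ} {g : GEnv Θ} (ρ' : Γ0 ⊆ Δ) n (mu : Maybe (Nf Γ0 α)) →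
             UniEnv ρ → UniG g → Uni α (sbGEnvAt ρ g ρ' n mu)
  sbGEnvAt-Uni ρ' n (just u) uρ ug = eval-Uni (renTm ρ' ⌜ u ⌝) uρ ug
  sbGEnvAt-Uni {α = α} ρ' n nothing uρ ug = ug α n

  sbGEnv-Uni : ∀ {Γ0 Δ Θ} {ρ : Env Δ Θ} {g : GEnv Θ} m (ρ' : Γ0 ⊆ Δ) →
            UniEnv ρ → UniG g → UniG (sbGEnv ρ g m ρ')
  sbGEnv-Uni m ρ' uρ ug α n = sbGEnvAt-Uni ρ' n (m α n) uρ ug

  sbGEnvAt-wk : ∀ {Γ0 Δ Θ Θ' α β} {ρ : Env Δ Θ} {g : GEnv Θ} (ρ' : Γ0 ⊆ Δ) (τ : Θ ⊆ Θ')
             (ρa : Env (β ∷ Δ) Θ') → UniEnv ρa → EqEnv (λ x → ρa (there x)) (renEnv τ ρ) →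
             ∀ n (mu : Maybe (Nf Γ0 α)) → UniEnv ρ → UniG g →
             Eq α (sbGEnvAt ρa (renG τ g) (drop ρ') n mu) (renSem α τ (sbGEnvAt ρ g ρ' n mu))
  sbGEnvAt-wk {ρ = ρ} {g} ρ' τ ρa uρa eρa n (just u) uρ ug =
    Eq-trans _ (eval-ren ⌜ u ⌝ (drop ρ') uρa (renG-Uni τ ug))
     (Eq-trans _ (eval-Eq ⌜ u ⌝ (λ x → uρa (there (renVar ρ' x))) (λ x → renSem-Uni _ τ (uρ (renVar ρ' x)))
                    (λ x → eρa (renVar ρ' x)) (renG-Uni τ ug) (renG-Uni τ ug) (λ γ n → Eq-refl γ _))
      (Eq-sym _ (Eq-trans _ (renSem-Eq _ τ (eval-ren ⌜ u ⌝ ρ' uρ ug))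
        (eval-nat ⌜ u ⌝ τ (λ x → uρ (renVar ρ' x)) ug))))
  sbGEnvAt-wk {α = α} ρ' τ ρa uρa eρa n nothing uρ ug = Eq-refl α _

  eval-sb : ∀ {Γ0 Δ Θ α} (t : Tm Δ α) (m : ∀ β → ℕ → Maybe (Nf Γ0 β)) (ρ' : Γ0 ⊆ Δ)
            {ρ : Env Δ Θ} {g : GEnv Θ} → UniEnv ρ → UniG g →
            Eq α (eval ρ g (sbTm m ρ' t)) (eval ρ (sbGEnv ρ g m ρ') t)
  eval-sb (` bv x) m ρ' uρ ug = Eq-refl _ _
  eval-sb (` fv {α} n) m ρ' uρ ug with m α n
  ... | just u = Eq-refl α _
  ... | nothing = Eq-refl α _
  eval-sb (` con f) m ρ' uρ ug = Eq-refl _ _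
  eval-sb (ƛ t) m ρ' {ρ} {g} uρ ug τ a ua =
    let uτg = renG-Uni τ ug
        ue = ext-Uni τ ua uρ in
    Eq-trans _ (eval-ƛ (sbTm m (drop ρ') t) τ a uρ ug ua)
     (Eq-trans _ (eval-sb t m (drop ρ') ue uτg)
      (Eq-trans _ (eval-Eq t ue ue (λ x → Eq-refl _ _) (sbGEnv-Uni m (drop ρ') ue uτg)
        (renG-Uni τ (sbGEnv-Uni m ρ' uρ ug))
        (λ γ n → sbGEnvAt-wk ρ' τ (ext τ a ρ) ue (λ x → Eq-refl _ _) n (m γ n) uρ ug))
       (Eq-sym _ (eval-ƛ t τ a uρ (sbGEnv-Uni m ρ' uρ ug) ua))))
  eval-sb {α = β} (_·_ {α} t u) m ρ' {ρ} {g} uρ ug =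
    let ug' = sbGEnv-Uni m ρ' uρ ug in
    Eq-trans β (eval-sb t m ρ' uρ ug ⊆-refl _ (eval-Uni (sbTm m ρ' u) uρ ug))
      (proj₁ (proj₂ (eval-Uni t uρ ug')) ⊆-refl _ _ (eval-Uni (sbTm m ρ' u) uρ ug) (eval-Uni u uρ ug')
         (eval-sb u m ρ' uρ ug))

  evalH : ∀ {Γ Δ α} → Env Γ Δ → GEnv Δ → Head Γ α → Sem α Δ
  evalH ρ g h = eval ρ g (` h)

  evalH-Uni : ∀ {Γ Δ α} {ρ : Env Γ Δ} {g : GEnv Δ} (h : Head Γ α) → UniEnv ρ → UniG g → Uni α (evalH ρ g h)
  evalH-Uni h uρ ug = eval-Uni (` h) uρ ug

  evalH-wk : ∀ {Γ Δ Θ α β} {ρ : Env Γ Δ} {g : GEnv Δ} (τ : Δ ⊆ Θ) (ρa : Env (β ∷ Γ) Θ) →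
             EqEnv (λ x → ρa (there x)) (renEnv τ ρ) → (h : Head Γ α) →
             Eq α (evalH ρa (renG τ g) (renHead wk h)) (renSem α τ (evalH ρ g h))
  evalH-wk {ρ = ρ} τ ρa e (bv x) = Eq-trans _ (e (renVar ⊆-refl x))
                                     (Eq-≡ _ (cong (λ z → renSem _ τ (ρ z)) (renVar-id x)))
  evalH-wk τ ρa e (fv n) = Eq-refl _ _
  evalH-wk τ ρa e (con {α} f) = Eq-sym α (reflect-nat α τ _)

  mutual
    eval-hs : ∀ {Γ Γ' Δ α} (v : Nf Γ α) (σ : HSub Γ Γ') {ρ : Env Γ' Δ} {g : GEnv Δ} →
              UniEnv ρ → UniG g →
              Eq α (eval ρ g ⌜ hsNf σ v ⌝) (eval (λ x → evalH ρ g (σ x)) g ⌜ v ⌝)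
    eval-hs (lam v) σ {ρ} {g} uρ ug τ a ua =
      let uτg = renG-Uni τ ug
          ue = ext-Uni τ ua uρ
          uρ' = λ {γ} (x : _ ∋ γ) → evalH-Uni (σ x) uρ ug in
      Eq-trans _ (eval-ƛ ⌜ hsNf (liftHS σ) v ⌝ τ a uρ ug ua)
       (Eq-trans _ (eval-hs v (liftHS σ) ue uτg)
        (Eq-trans _ (eval-Eq ⌜ v ⌝ (λ x → evalH-Uni (liftHS σ x) ue uτg)
          (ext-Uni τ ua uρ')
          (λ { here → Eq-refl _ a ; (there x) → evalH-wk τ (ext τ a ρ) (λ y → Eq-refl _ _) (σ x) })
          uτg uτg (λ γ n → Eq-refl γ _))
         (Eq-sym _ (eval-ƛ ⌜ v ⌝ τ a uρ' ug ua))))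
    eval-hs (ne n) σ uρ ug = eval-hsNe n σ uρ ug

    eval-hsNe : ∀ {Γ Γ' Δ α} (n : Ne Γ α) (σ : HSub Γ Γ') {ρ : Env Γ' Δ} {g : GEnv Δ} →
              UniEnv ρ → UniG g →
              Eq α (eval ρ g ⌜ hsNe σ n ⌝ne) (eval (λ x → evalH ρ g (σ x)) g ⌜ n ⌝ne)
    eval-hsNe (hd (bv x)) σ uρ ug = Eq-refl _ _
    eval-hsNe (hd (fv n)) σ uρ ug = Eq-refl _ _
    eval-hsNe (hd (con f)) σ uρ ug = Eq-refl _ _
    eval-hsNe {α = β} (app {α} n u) σ {ρ} {g} uρ ug =
      let uρ' = λ {γ} (x : _ ∋ γ) → evalH-Uni (σ x) uρ ug in
      Eq-trans β (eval-hsNe n σ uρ ug ⊆-refl _ (eval-Uni ⌜ hsNf σ u ⌝ uρ ug))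
        (proj₁ (proj₂ (eval-Uni ⌜ n ⌝ne uρ' ug)) ⊆-refl _ _ (eval-Uni ⌜ hsNf σ u ⌝ uρ ug)
           (eval-Uni ⌜ u ⌝ uρ' ug) (eval-hs u σ uρ ug))

  -- By soundness and nf-≃, T ≃ T' holds exactly when T and T' have the same normal form.
  infix 4 _≃_
  record _≃_ {Γ α} (T T' : Tm Γ α) : Set where
    constructor ≃i
    field run : ∀ {Δ} (ρ : Env Γ Δ) (g : GEnv Δ) → UniEnv ρ → UniG g → Eq α (eval ρ g T) (eval ρ g T')
  open _≃_ public

  ≃-refl : ∀ {Γ α} {T : Tm Γ α} → T ≃ T
  ≃-refl = ≃i λ ρ g uρ ug → Eq-refl _ _

  ≃-sym : ∀ {Γ α} {T T' : Tm Γ α} → T ≃ T' → T' ≃ T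
  ≃-sym e = ≃i λ ρ g uρ ug → Eq-sym _ (run e ρ g uρ ug)

  ≃-trans : ∀ {Γ α} {T T' T'' : Tm Γ α} → T ≃ T' → T' ≃ T'' → T ≃ T''
  ≃-trans e e' = ≃i λ ρ g uρ ug → Eq-trans _ (run e ρ g uρ ug) (run e' ρ g uρ ug)

  ≃-≡ : ∀ {Γ α} {T T' : Tm Γ α} → T ≡ T' → T ≃ T'
  ≃-≡ refl = ≃-refl

  ≃-app : ∀ {Γ α β} {T T' : Tm Γ (α ⇒ β)} {U U' : Tm Γ α} → T ≃ T' → U ≃ U' → (T · U) ≃ (T' · U')
  ≃-app {β = β} {T} {T'} {U} {U'} e e' = ≃i λ ρ g uρ ug →
    Eq-trans β (run e ρ g uρ ug ⊆-refl _ (eval-Uni U uρ ug))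
      (proj₁ (proj₂ (eval-Uni T' uρ ug)) ⊆-refl _ _ (eval-Uni U uρ ug) (eval-Uni U' uρ ug) (run e' ρ g uρ ug))

  ≃-ƛ : ∀ {Γ α β} {T T' : Tm (α ∷ Γ) β} → T ≃ T' → (ƛ T) ≃ (ƛ T')
  ≃-ƛ {T = T} {T'} e = ≃i λ ρ g uρ ug τ a ua →
    Eq-trans _ (eval-ƛ T τ a uρ ug ua)
      (Eq-trans _ (run e (ext τ a ρ) (renG τ g) (ext-Uni τ ua uρ) (renG-Uni τ ug))
        (Eq-sym _ (eval-ƛ T' τ a uρ ug ua)))

  ≃-ren : ∀ {Γ Γ' α} (τ : Γ ⊆ Γ') {T T' : Tm Γ α} → T ≃ T' → renTm τ T ≃ renTm τ T'
  ≃-ren τ {T} {T'} e = ≃i λ ρ g uρ ug →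
    Eq-trans _ (eval-ren T τ uρ ug)
      (Eq-trans _ (run e (λ x → ρ (renVar τ x)) g (λ x → uρ (renVar τ x)) ug)
        (Eq-sym _ (eval-ren T' τ uρ ug)))

  Rel : ∀ α {Γ} → Tm Γ α → Sem α Γ → Set
  Rel (base b) T n = T ≃ ⌜ n ⌝ne
  Rel (α ⇒ β) {Γ} T f = ∀ {Δ} (τ : Γ ⊆ Δ) (U : Tm Δ α) (a : Sem α Δ) → Uni α a → Rel α U a →
                        Rel β (renTm τ T · U) (f τ a)

  Rel-≃ : ∀ α {Γ} {T T' : Tm Γ α} {s : Sem α Γ} → T ≃ T' → Rel α T s → Rel α T' s
  Rel-≃ (base b) e r = ≃-trans (≃-sym e) r
  Rel-≃ (α ⇒ β) e r τ U a ua ra = Rel-≃ β (≃-app (≃-ren τ e) ≃-refl) (r τ U a ua ra)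

  Rel-Eq : ∀ α {Γ} {T : Tm Γ α} {s s' : Sem α Γ} → Rel α T s → Eq α s s' → Rel α T s'
  Rel-Eq (base b) r refl = r
  Rel-Eq (α ⇒ β) r e τ U a ua ra = Rel-Eq β (r τ U a ua ra) (e τ a ua)

  Rel-ren : ∀ α {Γ Δ} (τ : Γ ⊆ Δ) {T : Tm Γ α} {s : Sem α Γ} → Rel α T s → Rel α (renTm τ T) (renSem α τ s)
  Rel-ren (base b) τ {T} {s} r = ≃-trans (≃-ren τ r) (≃-≡ (sym (⌜⌝ne-renNe τ s)))
  Rel-ren (α ⇒ β) τ {T} r τ' U a ua ra =
    Rel-≃ β (≃-app (≃-≡ (renTm-trans τ τ' T)) ≃-refl) (r (⊆-trans τ τ') U a ua ra)

  mutual
    Rel-reflect : ∀ α {Γ} {T : Tm Γ α} (n : Ne Γ α) → T ≃ ⌜ n ⌝ne → Rel α T (reflect α n)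
    Rel-reflect (base b) n e = e
    Rel-reflect (α ⇒ β) n e τ U a ua ra =
      Rel-reflect β _ (≃-app (≃-trans (≃-ren τ e) (≃-≡ (sym (⌜⌝ne-renNe τ n)))) (Rel-reify α ra ua))

    Rel-reify : ∀ α {Γ} {T : Tm Γ α} {s : Sem α Γ} → Rel α T s → Uni α s → T ≃ ⌜ reify α s ⌝
    Rel-reify (base b) r us = r
    Rel-reify (α ⇒ β) {T = T} {f} r us =
      ≃-trans (η-law T) (≃-ƛ (Rel-reify β (r wk (` bv here) (var0Sem α) (reflect-Uni α _)
                           (Rel-reflect α (hd (bv here)) ≃-refl)) (proj₁ us wk _ (reflect-Uni α _))))

    η-law : ∀ {Γ α β} (T : Tm Γ (α ⇒ β)) → T ≃ (ƛ (renTm wk T · ` bv here))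
    η-law {α = α} {β} T = ≃i λ ρ g uρ ug τ a ua →
      let f = eval ρ g T in
      Eq-trans β (Eq-≡ β (cong (λ z → f z a) (sym (⊆-trans-identityʳ τ))))
       (Eq-trans β (eval-nat T τ uρ ug ⊆-refl a ua)
        (Eq-trans β (Eq-sym (α ⇒ β)
           (Eq-trans (α ⇒ β) (eval-ren T wk (ext-Uni τ ua uρ) (renG-Uni τ ug))
             (eval-Eq T (λ x → renSem-Uni _ τ (uρ (renVar ⊆-refl x))) (renEnv-Uni τ uρ)
               (λ x → Eq-≡ _ (cong (λ z → renSem _ τ (ρ z)) (renVar-id x)))
               (renG-Uni τ ug) (renG-Uni τ ug) (λ γ n → Eq-refl γ _))) ⊆-refl a ua)
         (Eq-sym β (eval-ƛ (renTm wk T · ` bv here) τ a uρ ug ua))))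

  β-law : ∀ {Γ Δ Δ' α β} (t : Tm (α ∷ Γ) β) (σ : Sub Γ Δ) (τ : Δ ⊆ Δ') (U : Tm Δ' α) →
          subTm (consS U (λ x → renTm τ (σ x))) t ≃ (renTm τ (ƛ subTm (liftS σ) t) · U)
  β-law {α = α} {β} t σ τ U = ≃i λ ρ1 g1 uρ1 ug1 →
    let uU = eval-Uni U uρ1 ug1
        E1 = ext ⊆-refl (eval ρ1 g1 U) ρ1
        uE1 = ext-Uni ⊆-refl uU uρ1
        G1 = renG ⊆-refl g1
        uG1 = renG-Uni ⊆-refl ug1
        E2 = λ {γ} (x : _ ∋ γ) → E1 (renVar (keep τ) x)
        uE2 = λ {γ} (x : _ ∋ γ) → uE1 (renVar (keep τ) x)
        uσ' = λ {γ} (x : _ ∋ γ) → eval-Uni (consS U (λ x → renTm τ (σ x)) x) uρ1 ug1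
    in
    Eq-trans β (eval-sub t (consS U (λ x → renTm τ (σ x))) uρ1 ug1)
     (Eq-sym β
      (Eq-trans β (eval-ƛ (renTm (keep τ) (subTm (liftS σ) t)) ⊆-refl (eval ρ1 g1 U) uρ1 ug1 uU)
       (Eq-trans β (eval-ren (subTm (liftS σ) t) (keep τ) uE1 uG1)
        (Eq-trans β (eval-sub t (liftS σ) uE2 uG1)
         (eval-Eq t (λ x → eval-Uni (liftS σ x) uE2 uG1) uσ'
           (λ { here → Eq-refl α _ ;
                (there x) → Eq-trans _ (eval-ren (σ x) wk uE2 uG1)
                  (Eq-trans _ (eval-Eq (σ x)
                      (λ y → uE2 (renVar wk y)) (λ y → uρ1 (renVar τ y))
                      (λ y → Eq-trans _ (renSem-id _ _) (Eq-≡ _ (cong (λ z → ρ1 (renVar τ z)) (renVar-id y))))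
                      uG1 ug1 (λ γ n → renSem-id γ _))
                    (Eq-sym _ (eval-ren (σ x) τ uρ1 ug1))) })
           uG1 ug1 (λ γ n → renSem-id γ _))))))

  fundamental : ∀ {Γ Δ α} (t : Tm Γ α) (σ : Sub Γ Δ) (ρ : Env Γ Δ) (g : GEnv Δ) →
                UniEnv ρ → UniG g → (∀ {γ} (x : Γ ∋ γ) → Rel γ (σ x) (ρ x)) →
                (∀ γ n → Rel γ (` fv n) (g γ n)) →
                Rel α (subTm σ t) (eval ρ g t)
  fundamental (` bv x) σ ρ g uρ ug rσ rg = rσ x
  fundamental (` fv {γ} n) σ ρ g uρ ug rσ rg = rg γ n
  fundamental (` con {γ} f) σ ρ g uρ ug rσ rg = Rel-reflect γ _ ≃-refl
  fundamental {α = β} (_·_ {α} t u) σ ρ g uρ ug rσ rg =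
    Rel-≃ β (≃-app (≃-≡ (renTm-id (subTm σ t))) ≃-refl)
      (fundamental t σ ρ g uρ ug rσ rg ⊆-refl (subTm σ u) (eval ρ g u) (eval-Uni u uρ ug)
        (fundamental u σ ρ g uρ ug rσ rg))
  fundamental {α = α ⇒ β} (ƛ t) σ ρ g uρ ug rσ rg τ U a ua ra =
    Rel-Eq β
      (Rel-≃ β (β-law t σ τ U)
        (fundamental t (consS U (λ x → renTm τ (σ x))) (ext τ a ρ) (renG τ g)
          (ext-Uni τ ua uρ) (renG-Uni τ ug)
          (λ { here → ra ; (there x) → Rel-ren _ τ (rσ x) })
          (λ γ n → Rel-ren γ τ (rg γ n))))
      (Eq-sym β (eval-ƛ t τ a uρ ug ua))

  idEnv : ∀ {Γ} → Env Γ Γ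
  idEnv {α = γ} x = reflect γ (hd (bv x))

  idGEnv : ∀ {Γ} → GEnv Γ
  idGEnv γ n = reflect γ (hd (fv n))

  idEnv-Uni : ∀ {Γ} → UniEnv (idEnv {Γ})
  idEnv-Uni x = reflect-Uni _ _

  idGEnv-Uni : ∀ {Γ} → UniG (idGEnv {Γ})
  idGEnv-Uni γ n = reflect-Uni γ _

  soundness : ∀ {Γ α} (T : Tm Γ α) → T ≃ ⌜ nf T ⌝
  soundness {Γ} {α} T =
    Rel-reify α
      (Rel-≃ α (≃i λ ρ g uρ ug → eval-sub T (λ x → ` bv x) uρ ug)
        (fundamental T (λ x → ` bv x) idEnv idGEnv idEnv-Uni idGEnv-Uni
          (λ x → Rel-reflect _ (hd (bv x)) ≃-refl) (λ γ n → Rel-reflect γ (hd (fv n)) ≃-refl)))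
      (eval-Uni T idEnv-Uni idGEnv-Uni)

  nf-≃ : ∀ {Γ α} {T T' : Tm Γ α} → T ≃ T' → nf T ≡ nf T'
  nf-≃ {α = α} e = reify-Eq α (run e idEnv idGEnv idEnv-Uni idGEnv-Uni)

  ηNe : ∀ α {Γ} → Ne Γ α → Nf Γ α
  ηNe α n = reify α (reflect α n)

  η-ren : ∀ α {Γ Δ} (ρ : Γ ⊆ Δ) (n : Ne Γ α) → renNf ρ (ηNe α n) ≡ ηNe α (renNe ρ n)
  η-ren α ρ n = trans (reify-nat α ρ (reflect α n) (reflect-Uni α n)) (reify-Eq α (reflect-nat α ρ n))

  η-≃ : ∀ α {Γ} (n : Ne Γ α) → ⌜ ηNe α n ⌝ ≃ ⌜ n ⌝ne
  η-≃ α n = ≃-sym (Rel-reify α (Rel-reflect α n ≃-refl) (reflect-Uni α n))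

  EtaLongSem : ∀ α {Γ} → Sem α Γ → Set
  EtaLongSem (base b) n = EtaLongNe n
  EtaLongSem (α ⇒ β) {Γ} f = ∀ {Δ} (ρ : Γ ⊆ Δ) a → EtaLongSem α a → EtaLongSem β (f ρ a)

  mutual
    reify-EL : ∀ α {Γ} {s : Sem α Γ} → EtaLongSem α s → EtaLong (reify α s)
    reify-EL (base b) e = ne e
    reify-EL (α ⇒ β) e = lam (reify-EL β (e wk _ (reflect-EL α hd)))

    reflect-EL : ∀ α {Γ} {n : Ne Γ α} → EtaLongNe n → EtaLongSem α (reflect α n)
    reflect-EL (base b) e = e
    reflect-EL (α ⇒ β) e ρ a ea = reflect-EL β (app (renNe-EL ρ e) (reify-EL α ea))

  renSem-EtaLongSem : ∀ α {Γ Δ} (ρ : Γ ⊆ Δ) {s : Sem α Γ} → EtaLongSem α s → EtaLongSem α (renSem α ρ s)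
  renSem-EtaLongSem (base b) ρ e = renNe-EL ρ e
  renSem-EtaLongSem (α ⇒ β) ρ e σ a ea = e (⊆-trans ρ σ) a ea

  eval-EtaLongSem : ∀ {Γ Δ α} (t : Tm Γ α) {ρ : Env Γ Δ} {g : GEnv Δ} →
             (∀ {β} (x : Γ ∋ β) → EtaLongSem β (ρ x)) → (∀ β n → EtaLongSem β (g β n)) → EtaLongSem α (eval ρ g t)
  eval-EtaLongSem (` bv x) eρ eg = eρ x
  eval-EtaLongSem (` fv {β} n) eρ eg = eg β n
  eval-EtaLongSem (` con {β} f) eρ eg = reflect-EL β hd
  eval-EtaLongSem (ƛ t) eρ eg σ a ea =
    eval-EtaLongSem t (λ { here → ea ; (there x) → renSem-EtaLongSem _ σ (eρ x) }) (λ β n → renSem-EtaLongSem β σ (eg β n))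
  eval-EtaLongSem (t · u) eρ eg = eval-EtaLongSem t eρ eg ⊆-refl _ (eval-EtaLongSem u eρ eg)

  nf-EL : ∀ {Γ α} (T : Tm Γ α) → EtaLong (nf T)
  nf-EL {α = α} T = reify-EL α (eval-EtaLongSem T (λ x → reflect-EL _ hd) (λ β n → reflect-EL β hd))

  ηNe-EL : ∀ α {Γ} {n : Ne Γ α} → EtaLongNe n → EtaLong (ηNe α n)
  ηNe-EL α e = reify-EL α (reflect-EL α e)

  idExt : ∀ {Γ α} → EqEnv (ext wk (var0Sem α) (idEnv {Γ})) (idEnv {α ∷ Γ})
  idExt here = Eq-refl _ _
  idExt (there x) = Eq-trans _ (reflect-nat _ wk (hd (bv x)))
                      (reflect-cong _ (cong (λ z → hd (bv (there z))) (renVar-id x)))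

  idGEnv-wk : ∀ {Γ Δ} (ρ : Γ ⊆ Δ) → EqG (renG ρ idGEnv) idGEnv
  idGEnv-wk ρ γ n = reflect-nat γ ρ (hd (fv n))

  mutual
    stable : ∀ {Γ α} {v : Nf Γ α} → EtaLong v → nf ⌜ v ⌝ ≡ v
    stable {α = α ⇒ β} {lam v} (lam e) = cong lam
      (trans (reify-Eq β (Eq-trans β
         (eval-ƛ ⌜ v ⌝ wk (var0Sem α) idEnv-Uni idGEnv-Uni (reflect-Uni α _))
         (eval-Eq ⌜ v ⌝ (ext-Uni _ (reflect-Uni α _) idEnv-Uni) idEnv-Uni idExt
            (renG-Uni _ idGEnv-Uni) idGEnv-Uni (idGEnv-wk _))))
        (stable e))
    stable {v = ne n} (ne e) = cong ne (stableNe e)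

    stableNe : ∀ {Γ α} {n : Ne Γ α} → EtaLongNe n → Eq α (eval idEnv idGEnv ⌜ n ⌝ne) (reflect α n)
    stableNe {n = hd (bv x)} hd = Eq-refl _ _
    stableNe {n = hd (fv n)} hd = Eq-refl _ _
    stableNe {n = hd (con f)} hd = Eq-refl _ _
    stableNe {α = β} {n = app {α} n u} (app e e') =
      Eq-trans β (stableNe e ⊆-refl _ (eval-Uni ⌜ u ⌝ idEnv-Uni idGEnv-Uni))
        (reflect-cong β (cong₂ app (renNe-id n) (stable e')))

  nf-ne-η : ∀ {Γ α} {n : Ne Γ α} → EtaLongNe n → nf ⌜ n ⌝ne ≡ ηNe α n
  nf-ne-η {α = α} e = reify-Eq α (stableNe e)

  ∅E : ∀ {Δ} → Env [] Δ
  ∅E ()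

  ∅-Uni : ∀ {Δ} (ρ : Env [] Δ) → UniEnv ρ
  ∅-Uni ρ ()

  ∅-Eq : ∀ {Δ} (ρ ρ' : Env [] Δ) → EqEnv ρ ρ'
  ∅-Eq ρ ρ' ()

  substTm : ∀ {Γ α} → Subst Γ → Nf [] α → Tm Γ α
  substTm θ t = sbTm (Subst.map θ) ⊆-refl (renTm ε⊆ ⌜ t ⌝)

  eval-substTm : ∀ {Γ Δ α} (θ : Subst Γ) (t : Nf [] α) {ρ : Env Γ Δ} {g : GEnv Δ} → UniEnv ρ → UniG g →
           Eq α (eval ρ g (substTm θ t)) (eval ∅E (sbGEnv ρ g (Subst.map θ) ⊆-refl) ⌜ t ⌝)
  eval-substTm θ t {ρ} uρ ug =
    let ug' = sbGEnv-Uni (Subst.map θ) ⊆-refl uρ ug in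
    Eq-trans _ (eval-sb (renTm ε⊆ ⌜ t ⌝) (Subst.map θ) ⊆-refl uρ ug)
      (Eq-trans _ (eval-ren ⌜ t ⌝ ε⊆ uρ ug')
        (eval-Eq ⌜ t ⌝ (∅-Uni (λ x → ρ (renVar ε⊆ x))) (∅-Uni ∅E) (∅-Eq (λ x → ρ (renVar ε⊆ x)) ∅E) ug' ug' (λ γ n → Eq-refl γ _)))

  mapM : ∀ {Γ Δ α} → (Nf Γ α → Nf Δ α) → Maybe (Nf Γ α) → Maybe (Nf Δ α)
  mapM f (just u) = just (f u)
  mapM f nothing = nothing

  mapM-just : ∀ {Γ Δ α} (f : Nf Γ α → Nf Δ α) (mu : Maybe (Nf Γ α)) {u} → mapM f mu ≡ just u →
              Σ (Nf Γ α) λ u' → (mu ≡ just u') × (f u' ≡ u)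
  mapM-just f (just u') refl = u' , refl , refl
  mapM-just f nothing ()

  hsSubst : ∀ {Γ Δ} → HSub Γ Δ → Subst Γ → Subst Δ
  hsSubst σ θ = record
    { map = λ α n → mapM (hsNf σ) (Subst.map θ α n)
    ; dom = Subst.dom θ
    ; finite = λ α n u eq → let (u' , e1 , e2) = mapM-just (hsNf σ) (Subst.map θ α n) eq
                            in Subst.finite θ α n u' e1
    ; etaLong = λ α n u eq → let (u' , e1 , e2) = mapM-just (hsNf σ) (Subst.map θ α n) eq
                             in subst EtaLong e2 (hsNf-EL σ (Subst.etaLong θ α n u' e1))
    }

  sbGEnvAt-hs : ∀ {Γ Δ Θ α} (σ : HSub Γ Δ) {ρ : Env Δ Θ} {g : GEnv Θ} n (mu : Maybe (Nf Γ α)) →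
           UniEnv ρ → UniG g →
           Eq α (sbGEnvAt (λ x → evalH ρ g (σ x)) g ⊆-refl n mu) (sbGEnvAt ρ g ⊆-refl n (mapM (hsNf σ) mu))
  sbGEnvAt-hs σ {ρ} {g} n (just u) uρ ug =
    Eq-trans _ (Eq-≡ _ (cong (eval (λ x → evalH ρ g (σ x)) g) (renTm-id ⌜ u ⌝)))
      (Eq-trans _ (Eq-sym _ (eval-hs u σ uρ ug)) (Eq-≡ _ (cong (eval ρ g) (sym (renTm-id ⌜ hsNf σ u ⌝)))))
  sbGEnvAt-hs σ n nothing uρ ug = Eq-refl _ _

  hsNf-[]↓ : ∀ {Γ Δ α} (σ : HSub Γ Δ) (θ : Subst Γ) (t : Nf [] α) →
            hsNf σ (t [ θ ]↓) ≡ t [ hsSubst σ θ ]↓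
  hsNf-[]↓ σ θ t = trans (sym (stable (hsNf-EL σ (nf-EL (substTm θ t))))) (nf-≃ {T = ⌜ hsNf σ (nf (substTm θ t)) ⌝} {T' = substTm (hsSubst σ θ) t} (≃i λ ρ g uρ ug →
    let uE = λ {γ} (x : _ ∋ γ) → evalH-Uni (σ x) uρ ug in
    Eq-trans _ (eval-hs (nf (substTm θ t)) σ uρ ug)
     (Eq-trans _ (run (≃-sym (soundness (substTm θ t))) _ g uE ug)
      (Eq-trans _ (eval-substTm θ t uE ug)
       (Eq-trans _ (eval-Eq ⌜ t ⌝ (∅-Uni ∅E) (∅-Uni ∅E) (∅-Eq ∅E ∅E) (sbGEnv-Uni (Subst.map θ) ⊆-refl uE ug)
                      (sbGEnv-Uni (Subst.map (hsSubst σ θ)) ⊆-refl uρ ug)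
                      (λ γ n → sbGEnvAt-hs σ n (Subst.map θ γ n) uρ ug))
         (Eq-sym _ (eval-substTm (hsSubst σ θ) t uρ ug))))))) 

  conSpine : ∀ {Γ α} (θ : Subst Γ) {n : Ne [] α} → TopCon n → Ne Γ α
  conSpine θ (hd {f = f}) = hd (con f)
  conSpine θ (app {u = u} tc) = app (conSpine θ tc) (u [ θ ]↓)

  conSpine-TopCon : ∀ {Γ α} (θ : Subst Γ) {n : Ne [] α} (tc : TopCon n) → TopCon (conSpine θ tc)
  conSpine-TopCon θ hd = hd
  conSpine-TopCon θ (app tc) = app (conSpine-TopCon θ tc)

  eval-conSpine : ∀ {Γ α} (θ : Subst Γ) {n : Ne [] α} (tc : TopCon n) →
                Eq α (eval idEnv idGEnv (sbTm (Subst.map θ) ⊆-refl (renTm ε⊆ ⌜ n ⌝ne))) (reflect α (conSpine θ tc))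
  eval-conSpine θ hd = Eq-refl _ _
  eval-conSpine θ (app {α} {β} {u = u} tc) =
    Eq-trans β (eval-conSpine θ tc ⊆-refl _ (eval-Uni (substTm θ u) idEnv-Uni idGEnv-Uni))
      (reflect-cong β (cong (λ z → app z (u [ θ ]↓)) (renNe-id _)))

  lhs[]↓-TopCon : ∀ {Γ} (ρr : Rule) (θ : Subst Γ) →
            Σ (Ne Γ (base (Rule.sort ρr))) λ m → (Rule.lhs ρr [ θ ]↓ ≡ ne m) × TopCon m
  lhs[]↓-TopCon ρr θ with Rule.lhs ρr | Rule.lhs-top ρr
  ... | ne n | ne tc = conSpine θ tc , cong ne (eval-conSpine θ tc) , conSpine-TopCon θ tc

  mutual
    eval-local : ∀ {Γ Δ α} (v : Nf Γ α) {E E' : Env Γ Δ} {g : GEnv Δ} → UniEnv E → UniEnv E' → UniG g →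
          (∀ {β} (y : Γ ∋ β) → UsesNf v y → Eq β (E y) (E' y)) →
          Eq α (eval E g ⌜ v ⌝) (eval E' g ⌜ v ⌝)
    eval-local (lam v) {E} {E'} uE uE' ug h τ a ua =
      Eq-trans _ (eval-ƛ ⌜ v ⌝ τ a uE ug ua)
       (Eq-trans _ (eval-local v (ext-Uni τ ua uE) (ext-Uni τ ua uE') (renG-Uni τ ug)
                     (λ { here u → Eq-refl _ a ; (there y) u → renSem-Eq _ τ (h y (lam u)) }))
        (Eq-sym _ (eval-ƛ ⌜ v ⌝ τ a uE' ug ua)))
    eval-local (ne n) uE uE' ug h = evalNe-local n uE uE' ug (λ y u → h y (ne u))

    evalNe-local : ∀ {Γ Δ α} (n : Ne Γ α) {E E' : Env Γ Δ} {g : GEnv Δ} → UniEnv E → UniEnv E' → UniG g →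
          (∀ {β} (y : Γ ∋ β) → UsesNe n y → Eq β (E y) (E' y)) →
          Eq α (eval E g ⌜ n ⌝ne) (eval E' g ⌜ n ⌝ne)
    evalNe-local (hd (bv y)) uE uE' ug h = h y hd
    evalNe-local (hd (fv m)) uE uE' ug h = Eq-refl _ _
    evalNe-local (hd (con f)) uE uE' ug h = Eq-refl _ _
    evalNe-local {α = β} (app n u) {E} {E'} {g} uE uE' ug h =
      Eq-trans β (evalNe-local n uE uE' ug (λ y p → h y (appL p)) ⊆-refl _ (eval-Uni ⌜ u ⌝ uE ug))
        (proj₁ (proj₂ (eval-Uni ⌜ n ⌝ne uE' ug)) ⊆-refl _ _ (eval-Uni ⌜ u ⌝ uE ug) (eval-Uni ⌜ u ⌝ uE' ug)
          (eval-local u uE uE' ug (λ y p → h y (appR p))))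

  nf-ƛ : ∀ {Γ α β} (X : Tm (α ∷ Γ) β) → nf (ƛ X) ≡ lam (nf X)
  nf-ƛ {α = α} {β} X = cong lam (reify-Eq β (Eq-trans β
         (eval-ƛ X wk (var0Sem α) idEnv-Uni idGEnv-Uni (reflect-Uni α _))
         (eval-Eq X (ext-Uni _ (reflect-Uni α _) idEnv-Uni) idEnv-Uni idExt
            (renG-Uni _ idGEnv-Uni) idGEnv-Uni (idGEnv-wk _))))

  nf-ren : ∀ {Γ Δ α} (ρ : Γ ⊆ Δ) (X : Tm Γ α) → renNf ρ (nf X) ≡ nf (renTm ρ X)
  nf-ren {α = α} ρ X = trans (reify-nat α ρ _ (eval-Uni X idEnv-Uni idGEnv-Uni))
    (reify-Eq α (Eq-trans α (eval-nat X ρ idEnv-Uni idGEnv-Uni)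
      (Eq-trans α (eval-Eq X (renEnv-Uni ρ idEnv-Uni) (λ x → idEnv-Uni (renVar ρ x))
          (λ x → reflect-nat _ ρ (hd (bv x))) (renG-Uni ρ idGEnv-Uni) idGEnv-Uni (idGEnv-wk ρ))
        (Eq-sym α (eval-ren X ρ idEnv-Uni idGEnv-Uni)))))

  nf-app-var0 : ∀ {α β} (w : Nf (α ∷ []) β) →
            nf (⌜ lam w ⌝ · ⌜ ηNe α (hd (fv 0)) ⌝) ≡ nf ⌜ hsNf openHS w ⌝
  nf-app-var0 {α} {β} w = nf-≃ {T = ⌜ lam w ⌝ · ⌜ ηNe α (hd (fv 0)) ⌝} {T' = ⌜ hsNf openHS w ⌝} (≃i λ ρ g uρ ug →
    let uz = eval-Uni ⌜ ηNe α (hd (fv {α = α} 0)) ⌝ uρ ug in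
    Eq-trans β (eval-ƛ ⌜ w ⌝ ⊆-refl _ uρ ug uz)
      (Eq-trans β (eval-Eq ⌜ w ⌝ (ext-Uni ⊆-refl uz uρ) (λ x → evalH-Uni (openHS x) uρ ug)
           (λ { here → run (≃-sym (soundness (` fv {α = α} 0))) ρ g uρ ug ; (there ()) })
           (renG-Uni ⊆-refl ug) ug (λ γ n → renSem-id γ _))
        (Eq-sym β (eval-hs w openHS uρ ug))))

  η-hs : ∀ α {Γ Δ} (σ : HSub Γ Δ) {n : Ne Γ α} → EtaLongNe n → hsNf σ (ηNe α n) ≡ ηNe α (hsNe σ n)
  η-hs α σ {n} e = trans (sym (stable (hsNf-EL σ (ηNe-EL α e))))
    (trans (nf-≃ {T = ⌜ hsNf σ (ηNe α n) ⌝} {T' = ⌜ hsNe σ n ⌝ne} (≃i λ ρ g uρ ug →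
       let uE = λ {γ} (x : _ ∋ γ) → evalH-Uni (σ x) uρ ug in
       Eq-trans α (eval-hs (ηNe α n) σ uρ ug)
        (Eq-trans α (run (η-≃ α n) _ g uE ug) (Eq-sym α (eval-hsNe n σ uρ ug)))))
     (nf-ne-η (hsNe-EL σ e)))

  η-inj : ∀ α {Γ} {n n' : Ne Γ α} → ηNe α n ≡ ηNe α n' → n ≡ n'
  η-inj (base b) e = ne-injective e
  η-inj (α ⇒ β) e = wkNe-injective (proj₁ (app-injective (η-inj β (lam-injective e))))

  η-uses : ∀ α {Γ β} {n : Ne Γ α} {y : Γ ∋ β} → UsesNe n y → UsesNf (ηNe α n) y
  η-uses (base b) u = ne u
  η-uses (α ⇒ β) {y = y} u =
    lam (η-uses β (appL (subst (UsesNe _) (cong there (renVar-id y)) (uses-renNe wk u))))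

  η-fv : ∀ α {Γ} {n : Ne Γ α} {x : Var} → x ∈FVne n → x ∈FV ηNe α n
  η-fv (base b) p = ne p
  η-fv (α ⇒ β) p = lam (η-fv β (appL (fv-renNe wk p)))

  η-Subterm-arg : ∀ α {Γ γ} (m : Ne Γ α) {u : Nf Γ γ} → ArgOf u m →
         Σ Ctx λ Δ → Σ (Γ ⊆ Δ) λ ρ → Subterm (ηNe α m) (renNf ρ u)
  η-Subterm-arg (base b) m {u} p = _ , ⊆-refl , arg p (subst (Subterm u) (sym (renNf-id u)) self)
  η-Subterm-arg (α ⇒ β) m {u} p with η-Subterm-arg β (app (renNe wk m) (ηNe α (hd (bv here))))
                                (earlier (ArgOf-renNe wk p))
  ... | Δ , ρ , q = Δ , ⊆-trans wk ρ ,
                    under (subst (Subterm _) (sym (renNf-trans wk ρ u)) q)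

  -- Spines h y₁ … yₖ of bound variables in η-long form, as they occur in η-expansions of a head.
  data ηSpine : ∀ {Γ α} → Ne Γ α → Set where
    hd  : ∀ {Γ α} {h : Head Γ α} → ηSpine (hd h)
    app : ∀ {Γ α β} {n : Ne Γ (α ⇒ β)} (y : Γ ∋ α) → ηSpine n → ηSpine (app n (ηNe α (hd (bv y))))

  ηSpine-renNe : ∀ {Γ Δ α} (ρ : Γ ⊆ Δ) {n : Ne Γ α} → ηSpine n → ηSpine (renNe ρ n)
  ηSpine-renNe ρ hd = hd
  ηSpine-renNe ρ (app {α = α} {n = n} y e) =
    subst (λ z → ηSpine (app (renNe ρ n) z)) (sym (η-ren α ρ (hd (bv y)))) (app (renVar ρ y) (ηSpine-renNe ρ e))

  liftHS-here-inv : ∀ {Γ Δ α} (σ : HSub Γ Δ) (y : (α ∷ Γ) ∋ α) → liftHS σ y ≡ bv here → y ≡ here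
  liftHS-here-inv σ here e = refl
  liftHS-here-inv σ (there y) e = ⊥-elim (wkHead≢here (σ y) e)

  strengthen-ηSpine : ∀ {Γ Δ α β} (σ : HSub Γ Δ) {n2 : Ne (β ∷ Γ) α} {n : Ne Δ α} → ηSpine n2 →
        hsNe (liftHS σ) n2 ≡ renNe wk n →
        Σ (Ne Γ α) λ n' → ηSpine n' × (n2 ≡ renNe wk n') × (hsNe σ n' ≡ n)
  strengthen-ηSpine σ {hd (bv here)} {hd h''} hd e = ⊥-elim (wkHead≢here h'' (sym (hd-injective e)))
  strengthen-ηSpine σ {hd (bv (there y))} {hd h''} hd e =
    hd (bv y) , hd , cong (λ z → hd (bv (there z))) (sym (renVar-id y)) , cong hd (wkHead-injective (hd-injective e))
  strengthen-ηSpine σ {hd (fv m)} {hd (bv x)} hd ()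
  strengthen-ηSpine σ {hd (fv m)} {hd (fv k)} hd refl = hd (fv m) , hd , refl , refl
  strengthen-ηSpine σ {hd (fv m)} {hd (con f)} hd ()
  strengthen-ηSpine σ {hd (con f)} {hd (bv x)} hd ()
  strengthen-ηSpine σ {hd (con f)} {hd (fv k)} hd ()
  strengthen-ηSpine σ {hd (con f)} {hd (con g)} hd refl = hd (con f) , hd , refl , refl
  strengthen-ηSpine σ {_} {hd h''} (app y e2) ()
  strengthen-ηSpine σ {hd h2} {app n4 u4} hd ()
  strengthen-ηSpine σ {app n3 _} {app n4 u4} (app {α = α} here e2) e with app-argType e
  ... | refl with app-injective e
  ... | e3 , e4 = ⊥-elim (no-uses-wk u4 (subst (λ z → UsesNf z here) (trans (sym (η-hs α (liftHS σ) {hd (bv here)} hd)) e4)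
                     (η-uses α hd)))
    where
    no-uses-wk : ∀ {Γ α β} (v : Nf Γ α) → UsesNf (renNf (wk {α = β}) v) here → ⊥
    no-uses-wk v u with uses-hsNf-inv (renHS wk) v (subst (λ w → UsesNf w here) (renNf-as-hsNf _ v) u)
    ... | y , _ , ()
  strengthen-ηSpine σ {app n3 _} {app n4 u4} (app {α = α} (there y) e2) e with app-argType e
  ... | refl with app-injective e
  ... | e3 , e4 with strengthen-ηSpine σ e2 e3
  ...   | n3' , es , refl , e5 =
    app n3' (ηNe α (hd (bv y))) , app y es ,
    cong (app (renNe wk n3'))
      (sym (trans (η-ren α wk (hd (bv y))) (cong (λ z → ηNe α (hd (bv (there z)))) (renVar-id y)))) ,
    cong₂ app e5 (trans (η-hs α σ hd)
      (wkNf-injective (trans (η-ren α wk (hd (σ y))) (trans (sym (η-hs α (liftHS σ) hd)) e4))))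

  mutual
    η-hsNf-inv : ∀ α {Γ Δ} (σ : HSub Γ Δ) (w : Nf Γ α) (n : Ne Δ α) → ηSpine n → hsNf σ w ≡ ηNe α n →
          Σ (Ne Γ α) λ n' → ηSpine n' × (w ≡ ηNe α n') × (hsNe σ n' ≡ n)
    η-hsNf-inv (base b) σ (ne N) n es e = N , ηSpine-hsNe-inv σ N n es (ne-injective e) , refl , ne-injective e
    η-hsNf-inv (α ⇒ β) σ (lam w1) n es e
      with η-hsNf-inv β (liftHS σ) w1 _ (app here (ηSpine-renNe wk es)) (lam-injective e)
    ... | app n2 _ , app y2 es2 , refl , e1 with app-argType e1
    ... | refl with app-injective e1
    ...   | e3 , e4 with liftHS-here-inv σ y2 (hd-injective (η-inj α (trans (sym (η-hs α (liftHS σ) hd)) e4)))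
    ...     | refl with strengthen-ηSpine σ es2 e3
    ...       | n' , es' , refl , e5 = n' , es' , refl , e5

    ηSpine-hsNe-inv : ∀ {Γ Δ α} (σ : HSub Γ Δ) (N : Ne Γ α) (n : Ne Δ α) → ηSpine n → hsNe σ N ≡ n → ηSpine N
    ηSpine-hsNe-inv σ (hd h) n es e = hd
    ηSpine-hsNe-inv σ (app N' u') (hd h) es ()
    ηSpine-hsNe-inv σ (app N' u') (app n' _) (app {α = α} y es) e with app-argType e
    ... | refl with app-injective e
    ... | e1 , e2 with η-hsNf-inv α σ u' (hd (bv y)) hd e2
    ... | hd (bv y3) , _ , refl , e3 = app y3 (ηSpine-hsNe-inv σ N' n' es e1)
    ... | hd (fv m) , _ , refl , ()
    ... | hd (con f) , _ , refl , ()
    ... | app _ _ , _ , refl , ()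

  ArgOf-conSpine : ∀ {Γ α γ} (θ : Subst Γ) {n : Ne [] α} {u : Nf [] γ} → ArgOf u n → (tc : TopCon n) →
              ArgOf (u [ θ ]↓) (conSpine θ tc)
  ArgOf-conSpine θ last (app tc) = last
  ArgOf-conSpine θ (earlier p) (app tc) = earlier (ArgOf-conSpine θ p tc)

  IsArg-[]↓ : ∀ {Γ γ} (ρr : Rule) (θ : Subst Γ) {l' : Nf [] γ} → IsArg l' (Rule.lhs ρr) →
         IsArg (l' [ θ ]↓) (Rule.lhs ρr [ θ ]↓)
  IsArg-[]↓ ρr θ p with Rule.lhs ρr | Rule.lhs-top ρr
  IsArg-[]↓ ρr θ (isArg q) | ne n | ne tc =
    subst (IsArg _) (sym (cong ne (eval-conSpine θ tc))) (isArg (ArgOf-conSpine θ q tc))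

  target : Type → B
  target (base b) = b
  target (α ⇒ β) = target β

  data SemArgs (Δ : Ctx) : Type → Set where
    []  : ∀ {b} → SemArgs Δ (base b)
    _∷_ : ∀ {α β} → Sem α Δ → SemArgs Δ β → SemArgs Δ (α ⇒ β)

  applySem : ∀ {Δ α} → Sem α Δ → SemArgs Δ α → Ne Δ (base (target α))
  applySem s [] = s
  applySem f (a ∷ as) = applySem (f ⊆-refl a) as

  UniArgs : ∀ {Δ α} → SemArgs Δ α → Set
  UniArgs [] = ⊤
  UniArgs (_∷_ {α} a as) = Uni α a × UniArgs as

  EqArgs : ∀ {Δ α} → SemArgs Δ α → SemArgs Δ α → Set
  EqArgs [] [] = ⊤
  EqArgs (_∷_ {α} a as) (a' ∷ as') = Eq α a a' × EqArgs as as'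

  EqArgs-sym : ∀ {Δ α} {as as' : SemArgs Δ α} → EqArgs as as' → EqArgs as' as
  EqArgs-sym {as = []} {[]} e = tt
  EqArgs-sym {α = α ⇒ _} {as = _ ∷ _} {_ ∷ _} (e₁ , e₂) = Eq-sym α e₁ , EqArgs-sym e₂

  EqArgs-trans : ∀ {Δ α} {as as' as'' : SemArgs Δ α} → EqArgs as as' → EqArgs as' as'' → EqArgs as as''
  EqArgs-trans {as = []} {[]} {[]} e e' = tt
  EqArgs-trans {α = α ⇒ _} {as = _ ∷ _} {_ ∷ _} {_ ∷ _} (e₁ , e₂) (e₁' , e₂') = Eq-trans α e₁ e₁' , EqArgs-trans e₂ e₂'

  applySem-Eq : ∀ {Δ α} {s s' : Sem α Δ} (as : SemArgs Δ α) → UniArgs as → Eq α s s' → applySem s as ≡ applySem s' as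
  applySem-Eq [] u e = e
  applySem-Eq (a ∷ as) (ua , uas) e = applySem-Eq as uas (e ⊆-refl a ua)

  applySem-args : ∀ {Δ α} {s : Sem α Δ} (as as' : SemArgs Δ α) → Uni α s → UniArgs as → UniArgs as' → EqArgs as as' →
              applySem s as ≡ applySem s as'
  applySem-args [] [] us _ _ _ = refl
  applySem-args {α = α ⇒ β} {s} (a ∷ as) (a' ∷ as') us (ua , uas) (ua' , uas') (ea , eas) =
    trans (applySem-Eq as uas (proj₁ (proj₂ us) ⊆-refl a a' ua ua' ea))
          (applySem-args as as' (proj₁ us ⊆-refl a' ua') uas uas' eas)

  constTm : ∀ {Γ} β → Tm Γ (base (target β)) → Tm Γ β
  constTm (base b) M = M
  constTm (ξ ⇒ β) M = ƛ constTm β (renTm wk M)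

  eval-constTm : ∀ {Γ Δ} β (M : Tm Γ (base (target β))) {ρ : Env Γ Δ} {g : GEnv Δ} → UniEnv ρ → UniG g →
          (as : SemArgs Δ β) → UniArgs as → applySem (eval ρ g (constTm β M)) as ≡ eval ρ g M
  eval-constTm (base b) M uρ ug [] _ = refl
  eval-constTm (ξ ⇒ β) M {ρ} {g} uρ ug (a ∷ as) (ua , uas) =
    let ue = ext-Uni ⊆-refl ua uρ
        ug' = renG-Uni ⊆-refl ug in
    trans (applySem-Eq as uas (eval-ƛ (constTm β (renTm wk M)) ⊆-refl a uρ ug ua))
     (trans (eval-constTm β (renTm wk M) ue ug' as uas)
      (trans (eval-ren M wk ue ug')
       (eval-Eq M (λ x → ue (there (renVar ⊆-refl x))) uρ
          (λ x → Eq-trans _ (renSem-id _ _) (Eq-≡ _ (cong ρ (renVar-id x))))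
          ug' ug (λ γ n → renSem-id γ _))))

  data ArgPos : Type → Type → Set where
    here  : ∀ {α β} → ArgPos (α ⇒ β) α
    there : ∀ {α β δ} → ArgPos β δ → ArgPos (α ⇒ β) δ

  pickArg : ∀ {Δ γ δ} → ArgPos γ δ → SemArgs Δ γ → Sem δ Δ
  pickArg here (a ∷ as) = a
  pickArg (there p) (a ∷ as) = pickArg p as

  pickArg-Uni : ∀ {Δ γ δ} (p : ArgPos γ δ) (as : SemArgs Δ γ) → UniArgs as → Uni δ (pickArg p as)
  pickArg-Uni here (a ∷ as) (ua , _) = ua
  pickArg-Uni (there p) (a ∷ as) (_ , uas) = pickArg-Uni p as uas

  spineArgs : ∀ {Γ Δ α β} {N : Ne Γ α} {h : Head Γ β} → (∀ {γ} → Nf Γ γ → Sem γ Δ) →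
              HeadOf N h → SemArgs Δ α → SemArgs Δ β
  spineArgs f hd as = as
  spineArgs f (app {u = u} p) as = spineArgs f p (f u ∷ as)

  target-HeadOf : ∀ {Γ α β} {N : Ne Γ α} {h : Head Γ β} → HeadOf N h → target β ≡ target α
  target-HeadOf hd = refl
  target-HeadOf (app p) = target-HeadOf p

  spine-sem : ∀ {Γ Δ α β} {E : Env Γ Δ} {g : GEnv Δ} {N : Ne Γ α} {y : Γ ∋ β} (p : HeadOf N (bv y)) →
              (as : SemArgs Δ α) →
              subst (λ b → Ne Δ (base b)) (target-HeadOf p) (applySem (E y) (spineArgs (λ u → eval E g ⌜ u ⌝) p as))
              ≡ applySem (eval E g ⌜ N ⌝ne) as
  spine-sem hd as = refl
  spine-sem {E = E} {g} (app {u = u} p) as = spine-sem p (eval E g ⌜ u ⌝ ∷ as)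

  spineArgs-Uni : ∀ {Γ Δ α β} {f : ∀ {γ} → Nf Γ γ → Sem γ Δ} {N : Ne Γ α} {h : Head Γ β} →
                  (∀ {γ} (u : Nf Γ γ) → Uni γ (f u)) → (p : HeadOf N h) (as : SemArgs Δ α) → UniArgs as →
                  UniArgs (spineArgs f p as)
  spineArgs-Uni uf hd as u = u
  spineArgs-Uni uf (app {u = v} p) as u = spineArgs-Uni uf p _ (uf v , u)

  posAfter : ∀ {Γ α β δ} {N : Ne Γ α} {h : Head Γ β} → HeadOf N h → ArgPos α δ → ArgPos β δ
  posAfter hd q = q
  posAfter (app p) q = posAfter p (there q)

  posOf : ∀ {Γ α β δ} {N : Ne Γ α} {h : Head Γ β} {a : Nf Γ δ} → HeadOf N h → ArgOf a N → ArgPos β δ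
  posOf (app p) last = posAfter p here
  posOf (app p) (earlier q) = posOf p q

  pick-after : ∀ {Γ Δ α β δ} (f : ∀ {γ} → Nf Γ γ → Sem γ Δ) {N : Ne Γ α} {h : Head Γ β}
               (p : HeadOf N h) (q : ArgPos α δ) (as : SemArgs Δ α) →
               pickArg (posAfter p q) (spineArgs f p as) ≡ pickArg q as
  pick-after f hd q as = refl
  pick-after f (app {u = u} p) q as = pick-after f p (there q) (f u ∷ as)

  pick-posOf : ∀ {Γ Δ α β δ} (f : ∀ {γ} → Nf Γ γ → Sem γ Δ) {N : Ne Γ α} {h : Head Γ β} {a : Nf Γ δ}
               (p : HeadOf N h) (q : ArgOf a N) (as : SemArgs Δ α) →
               pickArg (posOf p q) (spineArgs f p as) ≡ f a
  pick-posOf f (app {u = u} p) last as = pick-after f p here (f u ∷ as)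
  pick-posOf f (app {u = u} p) (earlier q) as = pick-posOf f p q (f u ∷ as)

module Reduction (B : Set) (F : Ty B → Set) (R : HRSTheory.HRS B F) where

  open HRSTheory B F
  open Syntax B F
  open Semantics B F

  SNΓ : ∀ {Γ α} → Nf Γ α → Set
  SNΓ {Γ} {α} v = Acc {A = Nf Γ α} (λ u w → Step R w u) v

  SN-preimage : ∀ {Γ Δ α β} (f : Nf Γ α → Nf Δ β) → (∀ {v v'} → Step R v v' → Step R (f v) (f v')) →
            ∀ {v} → SNΓ (f v) → SNΓ v
  SN-preimage f lift (acc rs) = acc (λ st → SN-preimage f lift (rs (lift st)))

  mutual
    Step-hsNf : ∀ {Γ Δ α} (σ : HSub Γ Δ) {v v' : Nf Γ α} → Step R v v' → Step R (hsNf σ v) (hsNf σ v')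
    Step-hsNf σ (root ρr Rρ θ) =
      subst₂ (Step R) (sym (hsNf-[]↓ σ θ (Rule.lhs ρr))) (sym (hsNf-[]↓ σ θ (Rule.rhs ρr)))
        (root ρr Rρ (hsSubst σ θ))
    Step-hsNf σ (lam st) = lam (Step-hsNf (liftHS σ) st)
    Step-hsNf σ (ne st) = ne (StepNe-hsNe σ st)

    StepNe-hsNe : ∀ {Γ Δ α} (σ : HSub Γ Δ) {n n' : Ne Γ α} → StepNe R n n' → StepNe R (hsNe σ n) (hsNe σ n')
    StepNe-hsNe σ (appL st) = appL (StepNe-hsNe σ st)
    StepNe-hsNe σ (appR st) = appR (Step-hsNf σ st)

  Step-renNf : ∀ {Γ Δ α} (ρ : Γ ⊆ Δ) {v v' : Nf Γ α} → Step R v v' → Step R (renNf ρ v) (renNf ρ v')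
  Step-renNf ρ {v} {v'} st = subst₂ (Step R) (sym (renNf-as-hsNf ρ v)) (sym (renNf-as-hsNf ρ v')) (Step-hsNf (renHS ρ) st)

  SN-hsNf-inv : ∀ {Γ Δ α} (σ : HSub Γ Δ) {v : Nf Γ α} → SNΓ (hsNf σ v) → SNΓ v
  SN-hsNf-inv σ = SN-preimage (hsNf σ) (Step-hsNf σ)

  SN-renNf-inv : ∀ {Γ Δ α} (ρ : Γ ⊆ Δ) {v : Nf Γ α} → SNΓ (renNf ρ v) → SNΓ v
  SN-renNf-inv ρ = SN-preimage (renNf ρ) (Step-renNf ρ)

  SN-lam-inv : ∀ {Γ α β} {w : Nf (α ∷ Γ) β} → SNΓ (lam w) → SNΓ w
  SN-lam-inv = SN-preimage lam lam

  SN-lam : ∀ {Γ α β} {w : Nf (α ∷ Γ) β} → SNΓ w → SNΓ (lam w)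
  SN-lam (acc rs) = acc λ { (lam st) → SN-lam (rs st) }

  plug : ∀ {Γ α γ} {n : Ne Γ α} {u : Nf Γ γ} → ArgOf u n → Nf Γ γ → Ne Γ α
  plug (last {n = n}) u' = app n u'
  plug (earlier {u = u} p) u' = app (plug p u') u

  plug-self : ∀ {Γ α γ} {n : Ne Γ α} {u : Nf Γ γ} (p : ArgOf u n) → plug p u ≡ n
  plug-self last = refl
  plug-self (earlier p) = cong (λ z → app z _) (plug-self p)

  plug-step : ∀ {Γ α γ} {n : Ne Γ α} {u : Nf Γ γ} (p : ArgOf u n) {w w'} → Step R w w' →
              StepNe R (plug p w) (plug p w')
  plug-step last st = appR st
  plug-step (earlier p) st = appL (plug-step p st)

  SN-ArgOf : ∀ {Γ α γ} {n : Ne Γ α} {u : Nf Γ γ} → ArgOf u n → SNΓ (ne n) → SNΓ u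
  SN-ArgOf p s = SN-preimage (λ w → ne (plug p w)) (λ st → ne (plug-step p st))
                 (subst (λ z → SNΓ (ne z)) (sym (plug-self p)) s)

  SN-Subterm : ∀ {Γ α Δ β} {v : Nf Γ α} {s : Nf Δ β} → Subterm v s → SNΓ v → SNΓ s
  SN-Subterm self sn = sn
  SN-Subterm (under p) sn = SN-Subterm p (SN-lam-inv sn)
  SN-Subterm (arg q p) sn = SN-Subterm p (SN-ArgOf q sn)

  Step-ne-inv : ∀ {Γ α} {v X : Nf Γ α} → Step R v X → (n : Ne Γ α) → v ≡ ne n → ¬ TopCon n →
           Σ (Ne Γ α) λ n' → (X ≡ ne n') × StepNe R n n'
  Step-ne-inv (root ρr Rρ θ) n eq nc with lhs[]↓-TopCon ρr θ
  ... | m , e , tc = ⊥-elim (nc (subst TopCon (ne-injective (trans (sym e) eq)) tc))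
  Step-ne-inv (lam st) n () nc
  Step-ne-inv (ne st) n refl nc = _ , refl , st

  TopCon-StepNe-inv : ∀ {Γ α} {n n' : Ne Γ α} → StepNe R n n' → TopCon n' → TopCon n
  TopCon-StepNe-inv (appL st) (app tc) = app (TopCon-StepNe-inv st tc)
  TopCon-StepNe-inv (appR st) (app tc) = app tc

  AccNe : ∀ {Γ α} → Ne Γ α → Set
  AccNe {Γ} {α} n = Acc {A = Ne Γ α} (λ a b → StepNe R b a) n

  AccNe⇒SN : ∀ {Γ α} {n : Ne Γ α} → AccNe n → ¬ TopCon n → SNΓ (ne n)
  AccNe⇒SN {n = n} (acc rs) nc = acc go
    where
    go : ∀ {X} → Step R (ne n) X → SNΓ X
    go st with Step-ne-inv st n refl nc
    ... | n' , refl , st' = AccNe⇒SN (rs st') (λ tc → nc (TopCon-StepNe-inv st' tc))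

  AccNe-app : ∀ {Γ α β} {n : Ne Γ (α ⇒ β)} {u : Nf Γ α} → AccNe n → SNΓ u → AccNe (app n u)
  AccNe-app (acc rn) (acc ru) = acc λ { (appL s) → AccNe-app (rn s) (acc ru) ; (appR s) → AccNe-app (acc rn) (ru s) }

  AccNe-args : ∀ {Γ α} (n : Ne Γ α) → (∀ {γ} (u : Nf Γ γ) → ArgOf u n → SNΓ u) → AccNe n
  AccNe-args (hd h) args = acc λ ()
  AccNe-args (app n u) args = AccNe-app (AccNe-args n (λ v p → args v (earlier p))) (args u last)

  mutual
    SC⇒SN : ∀ α (t : Nf [] α) → EtaLong t → SC R α t → SN R t
    SC⇒SN (base b) t e sc = sc
    SC⇒SN (α ⇒ β) (lam w) (lam e) sc =
      SN-lam (SN-hsNf-inv openHS (SC⇒SN β (hsNf openHS w) (hsNf-EL openHS e)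
        (subst (SC R β) (trans (nf-app-var0 w) (stable (hsNf-EL openHS e)))
          (sc (ηNe α (hd (fv 0))) (ηNe-EL α hd) (neutral-SC α (hd (fv 0)) (λ ()) hd (λ u ()))))))

    neutral-SC : ∀ α (m : Ne [] α) → ¬ TopCon m → EtaLongNe m → (∀ {γ} (u : Nf [] γ) → ArgOf u m → SN R u) →
          SC R α (ηNe α m)
    neutral-SC (base b) m nc e args = AccNe⇒SN (AccNe-args m args) nc
    neutral-SC (α ⇒ β) m nc e args u eu scu =
      subst (SC R β) (sym (trans (nf-≃ {T = ⌜ ηNe (α ⇒ β) m ⌝ · ⌜ u ⌝} {T' = ⌜ app m u ⌝ne}
                                         (≃-app (η-≃ (α ⇒ β) m) ≃-refl))
                                 (nf-ne-η (app e eu))))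
        (neutral-SC β (app m u) (λ { (app tc) → nc tc }) (app e eu)
           (λ { v last → SC⇒SN α u eu scu ; v (earlier p) → args v p }))

  SN-subst : ∀ {b b'} (e : b ≡ b') {t : Nf [] (base b)} → SN R (subst (λ c → Nf [] (base c)) e t) → SN R t
  SN-subst refl sn = sn

module Instantiation (B : Set) (F : Ty B → Set) (θ : HRSTheory.Subst B F []) where

  open HRSTheory B F
  open Syntax B F
  open Semantics B F

  θGEnv : ∀ {Δ} → GEnv Δ → GEnv Δ
  θGEnv g = sbGEnv ∅E g (Subst.map θ) ⊆-refl

  θGEnv-Uni : ∀ {Δ} {g : GEnv Δ} → UniG g → UniG (θGEnv g)
  θGEnv-Uni ug = sbGEnv-Uni (Subst.map θ) ⊆-refl (∅-Uni ∅E) ug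

  sbGEnv-θ-indep : ∀ {Γ Δ} {E : Env Γ Δ} {g : GEnv Δ} → UniEnv E → UniG g →
              EqG (sbGEnv E g (Subst.map θ) ε⊆) (θGEnv g)
  sbGEnv-θ-indep {E = E} {g} uE ug α n with Subst.map θ α n
  ... | just u = Eq-trans α (eval-ren ⌜ u ⌝ ε⊆ uE ug)
                  (Eq-trans α (eval-Eq ⌜ u ⌝ (∅-Uni (λ x → E (renVar ε⊆ x))) (∅-Uni (λ x → ∅E (renVar ⊆-refl x))) (∅-Eq (λ x → E (renVar ε⊆ x)) (λ x → ∅E (renVar ⊆-refl x))) ug ug
                                 (λ γ m → Eq-refl γ _))
                    (Eq-sym α (eval-ren ⌜ u ⌝ ⊆-refl (∅-Uni ∅E) ug)))
  ... | nothing = Eq-refl α _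

  instTm : ∀ {Γ Δ α} → Sub Γ Δ → Nf Γ α → Tm Δ α
  instTm τ v = subTm τ (sbTm (Subst.map θ) ε⊆ ⌜ v ⌝)

  instNeTm : ∀ {Γ Δ α} → Sub Γ Δ → Ne Γ α → Tm Δ α
  instNeTm τ n = subTm τ (sbTm (Subst.map θ) ε⊆ ⌜ n ⌝ne)

  inst : ∀ {Γ Δ α} → Sub Γ Δ → Nf Γ α → Nf Δ α
  inst τ v = nf (instTm τ v)

  eval-instTm : ∀ {Γ Δ Θ α} (τ : Sub Γ Δ) (v : Nf Γ α) {ρ : Env Δ Θ} {g : GEnv Θ} → UniEnv ρ → UniG g →
           Eq α (eval ρ g (instTm τ v)) (eval (λ x → eval ρ g (τ x)) (θGEnv g) ⌜ v ⌝)
  eval-instTm τ v {ρ} {g} uρ ug =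
    let uE = λ {γ} (x : _ ∋ γ) → eval-Uni (τ x) uρ ug in
    Eq-trans _ (eval-sub (sbTm (Subst.map θ) ε⊆ ⌜ v ⌝) τ uρ ug)
      (Eq-trans _ (eval-sb ⌜ v ⌝ (Subst.map θ) ε⊆ uE ug)
        (eval-Eq ⌜ v ⌝ uE uE (λ x → Eq-refl _ _) (sbGEnv-Uni (Subst.map θ) ε⊆ uE ug) (θGEnv-Uni ug)
           (sbGEnv-θ-indep uE ug)))

  inst-lam : ∀ {Γ Δ α β} (τ : Sub Γ Δ) (w : Nf (α ∷ Γ) β) → inst τ (lam w) ≡ lam (inst (liftS τ) w)
  inst-lam τ w = nf-ƛ (instTm (liftS τ) w)

  instSpine : ∀ {Γ Δ α β} (τ : Sub Γ Δ) {N : Ne Γ α} {h : Head Γ β} → HeadOf N h → Head Δ β → Ne Δ α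
  instSpine τ hd h' = hd h'
  instSpine τ (app {u = u} p) h' = app (instSpine τ p h') (inst τ u)

  eval-instSpine : ∀ {Γ Δ α β} (τ : Sub Γ Δ) {N : Ne Γ α} {h : Head Γ β} (p : HeadOf N h) (h' : Head Δ β) →
             Eq β (eval idEnv idGEnv (subTm τ (sbTm (Subst.map θ) ε⊆ (` h)))) (reflect β (hd h')) →
             Eq α (eval idEnv idGEnv (instNeTm τ N)) (reflect α (instSpine τ p h'))
  eval-instSpine τ hd h' e = e
  eval-instSpine τ (app {α} {β} {u = u} p) h' e =
    Eq-trans β (eval-instSpine τ p h' e ⊆-refl _ (eval-Uni (instTm τ u) idEnv-Uni idGEnv-Uni))
      (reflect-cong β (cong (λ z → app z (inst τ u)) (renNe-id _)))

  ArgOf-instSpine : ∀ {Γ Δ α β γ} (τ : Sub Γ Δ) {N : Ne Γ α} {h : Head Γ β} (p : HeadOf N h) (h' : Head Δ β)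
              {u : Nf Γ γ} → ArgOf u N → ArgOf (inst τ u) (instSpine τ p h')
  ArgOf-instSpine τ (app p) h' last = last
  ArgOf-instSpine τ (app p) h' (earlier q) = earlier (ArgOf-instSpine τ p h' q)

  inst-ne : ∀ {Γ Δ α β} (τ : Sub Γ Δ) {N : Ne Γ α} {h : Head Γ β} (p : HeadOf N h) (h' : Head Δ β) →
          Eq β (eval idEnv idGEnv (subTm τ (sbTm (Subst.map θ) ε⊆ (` h)))) (reflect β (hd h')) →
          inst τ (ne N) ≡ ηNe α (instSpine τ p h')
  inst-ne {α = α} τ p h' e = reify-Eq α (eval-instSpine τ p h' e)

  θGEnv-Eq : ∀ {Δ} {g g' : GEnv Δ} → UniG g → UniG g' → EqG g g' → EqG (θGEnv g) (θGEnv g')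
  θGEnv-Eq {g = g} {g'} ug ug' e α n with Subst.map θ α n
  ... | just u = eval-Eq (renTm ⊆-refl ⌜ u ⌝) (∅-Uni ∅E) (∅-Uni ∅E) (∅-Eq ∅E ∅E) ug ug' e
  ... | nothing = e α n

  ⟦_⟧_ : ∀ {Γ α} → Nf Γ α → Closing Γ → Nf [] α
  ⟦ t ⟧ ε = inst (closingSub ε) t

  inst-closed : ∀ {α} (τ : Sub [] []) (t : Nf [] α) → inst τ t ≡ t [ θ ]↓
  inst-closed τ t = nf-≃ {T = instTm τ t} {T' = substTm θ t} (≃i λ ρ g uρ ug →
    Eq-trans _ (eval-instTm τ t uρ ug)
      (Eq-trans _ (eval-Eq ⌜ t ⌝ (∅-Uni (λ x → eval ρ g (τ x))) (∅-Uni ∅E) (∅-Eq (λ x → eval ρ g (τ x)) ∅E)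
                     (θGEnv-Uni ug) (sbGEnv-Uni (Subst.map θ) ⊆-refl uρ ug)
                     (λ γ n → Eq-sym γ (sbGEnv-θ-indep uρ ug γ n)))
        (Eq-sym _ (eval-substTm θ t uρ ug))))

  ⟦⟧-β : ∀ {Γ α β} (s : Nf (α ∷ Γ) β) (ε : Closing (α ∷ Γ)) →
         nf (⌜ ⟦ lam s ⟧ (λ x → ε (there x)) ⌝ · ⌜ ε here ⌝) ≡ ⟦ s ⟧ ε
  ⟦⟧-β {Γ} {α} {β} s ε =
    nf-≃ {T = ⌜ ⟦ lam s ⟧ ε' ⌝ · ⌜ ε here ⌝} {T' = instTm (closingSub ε) s}
      (≃-trans (≃-app (≃-sym (soundness (instTm (closingSub ε') (lam s)))) ≃-refl) (≃i λ ρ g uρ ug →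
        let a = eval ρ g ⌜ ε here ⌝
            ua = eval-Uni ⌜ ε here ⌝ uρ ug
            ue = ext-Uni ⊆-refl ua uρ
            ug' = renG-Uni ⊆-refl ug
        in
        Eq-trans β (eval-ƛ (instTm (liftS (closingSub ε')) s) ⊆-refl a uρ ug ua)
         (Eq-trans β (eval-instTm (liftS (closingSub ε')) s ue ug')
          (Eq-trans β (eval-Eq ⌜ s ⌝ (λ x → eval-Uni (liftS (closingSub ε') x) ue ug')
                        (λ x → eval-Uni (closingSub ε x) uρ ug)
                        (λ { here → Eq-refl α a ;
                             (there x) → Eq-trans _ (eval-ren ⌜ ε (there x) ⌝ wk ue ug')
                               (eval-Eq ⌜ ε (there x) ⌝ (∅-Uni (λ y → ext ⊆-refl a ρ (renVar wk y))) (∅-Uni ρ) (∅-Eq (λ y → ext ⊆-refl a ρ (renVar wk y)) ρ) ug' ug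
                                  (λ γ n → renSem-id γ _)) })
                        (θGEnv-Uni ug') (θGEnv-Uni ug) (θGEnv-Eq ug' ug (λ γ n → renSem-id γ _)))
           (Eq-sym β (eval-instTm (closingSub ε) s uρ ug))))))
    where
    ε' : Closing Γ
    ε' x = ε (there x)

  inst-ext : ∀ {Γ Δ α} (τ τ' : Sub Γ Δ) → (∀ {β} (x : Γ ∋ β) → τ x ≃ τ' x) → (v : Nf Γ α) → inst τ v ≡ inst τ' v
  inst-ext τ τ' e v = nf-≃ {T = instTm τ v} {T' = instTm τ' v} (≃i λ ρ g uρ ug →
    Eq-trans _ (eval-instTm τ v uρ ug)
      (Eq-trans _ (eval-Eq ⌜ v ⌝ (λ x → eval-Uni (τ x) uρ ug) (λ x → eval-Uni (τ' x) uρ ug)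
                     (λ x → run (e x) ρ g uρ ug) (θGEnv-Uni ug) (θGEnv-Uni ug) (λ γ n → Eq-refl γ _))
        (Eq-sym _ (eval-instTm τ' v uρ ug))))

  liftS-idS : ∀ {Γ α β} (x : (α ∷ Γ) ∋ β) → liftS idS x ≃ idS x
  liftS-idS here = ≃-refl
  liftS-idS (there x) = ≃-≡ (cong (λ z → ` bv (there z)) (renVar-id x))

  inst-renNf-closed : ∀ {Δ α} (t : Nf [] α) → inst (idS {Δ}) (renNf ε⊆ t) ≡ renNf ε⊆ (t [ θ ]↓)
  inst-renNf-closed {α = α} t = trans (nf-≃ {T = instTm idS (renNf ε⊆ t)} {T' = renTm ε⊆ (substTm θ t)} (≃i λ ρ g uρ ug →
    let ρ' = λ {γ} (x : [] ∋ γ) → ρ (renVar ε⊆ x)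
        uρ' = λ {γ} (x : [] ∋ γ) → uρ (renVar ε⊆ x) in
    Eq-trans α (eval-instTm idS (renNf ε⊆ t) uρ ug)
     (Eq-trans α (Eq-≡ α (cong (eval (λ x → eval ρ g (idS x)) (θGEnv g)) (⌜⌝-renNf ε⊆ t)))
      (Eq-trans α (eval-ren ⌜ t ⌝ ε⊆ (λ x → eval-Uni (idS x) uρ ug) (θGEnv-Uni ug))
       (Eq-trans α (eval-Eq ⌜ t ⌝ (∅-Uni (λ x → eval ρ g (idS (renVar ε⊆ x)))) (∅-Uni ∅E)
                      (∅-Eq (λ x → eval ρ g (idS (renVar ε⊆ x))) ∅E) (θGEnv-Uni ug)
                      (sbGEnv-Uni (Subst.map θ) ⊆-refl uρ' ug)
                      (λ γ n → Eq-sym γ (sbGEnv-θ-indep uρ' ug γ n)))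
        (Eq-sym α (Eq-trans α (eval-ren (substTm θ t) ε⊆ uρ ug) (eval-substTm θ t uρ' ug))))))))
    (sym (nf-ren ε⊆ (substTm θ t)))

  SSub-inst-Subterm : ∀ {γ} (l' : Nf [] γ) {Γ α Δ β} (v : Nf Γ α) {s : Nf Δ β} → SSubX (λ x → x ∈FV l') v s →
         EtaLong v → v ⊆FV l' → Subterm (inst idS v) (inst idS s)
  SSub-inst-Subterm l' v self e fvs' = self
  SSub-inst-Subterm l' (lam v) {s = s} (under p) (lam e) fvs' =
    subst (λ z → Subterm z (inst idS s)) (sym (trans (inst-lam idS v) (cong lam (inst-ext _ _ liftS-idS v))))
      (under (SSub-inst-Subterm l' v p e (λ x q → fvs' x (lam q))))
  SSub-inst-Subterm l' (ne n) {s = s} (arg hn q p) (ne e) fvs' with neHead n | neHead-HeadOf n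
  ... | (β' , bv y) | sp =
    subst (λ z → Subterm z (inst idS s)) (sym (inst-ne idS sp (bv y) (Eq-refl _ _)))
      (arg (ArgOf-instSpine idS sp (bv y) q) (SSub-inst-Subterm l' _ p (ArgOf-EL q e) (λ x r → fvs' x (ne (ArgOf-fv q r)))))
  ... | (β' , fv m) | sp = ⊥-elim (hn (fvs' _ (ne (HeadOf-fv sp))))
  ... | (β' , con f) | sp =
    subst (λ z → Subterm z (inst idS s)) (sym (inst-ne idS sp (con f) (Eq-refl _ _)))
      (arg (ArgOf-instSpine idS sp (con f) q) (SSub-inst-Subterm l' _ p (ArgOf-EL q e) (λ x r → fvs' x (ne (ArgOf-fv q r)))))

  ⟦⟧-unused : ∀ {Γ α} (body : Nf Γ α) (name : ∀ {β} → Γ ∋ β → ℕ) {t : Nf [] α} →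
              hsNf (namesHS name) body ≡ t → (∀ {β} (y : Γ ∋ β) → ¬ UsesNf body y) →
              (ε : Closing Γ) → nf ⌜ t ⌝ [ θ ]↓ ≡ ⟦ body ⟧ ε
  ⟦⟧-unused {α = α} body name {t} body-names unused ε =
    nf-≃ {T = substTm θ (nf ⌜ t ⌝)} {T' = instTm (closingSub ε) body} (≃i λ ρ g uρ ug →
      let G = sbGEnv ρ g (Subst.map θ) ⊆-refl
          uG = sbGEnv-Uni (Subst.map θ) ⊆-refl uρ ug
          uE = λ {β} (x : _ ∋ β) → eval-Uni (closingSub ε x) uρ ug
      in
      Eq-trans α (eval-substTm θ (nf ⌜ t ⌝) uρ ug)
       (Eq-trans α (run (≃-sym (soundness ⌜ t ⌝)) ∅E G (∅-Uni ∅E) uG)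
        (Eq-trans α (Eq-≡ α (cong (λ w → eval ∅E G ⌜ w ⌝) (sym body-names)))
         (Eq-trans α (eval-hs body (namesHS name) (∅-Uni ∅E) uG)
          (Eq-trans α (eval-local body (λ x → uG _ (name x)) uE uG (λ y u → ⊥-elim (unused y u)))
           (Eq-trans α (eval-Eq ⌜ body ⌝ uE uE (λ x → Eq-refl _ _) uG (θGEnv-Uni ug) (sbGEnv-θ-indep uρ ug))
            (Eq-sym α (eval-instTm (closingSub ε) body uρ ug))))))))

  inst-hsNf-local : ∀ {Γ Γ' Ξ α} (a : Nf Γ' α) (κ : HSub Γ' Γ) (ε : Closing Γ) (τ : Sub Γ' Ξ) →
    (∀ {β} (y : Γ' ∋ β) → UsesNf a y → Σ (Γ ∋ β) λ x → (κ y ≡ bv x) × (τ y ≃ renTm ε⊆ ⌜ ε x ⌝)) →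
    inst τ a ≡ renNf ε⊆ (⟦ hsNf κ a ⟧ ε)
  inst-hsNf-local {Γ} {α = α} a κ ε τ agree =
    trans (nf-≃ {T = instTm τ a} {T' = renTm ε⊆ (instTm (closingSub ε) (hsNf κ a))} (≃i λ ρ g uρ ug →
      let uρ' = λ {γ} (x : [] ∋ γ) → uρ (renVar ε⊆ x)
          uE = λ {γ} (x : Γ ∋ γ) → eval-Uni ⌜ ε x ⌝ uρ' ug
          uG = θGEnv-Uni ug in
      Eq-trans α (eval-instTm τ a uρ ug)
       (Eq-trans α (eval-local a (λ y → eval-Uni (τ y) uρ ug) (λ y → evalH-Uni (κ y) uE uG) uG (τ≈κ ρ g uρ ug))
        (Eq-sym α (Eq-trans α (eval-ren (instTm (closingSub ε) (hsNf κ a)) ε⊆ uρ ug)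
          (Eq-trans α (eval-instTm (closingSub ε) (hsNf κ a) uρ' ug) (eval-hs a κ uE uG)))))))
      (sym (nf-ren ε⊆ (instTm (closingSub ε) (hsNf κ a))))
    where
    τ≈κ : ∀ {Δ} (ρ : Env _ Δ) (g : GEnv Δ) → UniEnv ρ → UniG g → ∀ {γ} (y : _ ∋ γ) → UsesNf a y →
          Eq γ (eval ρ g (τ y)) (evalH (λ x → eval (λ z → ρ (renVar ε⊆ z)) g ⌜ ε x ⌝) (θGEnv g) (κ y))
    τ≈κ ρ g uρ ug y u with agree y u
    ... | x , κy≡x , τy≃εx = Eq-trans _ (run τy≃εx ρ g uρ ug)
                               (Eq-trans _ (eval-ren ⌜ ε x ⌝ ε⊆ uρ ug)
                                 (Eq-≡ _ (cong (evalH _ (θGEnv g)) (sym κy≡x))))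

  ⟦⟧-app-update : ∀ {Γ α β} (n : Ne Γ (α ⇒ β)) (i : Γ ∋ α) → ¬ UsesNf (ne n) i → (ε : Closing Γ) (u : Nf [] α) →
                  nf (⌜ ⟦ ne n ⟧ ε ⌝ · ⌜ u ⌝) ≡ ⟦ ne (app n (ηNe α (hd (bv i)))) ⟧ update ε i u
  ⟦⟧-app-update {Γ} {α} {β} n i i-unused ε u =
    nf-≃ {T = ⌜ ⟦ ne n ⟧ ε ⌝ · ⌜ u ⌝} {T' = instTm (closingSub ε') (ne (app n w))}
      (≃-trans (≃-app (≃-sym (soundness (instTm (closingSub ε) (ne n)))) ≃-refl)
        (≃-app
          (≃i λ ρ g uρ ug →
            let uE = λ {γ} (x : Γ ∋ γ) → eval-Uni (closingSub ε x) uρ ug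
                uE' = λ {γ} (x : Γ ∋ γ) → eval-Uni (closingSub ε' x) uρ ug in
            Eq-trans (α ⇒ β) (eval-instTm (closingSub ε) (ne n) uρ ug)
             (Eq-trans (α ⇒ β) (eval-local (ne n) uE uE' (θGEnv-Uni ug) (ε≈ε' ρ g))
              (Eq-sym (α ⇒ β) (eval-instTm (closingSub ε') (ne n) uρ ug))))
          (≃i λ ρ g uρ ug →
            let uE' = λ {γ} (x : Γ ∋ γ) → eval-Uni (closingSub ε' x) uρ ug in
            Eq-sym α (Eq-trans α (eval-instTm (closingSub ε') w uρ ug)
              (Eq-trans α (run (η-≃ α (hd (bv i))) _ (θGEnv g) uE' (θGEnv-Uni ug))
                (Eq-≡ α (cong (λ z → eval ρ g ⌜ z ⌝) (update-at ε i u))))))))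
    where
    ε' : Closing Γ
    ε' = update ε i u
    w : Nf Γ α
    w = ηNe α (hd (bv i))
    ε≈ε' : ∀ {Δ} (ρ : Env [] Δ) (g : GEnv Δ) {γ} (y : Γ ∋ γ) → UsesNf (ne n) y →
           Eq γ (eval ρ g ⌜ ε y ⌝) (eval ρ g ⌜ ε' y ⌝)
    ε≈ε' ρ g y q with update-other ε i u y
    ... | inj₁ e = Eq-≡ _ (cong (λ z → eval ρ g ⌜ z ⌝) (sym e))
    ... | inj₂ refl = ⊥-elim (i-unused q)

module Projection (B : Set) (F : Ty B → Set) (R : HRSTheory.HRS B F) where

  open HRSTheory B F
  open Syntax B F
  open Semantics B F
  open Reduction B F R

  data SCArgs : Type → Set where
    []   : ∀ {b} → SCArgs (base b)
    cons : ∀ {α β} (u : Nf [] α) → EtaLong u → SC R α u → SCArgs β → SCArgs (α ⇒ β)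

  applyAll : ∀ {α} → Nf [] α → SCArgs α → Nf [] (base (target α))
  applyAll X [] = X
  applyAll X (cons u _ _ us) = applyAll (nf (⌜ X ⌝ · ⌜ u ⌝)) us

  SC⇒SN-applyAll : ∀ α (X : Nf [] α) → SC R α X → (us : SCArgs α) → SN R (applyAll X us)
  SC⇒SN-applyAll (base b) X sc [] = sc
  SC⇒SN-applyAll (α ⇒ β) X sc (cons u eu su us) = SC⇒SN-applyAll β _ (sc u eu su) us

  SN-applyAll⇒SC : ∀ α (X : Nf [] α) → (∀ (us : SCArgs α) → SN R (applyAll X us)) → SC R α X
  SN-applyAll⇒SC (base b) X h = h []
  SN-applyAll⇒SC (α ⇒ β) X h u eu su = SN-applyAll⇒SC β _ (λ us → h (cons u eu su us))

  applyAllTm : ∀ {Γ α} → Tm Γ α → SCArgs α → Tm Γ (base (target α))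
  applyAllTm T [] = T
  applyAllTm T (cons u _ _ us) = applyAllTm (T · renTm ε⊆ ⌜ u ⌝) us

  evalArgs : ∀ {Γ Δ} (ρ : Env Γ Δ) (g : GEnv Δ) {α} → SCArgs α → SemArgs Δ α
  evalArgs ρ g [] = []
  evalArgs ρ g (cons u _ _ us) = eval ρ g (renTm ε⊆ ⌜ u ⌝) ∷ evalArgs ρ g us

  evalClosedArgs : ∀ {Δ} (g : GEnv Δ) {α} → SCArgs α → SemArgs Δ α
  evalClosedArgs g [] = []
  evalClosedArgs g (cons u _ _ us) = eval ∅E g ⌜ u ⌝ ∷ evalClosedArgs g us

  evalArgs-Uni : ∀ {Γ Δ} {ρ : Env Γ Δ} {g : GEnv Δ} {α} → UniEnv ρ → UniG g → (us : SCArgs α) → UniArgs (evalArgs ρ g us)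
  evalArgs-Uni uρ ug [] = tt
  evalArgs-Uni uρ ug (cons u _ _ us) = eval-Uni (renTm ε⊆ ⌜ u ⌝) uρ ug , evalArgs-Uni uρ ug us

  evalClosedArgs-Uni : ∀ {Δ} {g : GEnv Δ} {α} → UniG g → (us : SCArgs α) → UniArgs (evalClosedArgs g us)
  evalClosedArgs-Uni ug [] = tt
  evalClosedArgs-Uni ug (cons u _ _ us) = eval-Uni ⌜ u ⌝ (∅-Uni ∅E) ug , evalClosedArgs-Uni ug us

  evalArgs-closed : ∀ {Γ Δ} {ρ : Env Γ Δ} {g : GEnv Δ} {α} → UniEnv ρ → UniG g → (us : SCArgs α) →
              EqArgs (evalArgs ρ g us) (evalClosedArgs g us)
  evalArgs-closed uρ ug [] = tt
  evalArgs-closed {ρ = ρ} uρ ug (cons u _ _ us) =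
    Eq-trans _ (eval-ren ⌜ u ⌝ ε⊆ uρ ug)
      (eval-Eq ⌜ u ⌝ (∅-Uni (λ x → ρ (renVar ε⊆ x))) (∅-Uni ∅E) (∅-Eq (λ x → ρ (renVar ε⊆ x)) ∅E) ug ug
        (λ γ n → Eq-refl γ _)) ,
    evalArgs-closed uρ ug us

  evalClosedArgs-Eq : ∀ {Δ} {g g' : GEnv Δ} {α} → UniG g → UniG g' → EqG g g' → (us : SCArgs α) → EqArgs (evalClosedArgs g us) (evalClosedArgs g' us)
  evalClosedArgs-Eq ug ug' e [] = tt
  evalClosedArgs-Eq ug ug' e (cons u _ _ us) =
    eval-Eq ⌜ u ⌝ (∅-Uni ∅E) (∅-Uni ∅E) (∅-Eq ∅E ∅E) ug ug' e , evalClosedArgs-Eq ug ug' e us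

  eval-applyAllTm : ∀ {Γ Δ α} (T : Tm Γ α) (us : SCArgs α) {ρ : Env Γ Δ} {g : GEnv Δ} →
               eval ρ g (applyAllTm T us) ≡ applySem (eval ρ g T) (evalArgs ρ g us)
  eval-applyAllTm T [] = refl
  eval-applyAllTm T (cons u _ _ us) = eval-applyAllTm (T · renTm ε⊆ ⌜ u ⌝) us

  applyAllTm-cong : ∀ {Γ α} {T T' : Tm Γ α} (us : SCArgs α) → T ≃ T' → applyAllTm T us ≃ applyAllTm T' us
  applyAllTm-cong [] e = e
  applyAllTm-cong (cons u _ _ us) e = applyAllTm-cong us (≃-app e ≃-refl)

  applyAll-nf : ∀ {α} (X : Nf [] α) → EtaLong X → (us : SCArgs α) → applyAll X us ≡ nf (applyAllTm ⌜ X ⌝ us)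
  applyAll-nf X e [] = sym (stable e)
  applyAll-nf X e (cons u eu su us) =
    trans (applyAll-nf (nf (⌜ X ⌝ · ⌜ u ⌝)) (nf-EL (⌜ X ⌝ · ⌜ u ⌝)) us)
      (nf-≃ {T = applyAllTm ⌜ nf (⌜ X ⌝ · ⌜ u ⌝) ⌝ us} {T' = applyAllTm (⌜ X ⌝ · renTm ε⊆ ⌜ u ⌝) us}
        (applyAllTm-cong us (≃-trans (≃-sym (soundness (⌜ X ⌝ · ⌜ u ⌝))) (≃-app ≃-refl (≃-≡ (sym (renTm-id ⌜ u ⌝)))))))

  var0Args : ∀ α → SCArgs α
  var0Args (base b) = []
  var0Args (α ⇒ β) = cons (ηNe α (hd (fv 0))) (ηNe-EL α hd) (neutral-SC α (hd (fv 0)) (λ ()) hd (λ u ())) (var0Args β)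

  pickSCArg : ∀ {γ δ} → ArgPos γ δ → SCArgs γ → Σ (Nf [] δ) λ c → EtaLong c × SC R δ c
  pickSCArg here (cons u eu su us) = u , eu , su
  pickSCArg (there p) (cons u eu su us) = pickSCArg p us

  pickArg-evalArgs : ∀ {Γ Δ γ δ} (p : ArgPos γ δ) (cs : SCArgs γ) {ρ : Env Γ Δ} {g : GEnv Δ} →
             pickArg p (evalArgs ρ g cs) ≡ eval ρ g (renTm ε⊆ ⌜ proj₁ (pickSCArg p cs) ⌝)
  pickArg-evalArgs here (cons u _ _ cs) = refl
  pickArg-evalArgs (there p) (cons u _ _ cs) = pickArg-evalArgs p cs

  -- λx₁…xₖ. c (xₚ v₁ … vₘ) with the free variable c = fv 0: applied to SC arguments it is a
  -- neutral term whose only argument is SN, so it is SC, and it exposes the p-th argument.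
  projTm : ∀ {Γ γ δ} → ArgPos γ δ → SCArgs δ → Tm Γ γ
  projTm (here {α = δ} {β}) vs = ƛ constTm β (` fv {α = base (target δ) ⇒ base (target β)} 0 · applyAllTm (` bv here) vs)
  projTm (there p) vs = ƛ projTm p vs

  eval-projTm : ∀ {Γ Δ γ δ} (p : ArgPos γ δ) (vs : SCArgs δ) {ρ : Env Γ Δ} {g : GEnv Δ} → UniEnv ρ → UniG g →
          (as : SemArgs Δ γ) → UniArgs as →
          applySem (eval ρ g (projTm p vs)) as ≡ g (base (target δ) ⇒ base (target γ)) 0 ⊆-refl (applySem (pickArg p as) (evalClosedArgs g vs))
  eval-projTm {δ = δ} (here {β = β}) vs {ρ} {g} uρ ug (a ∷ as) (ua , uas) =
    let ue = ext-Uni ⊆-refl ua uρ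
        ug' = renG-Uni ⊆-refl ug
        Bd = ` fv {α = base (target δ) ⇒ base (target β)} 0 · applyAllTm (` bv here) vs in
    trans (applySem-Eq as uas (eval-ƛ (constTm β Bd) ⊆-refl a uρ ug ua))
     (trans (eval-constTm β Bd ue ug' as uas)
      (trans (cong (renG ⊆-refl g (base (target δ) ⇒ base (target β)) 0 ⊆-refl) (eval-applyAllTm (` bv here) vs))
       (trans (cong (λ z → g (base (target δ) ⇒ base (target β)) 0 z (applySem a (evalArgs (ext ⊆-refl a ρ) (renG ⊆-refl g) vs))) (⊆-trans-identityˡ ⊆-refl))
        (cong (g (base (target δ) ⇒ base (target β)) 0 ⊆-refl)
          (applySem-args _ _ ua (evalArgs-Uni ue ug' vs) (evalClosedArgs-Uni ug vs)
            (EqArgs-trans (evalArgs-closed ue ug' vs) (evalClosedArgs-Eq ug' ug (λ γ n → renSem-id γ _) vs)))))))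
  eval-projTm {δ = δ} (there {β = β} p) vs {ρ} {g} uρ ug (a ∷ as) (ua , uas) =
    let ue = ext-Uni ⊆-refl ua uρ
        ug' = renG-Uni ⊆-refl ug in
    trans (applySem-Eq as uas (eval-ƛ (projTm p vs) ⊆-refl a uρ ug ua))
     (trans (eval-projTm p vs ue ug' as uas)
      (trans (cong (λ z → g (base (target δ) ⇒ base (target β)) 0 z (applySem (pickArg p as) (evalClosedArgs (renG ⊆-refl g) vs))) (⊆-trans-identityˡ ⊆-refl))
        (cong (g (base (target δ) ⇒ base (target β)) 0 ⊆-refl)
          (applySem-args _ _ (pickArg-Uni p as uas) (evalClosedArgs-Uni ug' vs) (evalClosedArgs-Uni ug vs)
            (evalClosedArgs-Eq ug' ug (λ γ n → renSem-id γ _) vs)))))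

  applyAll-applySem : ∀ {δ} (c : Nf [] δ) → EtaLong c → (vs : SCArgs δ) (s : Sem δ []) → Uni δ s →
              Eq δ s (eval idEnv idGEnv ⌜ c ⌝) → ne (applySem s (evalClosedArgs idGEnv vs)) ≡ applyAll c vs
  applyAll-applySem c ec vs s us e =
    trans (cong ne (trans (applySem-Eq (evalClosedArgs idGEnv vs) (evalClosedArgs-Uni idGEnv-Uni vs) e)
                     (applySem-args _ _ (eval-Uni ⌜ c ⌝ idEnv-Uni idGEnv-Uni) (evalClosedArgs-Uni idGEnv-Uni vs) (evalArgs-Uni idEnv-Uni idGEnv-Uni vs)
                       (EqArgs-sym (evalArgs-closed idEnv-Uni idGEnv-Uni vs)))))
      (sym (trans (applyAll-nf c ec vs) (cong ne (eval-applyAllTm ⌜ c ⌝ vs))))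

  projTm-SC : ∀ {γ δ} (p : ArgPos γ δ) (vs : SCArgs δ) → SC R γ (nf (projTm p vs))
  projTm-SC {γ} {δ} p vs = SN-applyAll⇒SC γ (nf (projTm p vs)) (λ cs → subst (SN R) (sym (EQ cs)) (SNW cs))
    where
    W : SCArgs γ → Nf [] (base (target δ))
    W cs = applyAll (proj₁ (pickSCArg p cs)) vs
    EQ : ∀ cs → applyAll (nf (projTm p vs)) cs ≡ ne (app (hd (fv 0)) (W cs))
    EQ cs = trans (applyAll-nf (nf (projTm p vs)) (nf-EL (projTm p vs)) cs)
      (trans (nf-≃ {T = applyAllTm ⌜ nf (projTm p vs) ⌝ cs} {T' = applyAllTm (projTm p vs) cs} (applyAllTm-cong cs (≃-sym (soundness (projTm p vs)))))
        (cong ne (trans (eval-applyAllTm (projTm p vs) cs)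
          (trans (eval-projTm p vs idEnv-Uni idGEnv-Uni (evalArgs idEnv idGEnv cs) (evalArgs-Uni idEnv-Uni idGEnv-Uni cs))
            (cong (app (hd (fv 0)))
              (applyAll-applySem (proj₁ (pickSCArg p cs)) (proj₁ (proj₂ (pickSCArg p cs))) vs _
                (pickArg-Uni p _ (evalArgs-Uni idEnv-Uni idGEnv-Uni cs))
                (Eq-≡ δ (trans (pickArg-evalArgs p cs) (cong (eval idEnv idGEnv) (renTm-id ⌜ proj₁ (pickSCArg p cs) ⌝))))))))))
    SNW : ∀ cs → SN R (ne (app (hd (fv 0)) (W cs)))
    SNW cs = AccNe⇒SN (AccNe-args _ args) (λ { (app ()) })
      where
      args : ∀ {ζ} (u : Nf [] ζ) → ArgOf u (app (hd (fv 0)) (W cs)) → SNΓ u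
      args u last = SC⇒SN-applyAll δ _ (proj₂ (proj₂ (pickSCArg p cs))) vs
      args u (earlier ())

module Safety (B : Set) (F : Ty B → Set) where

  open HRSTheory B F
  open Syntax B F
  open Semantics B F

  module _ (R : HRS) (θ : Subst []) where

    open Reduction B F R
    open Instantiation B F θ
    open Projection B F R
    open ≡-Reasoning

    SCClosing : ∀ {Γ} → Closing Γ → Set
    SCClosing {Γ} ε = ∀ {β} (x : Γ ∋ β) → EtaLong (ε x) × SC R β (ε x)

    record SCAbstraction {γ} (l' : Nf [] γ) {α} (t : Nf [] α) : Set where
      constructor abstraction
      field
        vars        : Ctx
        body        : Nf vars α
        name        : ∀ {β} → vars ∋ β → ℕ
        body-names  : hsNf (namesHS name) body ≡ t
        body-fv     : body ⊆FV l'
        names-fresh : ∀ {β} (x : vars ∋ β) → ¬ ((β , name x) ∈FV l')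
        body-SC     : ∀ (ε : Closing vars) → SCClosing ε → SC R α (⟦ body ⟧ ε)

    var0Closing : ∀ {Γ} → Closing Γ
    var0Closing {β = β} x = ηNe β (hd (fv 0))

    var0Closing-SC : ∀ {Γ} → SCClosing (var0Closing {Γ})
    var0Closing-SC {β = β} x = ηNe-EL β hd , neutral-SC β (hd (fv 0)) (λ ()) hd (λ u ())

    SCAbstraction⇒SC : ∀ {γ α} {l' : Nf [] γ} {t : Nf [] α} → SCAbstraction l' t → t ⊆FV l' →
                       SC R α (nf ⌜ t ⌝ [ θ ]↓)
    SCAbstraction⇒SC {α = α} (abstraction Γ body name body-names body-fv names-fresh body-SC) t⊆l' =
      subst (SC R α) (sym (⟦⟧-unused body name body-names unused var0Closing))
        (body-SC var0Closing var0Closing-SC)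
      where
      unused : ∀ {β} (y : Γ ∋ β) → ¬ UsesNf body y
      unused y u = names-fresh y (t⊆l' _ (subst (_ ∈FV_) body-names (uses-fv-hsNf (namesHS name) u refl)))

    SCAbstraction-open : ∀ {γ α β} {l' : Nf [] γ} {t : Nf (α ∷ []) β} (n : ℕ) → SCAbstraction l' (lam t) →
                         ¬ (α , n) ∈FV l' → SCAbstraction l' (open0 t n)
    SCAbstraction-open {α = α} {β} {t = t} n (abstraction Γ body name body-names body-fv names-fresh body-SC) n∉l'
      with hsNf-lam-inv (namesHS name) body body-names
    ... | s , refl , s-names =
      abstraction (α ∷ Γ) s (extendNames n name) names-eq (λ x q → body-fv x (lam q))
        (λ { here → n∉l' ; (there x) → names-fresh x })
        (λ ε ε-SC → subst (SC R β) (⟦⟧-β s ε)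
           (body-SC (λ x → ε (there x)) (λ x → ε-SC (there x)) (ε here) (proj₁ (ε-SC here)) (proj₂ (ε-SC here))))
      where
      names-eq : hsNf (namesHS (extendNames n name)) s ≡ open0 t n
      names-eq = begin
        hsNf (namesHS (extendNames n name)) s
          ≡⟨ hsNf-ext _ _ (λ { here → refl ; (there x) → refl }) s ⟩
        hsNf (hsComp _ (liftHS (namesHS name))) s
          ≡⟨ sym (hsNf-∘ _ (liftHS (namesHS name)) s) ⟩
        open0 (hsNf (liftHS (namesHS name)) s) n
          ≡⟨ cong (λ z → open0 z n) s-names ⟩
        open0 t n ∎

    -- The bound variable standing for the applied name is re-bound to the new argument u.
    SCAbstraction-unapply : ∀ {γ α β} {l' : Nf [] γ} {n : Ne [] (α ⇒ β)} (m : ℕ) →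
      SCAbstraction l' (ne (app n (var↓ α m))) → ¬ (α , m) ∈FV ne n → ¬ (α , m) ∈FV l' → SCAbstraction l' (ne n)
    SCAbstraction-unapply {α = α} {β} m (abstraction Γ body name body-names body-fv names-fresh body-SC) m∉n m∉l'
      with hsNf-ne-inv (namesHS name) body body-names
    ... | N , refl , N-names with hsNe-app-inv (namesHS name) N N-names
    ... | n' , w , refl , n'-names , w-names with η-hsNf-inv α (namesHS name) w (hd (fv m)) hd w-names
    ... | hd (fv k) , _ , refl , refl = ⊥-elim (m∉l' (body-fv _ (ne (appR (η-fv α hd)))))
    ... | hd (con f) , _ , refl , ()
    ... | app _ _ , _ , refl , ()
    ... | hd (bv i) , _ , refl , refl =
      abstraction Γ (ne n') name (cong ne n'-names) (λ { x (ne q) → body-fv x (ne (appL q)) }) names-fresh n'-SC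
      where
      i-unused : ¬ UsesNf (ne n') i
      i-unused q = m∉n (subst (λ z → (α , name i) ∈FV z) (cong ne n'-names) (uses-fv-hsNf (namesHS name) q refl))

      n'-SC : ∀ (ε : Closing Γ) → SCClosing ε → SC R (α ⇒ β) (⟦ ne n' ⟧ ε)
      n'-SC ε ε-SC u u-η u-SC = subst (SC R β) (sym (⟦⟧-app-update n' i i-unused ε u))
        (body-SC (update ε i u) (update-All (λ {γ} v → EtaLong v × SC R γ v) ε i u ε-SC (u-η , u-SC)))

    -- Peels the λs of an argument λx₁…xₖ. s of a function symbol.  Since s is closed it uses none of
    -- the xᵢ, which may therefore all be named fv 0 (collapseHS).
    module UnderLambdas {Γ : Ctx} (σ : ∀ {β} → Γ ∋ β → ℕ) where

      NamesAgree : ∀ {Γ' Δ'} → HSub Γ' Δ' → HSub Γ' Γ → Set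
      NamesAgree {Γ'} σ' κ = ∀ {β} (y : Γ' ∋ β) → hsHead (namesHS σ) (κ y) ≡ hsHead collapseHS (σ' y)

      ComesFrom : ∀ {Γ' Δ'} → HSub Γ' Δ' → HSub Γ' Γ → Set
      ComesFrom {Γ'} {Δ'} σ' κ = ∀ {β} (y : Γ' ∋ β) → (Σ (Γ ∋ β) λ x → κ y ≡ bv x) ⊎ (Σ (Δ' ∋ β) λ z → σ' y ≡ bv z)

      InstAgrees : ∀ {Γ' Ξ} → Closing Γ → Sub Γ' Ξ → HSub Γ' Γ → Set
      InstAgrees {Γ'} ε τ κ = ∀ {β} (y : Γ' ∋ β) (x : Γ ∋ β) → κ y ≡ bv x → τ y ≃ renTm ε⊆ ⌜ ε x ⌝

      liftCollapse : ∀ {Γ' α} → HSub Γ' Γ → HSub (α ∷ Γ') Γ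
      liftCollapse κ here = fv 0
      liftCollapse κ (there y) = κ y

      body-under-lams : ∀ {Γ' Δ' δ Δs b} (a : Nf Γ' δ) (σ' : HSub Γ' Δ') {tᵢ : Nf Δ' δ} {s : Nf Δs (base b)} →
           Lams tᵢ s → hsNf σ' a ≡ tᵢ → (t : Nf [] (base b)) → s ≡ renNf ε⊆ t →
           (κ : HSub Γ' Γ) → NamesAgree σ' κ → ComesFrom σ' κ →
           Σ (Nf Γ (base b)) λ body → (hsNf (namesHS σ) body ≡ t) × (body ⊆FV a) ×
             (∀ (ε : Closing Γ) {Ξ} (τ : Sub Γ' Ξ) → InstAgrees ε τ κ → SNΓ (inst τ a) → SN R (⟦ body ⟧ ε))
      body-under-lams {b = b} a σ' none e t es κ names-agree comes-from = hsNf κ a , names-eq , fv-sub , SN-transfer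
        where
        names-eq : hsNf (namesHS σ) (hsNf κ a) ≡ t
        names-eq = begin
          hsNf (namesHS σ) (hsNf κ a)     ≡⟨ hsNf-∘ (namesHS σ) κ a ⟩
          hsNf (hsComp (namesHS σ) κ) a   ≡⟨ hsNf-ext _ (hsComp collapseHS σ') names-agree a ⟩
          hsNf (hsComp collapseHS σ') a   ≡⟨ sym (hsNf-∘ collapseHS σ' a) ⟩
          hsNf collapseHS (hsNf σ' a)     ≡⟨ cong (hsNf collapseHS) (trans e es) ⟩
          hsNf collapseHS (renNf ε⊆ t)    ≡⟨ hsNf-renNf-closed collapseHS t ⟩
          t                               ∎
        uses-outer : ∀ {β} (y : _ ∋ β) → UsesNf a y → (Σ (Γ ∋ β) λ x → κ y ≡ bv x)
        uses-outer y u with comes-from y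
        ... | inj₁ r = r
        ... | inj₂ (z , e') = ⊥-elim (renNf-closed-unused ε⊆ t (subst (λ w → UsesNf w z) (trans e es) (uses-hsNf σ' u e')))
        fv-sub : hsNf κ a ⊆FV a
        fv-sub (β , m) q with fv-hsNf-inv κ a q
        ... | inj₁ r = r
        ... | inj₂ (y , u , e') with uses-outer y u
        ...   | x , e'' with trans (sym e'') e'
        ...     | ()
        SN-transfer : ∀ (ε : Closing Γ) {Ξ} (τ : Sub _ Ξ) → InstAgrees ε τ κ → SNΓ (inst τ a) → SN R (⟦ hsNf κ a ⟧ ε)
        SN-transfer ε τ inst-agrees sn = SN-renNf-inv ε⊆ (subst SNΓ (inst-hsNf-local a κ ε τ agree) sn)
          where
          agree : ∀ {β} (y : _ ∋ β) → UsesNf a y → Σ (Γ ∋ β) λ x → (κ y ≡ bv x) × (τ y ≃ renTm ε⊆ ⌜ ε x ⌝)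
          agree y u with uses-outer y u
          ... | x , e' = x , e' , inst-agrees y x e'
      body-under-lams a σ' (more p) e t es κ names-agree comes-from with hsNf-lam-inv σ' a e
      ... | a' , refl , e' with body-under-lams a' (liftHS σ') p e' t es (liftCollapse κ) names-agree' comes-from'
        where
        names-agree' : NamesAgree (liftHS σ') (liftCollapse κ)
        names-agree' here = refl
        names-agree' (there y) = trans (names-agree y) (sym (collapseHS-wk (σ' y)))
        comes-from' : ComesFrom (liftHS σ') (liftCollapse κ)
        comes-from' here = inj₂ (here , refl)
        comes-from' (there y) with comes-from y
        ... | inj₁ r = inj₁ r
        ... | inj₂ (z , e'') = inj₂ (renVar wk z , cong (renHead wk) e'')
      ... | body , hs , fvs' , sem =
        body , hs , (λ x q → lam (fvs' x q)) ,
        (λ ε τ inst-agrees sn → sem ε (liftS τ) (inst-agrees' ε τ inst-agrees) (SN-lam-inv (subst SNΓ (inst-lam τ a') sn)))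
        where
        inst-agrees' : ∀ (ε : Closing Γ) {Ξ} (τ : Sub _ Ξ) → InstAgrees ε τ κ → InstAgrees ε (liftS τ) (liftCollapse κ)
        inst-agrees' ε τ inst-agrees here x ()
        inst-agrees' ε τ inst-agrees (there y) x e'' = ≃-trans (≃-ren wk (inst-agrees y x e''))
          (≃-≡ (trans (sym (renTm-trans ε⊆ wk ⌜ ε x ⌝)) (cong (λ z → renTm z ⌜ ε x ⌝) ε⊆-wk-trans)))

    -- The argument of a function symbol is SN after instantiation, hence so is its η-expanded body.
    SCAbstraction-conArg : ∀ {γ α δ Δ b} {l' : Nf [] γ} {n : Ne [] α} {tᵢ : Nf [] δ} {s : Nf Δ (base b)}
      {t : Nf [] (base b)} → SCAbstraction l' (ne n) → TopCon n → ArgOf tᵢ n → Lams tᵢ s → s ≡ renNf ε⊆ t →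
      SCAbstraction l' t
    SCAbstraction-conArg {α = α} {t = t} (abstraction Γ body name body-names body-fv names-fresh body-SC)
                         n-con tᵢ-arg tᵢ-lams s≡t
      with hsNf-ne-inv (namesHS name) body body-names
    ... | N , refl , N-names with hsNe-ArgOf-inv (namesHS name) N tᵢ-arg N-names | TopCon⇒HeadOf n-con
    ... | a , a-arg , a-names | β , f , f-head
      with hsNe-HeadOf-inv (namesHS name) N (subst (λ z → HeadOf z (con f)) (sym N-names) f-head)
    ... | bv x , _ , ()
    ... | fv m , _ , ()
    ... | con .f , N-head , refl
      with UnderLambdas.body-under-lams name a (namesHS name) tᵢ-lams a-names t s≡t
             (λ x → bv x) (λ y → refl) (λ y → inj₁ (y , refl))
    ... | body' , body'-names , body'⊆a , SN-transfer =
      abstraction Γ body' name body'-names (λ x r → body-fv x (ne (ArgOf-fv a-arg (body'⊆a x r)))) names-fresh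
        (λ ε ε-SC → SN-transfer ε (closingSub ε)
          (λ y x e → ≃-≡ (trans (cong (λ z → ⌜ ε z ⌝) (bv-injective e)) (sym (renTm-id ⌜ ε x ⌝))))
          (a-SN ε ε-SC))
      where
      a-SN : ∀ (ε : Closing Γ) → SCClosing ε → SNΓ (inst (closingSub ε) a)
      a-SN ε ε-SC with η-Subterm-arg α (instSpine (closingSub ε) N-head (con f))
                                      (ArgOf-instSpine (closingSub ε) N-head (con f) a-arg)
      ... | _ , ρ , sub = SN-renNf-inv ρ (SN-Subterm sub
            (subst SNΓ (inst-ne (closingSub ε) N-head (con f) (Eq-refl _ _))
              (SC⇒SN α _ (nf-EL (instTm (closingSub ε) (ne N))) (body-SC ε ε-SC))))

    applyAll-⟦⟧-projection : ∀ {Γ α γ δ} {N : Ne Γ α} {j : Γ ∋ γ} {a : Nf Γ δ}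
      (j-head : HeadOf N (bv j)) (a-arg : ArgOf a N) → ¬ UsesNf a j → (ε : Closing Γ) (vs : SCArgs δ) →
      applyAll (⟦ ne N ⟧ update ε j (nf (projTm (posOf j-head a-arg) vs))) (var0Args α)
      ≡ subst (λ b → Nf [] (base b)) (target-HeadOf j-head) (ne (app (hd (fv 0)) (applyAll (⟦ a ⟧ ε) vs)))
    applyAll-⟦⟧-projection {Γ} {α} {γ} {δ} {N} {j} {a} j-head a-arg a-unused ε vs =
      trans (applyAll-nf (⟦ ne N ⟧ ε'') (nf-EL (instTm (closingSub ε'') (ne N))) zs)
        (trans (nf-≃ {T = applyAllTm ⌜ ⟦ ne N ⟧ ε'' ⌝ zs} {T' = applyAllTm (instTm (closingSub ε'') (ne N)) zs}
                 (applyAllTm-cong zs (≃-sym (soundness (instTm (closingSub ε'') (ne N))))))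
          (trans (cong ne (trans (eval-applyAllTm (instTm (closingSub ε'') (ne N)) zs)
                            (trans (applySem-Eq Z uZ (eval-instTm (closingSub ε'') (ne N) idEnv-Uni idGEnv-Uni))
                              (sym (spine-sem j-head Z)))))
            (trans (ne-subst (target-HeadOf j-head) _)
              (cong (subst (λ b → Nf [] (base b)) (target-HeadOf j-head)) (cong ne head-eq)))))
      where
      pos : ArgPos γ δ
      pos = posOf j-head a-arg
      P : Nf [] γ
      P = nf (projTm pos vs)
      ε'' : Closing Γ
      ε'' = update ε j P
      zs : SCArgs α
      zs = var0Args α
      E'' E : Env Γ []
      E'' x = eval idEnv idGEnv (closingSub ε'' x)
      E x = eval idEnv idGEnv (closingSub ε x)
      uE'' : UniEnv E''
      uE'' x = eval-Uni (closingSub ε'' x) idEnv-Uni idGEnv-Uni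
      uE : UniEnv E
      uE x = eval-Uni (closingSub ε x) idEnv-Uni idGEnv-Uni
      G : GEnv []
      G = θGEnv idGEnv
      uG : UniG G
      uG = θGEnv-Uni idGEnv-Uni
      f : ∀ {ζ} → Nf Γ ζ → Sem ζ []
      f u = eval E'' G ⌜ u ⌝
      Z : SemArgs [] α
      Z = evalArgs idEnv idGEnv zs
      uZ : UniArgs Z
      uZ = evalArgs-Uni idEnv-Uni idGEnv-Uni zs
      S : SemArgs [] γ
      S = spineArgs f j-head Z
      uS : UniArgs S
      uS = spineArgs-Uni (λ u → eval-Uni ⌜ u ⌝ uE'' uG) j-head Z uZ
      E''≈E : ∀ {ζ} (y : Γ ∋ ζ) → UsesNf a y → Eq ζ (E'' y) (E y)
      E''≈E y u with update-other ε j P y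
      ... | inj₁ e = Eq-≡ _ (cong (λ z → eval idEnv idGEnv ⌜ z ⌝) e)
      ... | inj₂ refl = ⊥-elim (a-unused u)
      eval-a : Eq δ (f a) (eval idEnv idGEnv ⌜ ⟦ a ⟧ ε ⌝)
      eval-a = Eq-trans δ (eval-local a uE'' uE uG E''≈E)
                 (Eq-trans δ (Eq-sym δ (eval-instTm (closingSub ε) a idEnv-Uni idGEnv-Uni))
                   (run (soundness (instTm (closingSub ε) a)) idEnv idGEnv idEnv-Uni idGEnv-Uni))
      head-eq : applySem (E'' j) S ≡ app (hd (fv 0)) (applyAll (⟦ a ⟧ ε) vs)
      head-eq =
        trans (applySem-Eq S uS (Eq-trans γ (Eq-≡ γ (cong (λ z → eval idEnv idGEnv ⌜ z ⌝) (update-at ε j P)))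
                                  (run (≃-sym (soundness (projTm pos vs))) idEnv idGEnv idEnv-Uni idGEnv-Uni)))
          (trans (eval-projTm pos vs idEnv-Uni idGEnv-Uni S uS)
            (cong (app (hd (fv 0)))
              (applyAll-applySem (⟦ a ⟧ ε) (nf-EL (instTm (closingSub ε) a)) vs (pickArg pos S) (pickArg-Uni pos S uS)
                (Eq-trans δ (Eq-≡ δ (pick-posOf f j-head a-arg Z)) eval-a))))

    -- The head variable is instantiated by a projection onto the position of t, so strong
    -- normalisation of the whole spine transfers to t applied to arbitrary SC arguments.
    SCAbstraction-varArg : ∀ {γl α δ} {l' : Nf [] γl} {n : Ne [] α} {t : Nf [] δ} (x : Var) →
      SCAbstraction l' (ne n) → TopVar x n → ArgOf t n → (∀ {ζ} (u : Nf [] ζ) → ArgOf u n → ¬ x ∈FV u) →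
      ¬ x ∈FV l' → SCAbstraction l' t
    SCAbstraction-varArg {α = α} {δ} {t = t} (γ , m) (abstraction Γ body name body-names body-fv names-fresh body-SC)
                         x-top t-arg x∉args x∉l'
      with hsNf-ne-inv (namesHS name) body body-names
    ... | N , refl , N-names with hsNe-ArgOf-inv (namesHS name) N t-arg N-names
    ... | a , a-arg , a-names
      with hsNe-HeadOf-inv (namesHS name) N (subst (λ z → HeadOf z (fv {α = γ} m)) (sym N-names) (TopVar⇒HeadOf x-top))
    ... | fv k , N-head , refl = ⊥-elim (x∉l' (body-fv _ (ne (HeadOf-fv N-head))))
    ... | con f , N-head , ()
    ... | bv j , N-head , refl =
      abstraction Γ a name a-names (λ y r → body-fv y (ne (ArgOf-fv a-arg r))) names-fresh a-SC
      where
      a-unused : ¬ UsesNf a j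
      a-unused u = x∉args t t-arg (subst (λ w → (γ , name j) ∈FV w) a-names (uses-fv-hsNf (namesHS name) u refl))

      a-SC : ∀ (ε : Closing Γ) → SCClosing ε → SC R δ (⟦ a ⟧ ε)
      a-SC ε ε-SC = SN-applyAll⇒SC δ _ λ vs →
        let P = projTm (posOf N-head a-arg) vs in
        SN-ArgOf last (SN-subst (target-HeadOf N-head)
          (subst (SN R) (applyAll-⟦⟧-projection N-head a-arg a-unused ε vs)
            (SC⇒SN-applyAll α _
              (body-SC (update ε j (nf P))
                (update-All (λ {ζ} v → EtaLong v × SC R ζ v) ε j (nf P) ε-SC (nf-EL P , projTm-SC (posOf N-head a-arg) vs)))
              (var0Args α))))

    module _ (ρr : Rule) (hyp : ArgsSC R (Rule.lhs ρr [ θ ]↓)) where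

      lhs-arg-EL : ∀ {γ} {l' : Nf [] γ} → IsArg l' (Rule.lhs ρr) → EtaLong l'
      lhs-arg-EL p with Rule.lhs ρr | Rule.lhs-η ρr
      lhs-arg-EL (isArg q) | ne n | ne e = ArgOf-EL q e

      SCAbstraction-arg : ∀ {γ} (l' : Nf [] γ) → IsArg l' (Rule.lhs ρr) → SCAbstraction l' l'
      SCAbstraction-arg l' l'-arg = abstraction [] l' (λ ()) (hsNf-closed _ l') (λ x q → q) (λ ())
        (λ ε _ → subst (SC R _) (sym (inst-closed (closingSub ε) l')) (hyp _ (IsArg-[]↓ ρr θ l'-arg)))

      -- sθ is a subterm of l'θ, and l'θ is SN as an argument of lθ.
      SCAbstraction-stable : ∀ {γ b} {l' : Nf [] γ} → IsArg l' (Rule.lhs ρr) →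
        ∀ {Δ} {s : Nf Δ (base b)} {t : Nf [] (base b)} → SSub l' s → s ≡ renNf ε⊆ t → t ⊆FV l' →
        SCAbstraction l' t
      SCAbstraction-stable {l' = l'} l'-arg {t = t} s-stable refl t⊆l' =
        abstraction [] t (λ ()) (hsNf-closed _ t) t⊆l' (λ ())
          (λ ε _ → subst (SN R) (sym (inst-closed (closingSub ε) t))
            (SN-renNf-inv ε⊆ (subst SNΓ (inst-renNf-closed t)
              (SN-Subterm (SSub-inst-Subterm l' l' s-stable (lhs-arg-EL l'-arg) (λ x q → q))
                (subst SNΓ (sym (inst-closed idS l'))
                  (SC⇒SN _ (l' [ θ ]↓) (nf-EL (substTm θ l')) (hyp _ (IsArg-[]↓ ρr θ l'-arg))))))))

      Accs⇒SCAbstraction : ∀ {γ α} {l' : Nf [] γ} → IsArg l' (Rule.lhs ρr) → {t : Nf [] α} → Accs l' t → SCAbstraction l' t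
      Accs⇒SCAbstraction {l' = l'} p acc0 = SCAbstraction-arg l' p
      Accs⇒SCAbstraction p (acc1 ss e tsub) = SCAbstraction-stable p ss e tsub
      Accs⇒SCAbstraction p (acc2 n a nl nt) = SCAbstraction-open n (Accs⇒SCAbstraction p a) nl
      Accs⇒SCAbstraction p (acc3 m a nfn nfl) = SCAbstraction-unapply m (Accs⇒SCAbstraction p a) nfn nfl
      Accs⇒SCAbstraction p (acc4 a tc q lm es) = SCAbstraction-conArg (Accs⇒SCAbstraction p a) tc q lm es
      Accs⇒SCAbstraction p (acc5 x a tv q nfa nfl) = SCAbstraction-varArg x (Accs⇒SCAbstraction p a) tv q nfa nfl

lemma2 : (B : Set) (F : Ty B → Set) → let open HRSTheory B F in
    (R : HRS) (ρ : Rule) → R ρ → (θ : Subst []) →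
    ∀ {α} (t : Nf [] α) → Safe (Rule.lhs ρ) t →
    ArgsSC R (Rule.lhs ρ [ θ ]↓) → SC R α (t [ θ ]↓)
lemma2 B F R ρ _ θ t t-safe hyp = safe⇒SC t-safe
  where
  open HRSTheory B F
  open Safety B F

  safe⇒SC : ∀ {α} {t : Nf [] α} → Safe (Rule.lhs ρ) t → SC R α (t [ θ ]↓)
  safe⇒SC (safe l'∈args t∈Acc t⊆l' refl) =
    SCAbstraction⇒SC R θ (Accs⇒SCAbstraction R θ ρ hyp l'∈args t∈Acc) t⊆l'
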